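{- Let $G=(V,E)$ be a connected graph with $n$ nodes and $r\in V$. At the end of Algorithm 1 (described in the context) run on $G$ with root $r$, all nodes are in state $\mathsf{DONE}$. Moreover, if $r$ is in state $\mathsf{DONE}$ then all other nodes are in state $\mathsf{DONE}$ as well.
   Context: Asynchronous model: no timing assumptions; a node is asleep until it receives a message, then performs local computation, sends messages and sleeps; channels are not assumed FIFO; messages may be arbitrarily (finitely) delayed. Each node knows its neighbor set $\mathcal{N}_u$ and $n$. Algorithm 1 (content-oblivious BFS): nodes never look at message content. Each node has a state in $\{\mathsf{INIT},\mathsf{IDLE},\mathsf{EXPLORE},\mathsf{DONE}\}$; all start in $\mathsf{INIT}$. The root $r$ sets $\mathit{parent}_r=\bot$, $\mathit{children}_r=\mathcal{N}_r$, $\mathit{count}_r=0$, state $\mathsf{IDLE}$, and while its state is not $\mathsf{DONE}$ repeatedly invokes Explore. (SetParent) A node $u$ in state $\mathsf{INIT}$ receiving a message from $v$ sets $\mathit{parent}_u=v$, $\mathit{children}_u=\mathcal{N}_u\setminus\{v\}$, $\mathit{count}_u=0$, state $\mathsf{IDLE}$, and sends a message to $v$. (MarkSibling) A node $u$ in state $\mathsf{IDLE}$ or $\mathsf{DONE}$ receiving a message from $v\ne\mathit{parent}_u$ removes $v$ from $\mathit{children}_u$ and sends a message to $v$. (Explore) A node $u$ in state $\mathsf{IDLE}$ receiving a message from $\mathit{parent}_u$ (or the root invoking it): sets state $\mathsf{EXPLORE}$, increments $\mathit{count}_u$; sequentially for each $v\in\mathcal{N}_u\setminus\{\mathit{parent}_u\}$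 sends a message to $v$ and waits for a message from $v$; if $\mathit{count}_u=n-1$ it additionally, sequentially for each $v\in\mathit{children}_u$, sends a message to $v$ and waits for a message from $v$; then sends a message to $\mathit{parent}_u$; finally sets state $\mathsf{DONE}$ if $\mathit{count}_u=n-1$ and $\mathsf{IDLE}$ otherwise. -}

module Defs where

open import Data.Nat using (ℕ; zero; suc; _∸_)
open import Data.Bool using (Bool; true; false; if_then_else_)
open import Data.Fin using (Fin; _≟_)
open import Data.Fin.Subset using (Subset; _∈_; _-_; Empty)
open import Data.Maybe using (Maybe; just; nothing)
open import Data.Vec using (tabulate)
open import Data.Product using (Σ; _×_; _,_)
open import Data.Sum using (_⊎_)
open import Relation.Nullary using (¬_; does)
open import Relation.Binary.PropositionalEquality using (_≡_; _≢_)
open import Relation.Binary.Construct.Closure.ReflexiveTransitive using (Star)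

record Graph (n : ℕ) : Set where
  field
    adj   : Fin n → Fin n → Bool
    sym   : ∀ u v → adj u v ≡ adj v u
    irrefl : ∀ u → adj u u ≡ false

  Edge : Fin n → Fin n → Set
  Edge u v = adj u v ≡ true

  𝒩 : Fin n → Subset n
  𝒩 u = tabulate (adj u)

data Reach {n : ℕ} (G : Graph n) : Fin n → Fin n → Set where
  here : ∀ {u} → Reach G u u
  step : ∀ {u v w} → Graph.Edge G u v → Reach G v w → Reach G u w

Connected : {n : ℕ} → Graph n → Set
Connected G = ∀ u v → Reach G u v

data Status : Set where
  INIT IDLE EXPLORE DONE : Status

-- phase 1 : loop over 𝒩_u ∖ {parent_u};  phase 2 : loop over children_u
data Phase : Set where
  ph1 ph2 : Phase

-- The fields phase / rem / waiting form the
-- program counter of the (sequential) Explore procedure and are only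
-- meaningful while status = EXPLORE:
--   rem     = targets of the current loop not yet handled
--   waiting = just v  : has sent to v and waits for a message from v
--             nothing : not waiting (about to continue the procedure)
record Local (n : ℕ) : Set where
  field
    status   : Status
    parent   : Maybe (Fin n)
    children : Subset n
    count    : ℕ
    phase    : Phase
    rem      : Subset n
    waiting  : Maybe (Fin n)
open Local public

-- Configuration: local states and the number of (content-free) messages
-- in transit on each directed channel  (chan u v = # messages u → v).
-- Channels are not FIFO and messages carry no content, so a count suffices.
record Config (n : ℕ) : Set where
  field
    loc  : Fin n → Local n
    chan : Fin n → Fin n → ℕ
open Config public

upd : ∀ {n} {A : Set} → (Fin n → A) → Fin n → A → Fin n → A
upd f u x w = if does (w ≟ u) then x else f w

send : ∀ {n} → (Fin n → Fin n → ℕ) → Fin n → Fin n → Fin n → Fin n → ℕ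
send c u v = upd c u (upd (c u) v (suc (c u v)))

consume : ∀ {n} → (Fin n → Fin n → ℕ) → Fin n → Fin n → Fin n → Fin n → ℕ
consume c u v = upd c u (upd (c u) v (c u v ∸ 1))

sendParent : ∀ {n} → (Fin n → Fin n → ℕ) → Fin n → Maybe (Fin n)
           → Fin n → Fin n → ℕ
sendParent c u nothing  = c
sendParent c u (just p) = send c u p

initLocal : ∀ {n} → Local n
initLocal = record
  { status = INIT ; parent = nothing ; children = tabulate (λ _ → false)
  ; count = 0 ; phase = ph1 ; rem = tabulate (λ _ → false) ; waiting = nothing }

initConfig : ∀ {n} → Config n
initConfig = record { loc = λ _ → initLocal ; chan = λ _ _ → 0 }

module Algorithm {n : ℕ} (G : Graph n) (r : Fin n) where
  open Graph G

  others : Fin n → Maybe (Fin n) → Subset n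
  others u nothing  = 𝒩 u
  others u (just p) = 𝒩 u - p

  beginExplore : Fin n → Local n → Local n
  beginExplore u l = record l
    { status = EXPLORE ; count = suc (count l) ; phase = ph1
    ; rem = others u (parent l) ; waiting = nothing }

  data _⟶_ : Config n → Config n → Set where
    rootWake : ∀ {c} → status (loc c r) ≡ INIT →
      c ⟶ record c { loc = upd (loc c) r (beginExplore r (record (loc c r)
              { status = IDLE ; parent = nothing ; children = 𝒩 r ; count = 0 })) }
    setParent : ∀ {c u v k} → chan c v u ≡ suc k → status (loc c u) ≡ INIT →
      c ⟶ record
        { loc  = upd (loc c) u (record (loc c u)
                   { status = IDLE ; parent = just v ; children = 𝒩 u - v ; count = 0 })
        ; chan = send (consume (chan c) v u) u v }
    markSibling : ∀ {c u v k} → chan c v u ≡ suc k →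
      (status (loc c u) ≡ IDLE ⊎ status (loc c u) ≡ DONE) →
      parent (loc c u) ≢ just v →
      c ⟶ record
        { loc  = upd (loc c) u (record (loc c u) { children = children (loc c u) - v })
        ; chan = send (consume (chan c) v u) u v }
    explore : ∀ {c u v k} → chan c v u ≡ suc k → status (loc c u) ≡ IDLE →
      parent (loc c u) ≡ just v →
      c ⟶ record
        { loc  = upd (loc c) u (beginExplore u (loc c u))
        ; chan = consume (chan c) v u }
    reply : ∀ {c u v k} → chan c v u ≡ suc k → status (loc c u) ≡ EXPLORE →
      waiting (loc c u) ≡ just v →
      c ⟶ record
        { loc  = upd (loc c) u (record (loc c u) { waiting = nothing })
        ; chan = consume (chan c) v u }
    -- inside Explore: send to the next target v of the current loop
    -- (the order of the loop is arbitrary)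
    next : ∀ {c u v} → status (loc c u) ≡ EXPLORE → waiting (loc c u) ≡ nothing →
      v ∈ rem (loc c u) →
      c ⟶ record
        { loc  = upd (loc c) u (record (loc c u)
                   { rem = rem (loc c u) - v ; waiting = just v })
        ; chan = send (chan c) u v }
    toPhase2 : ∀ {c u} → status (loc c u) ≡ EXPLORE → waiting (loc c u) ≡ nothing →
      Empty (rem (loc c u)) → phase (loc c u) ≡ ph1 → count (loc c u) ≡ n ∸ 1 →
      c ⟶ record c
        { loc = upd (loc c) u (record (loc c u)
                  { phase = ph2 ; rem = children (loc c u) }) }
    finishDone : ∀ {c u} → status (loc c u) ≡ EXPLORE → waiting (loc c u) ≡ nothing →
      Empty (rem (loc c u)) → phase (loc c u) ≡ ph2 →
      c ⟶ record
        { loc  = upd (loc c) u (record (loc c u) { status = DONE })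
        ; chan = sendParent (chan c) u (parent (loc c u)) }
    finishIdle : ∀ {c u} → status (loc c u) ≡ EXPLORE → waiting (loc c u) ≡ nothing →
      Empty (rem (loc c u)) → phase (loc c u) ≡ ph1 → count (loc c u) ≢ n ∸ 1 →
      u ≢ r →
      c ⟶ record
        { loc  = upd (loc c) u (record (loc c u) { status = IDLE })
        ; chan = sendParent (chan c) u (parent (loc c u)) }
    rootRestart : ∀ {c} → status (loc c r) ≡ EXPLORE → waiting (loc c r) ≡ nothing →
      Empty (rem (loc c r)) → phase (loc c r) ≡ ph1 → count (loc c r) ≢ n ∸ 1 →
      c ⟶ record c
        { loc = upd (loc c) r (beginExplore r (record (loc c r) { status = IDLE })) }

  Reachable : Config n → Set
  Reachable c = Star _⟶_ initConfig c

  -- "the end" of the algorithm: no further event can happen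
  Terminal : Config n → Set
  Terminal c = ∀ c' → ¬ (c ⟶ c')

module Submission where

-- The proof is an inductive invariant.  For n ≥ 2 nodes, a record Inv c d
-- describes every reachable configuration c together with a "depth"
-- labelling d (the BFS layer in which a node was woken).  Its key components:
--   * the parent pointers form a tree rooted at r, with d increasing by one
--     along parent edges, and d is a BFS labelling (adjacent woken nodes have
--     depths differing by at most one);
--   * the EXPLORE nodes form a path from r down the tree, exactly one of them
--     (the "tip") is active, and every channel holds at most one message, sent
--     or awaited by the tip;
--   * counters decrease by one per tree level below an exploring node; this
--     ties the number of completed rounds of r to the depth explored so far.
-- Two consequences of Inv then give the theorem: (progress) while r is
-- EXPLORE, following the path of waiting nodes from r reaches a node that can
-- move, so a terminal configuration has r DONE; (completion) DONE propagates
-- down the tree, and once r is DONE every neighbour of a DONE node has been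
-- woken, so by connectivity every node is woken and hence DONE.  The graph
-- with a single node is degenerate (the root restarts forever) and is handled
-- by a small separate invariant.

open import Defs
open import Data.Nat using (ℕ; zero; suc; _≤_; _<_; _+_; _∸_; z≤n; s≤s) renaming (_≟_ to _≟ℕ_)
open import Data.Nat.Properties hiding (_≟_)
open import Data.Fin using (Fin; toℕ; _≟_; punchOut) renaming (zero to fz; suc to fs)
open import Data.Fin.Properties using (punchOut-injective; pigeonhole; toℕ<n)
open import Data.Fin.Subset using (Subset; _∈_; _∉_; _-_; _─_; Empty; ⁅_⁆; inside; outside)
open import Data.Fin.Subset.Properties using (nonempty?; x∈p∧x≢y⇒x∈p-y; p─q⊆p; x∈⁅x⁆)
open import Data.Bool using (Bool; true; false; if_then_else_)
open import Data.Maybe using (Maybe; just; nothing)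
open import Data.Maybe.Properties using (just-injective)
import Data.Maybe.Properties as Maybe
open import Data.Product
open import Data.Sum
open import Data.Empty
open import Relation.Nullary
open import Relation.Nullary.Decidable using (dec-true; dec-false)
open import Relation.Binary.PropositionalEquality
open import Data.Vec using (tabulate; _∷_; here; there)
open import Data.Vec.Properties using (lookup∘tabulate; []=⇒lookup; lookup⇒[]=)
open import Relation.Binary.Construct.Closure.ReflexiveTransitive using (Star; ε; _◅_)
open import Function using (_∘_)

Star-invariant : ∀ {A : Set} {_⟶_ : A → A → Set} (Good : A → Set) →
  (∀ {a b} → Good a → a ⟶ b → Good b) → ∀ {a b} → Good a → Star _⟶_ a b → Good b
Star-invariant Good preserved g ε = g
Star-invariant Good preserved g (s ◅ ss) = Star-invariant Good preserved (preserved g s) ss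

upd-here : ∀ {n} {A : Set} (f : Fin n → A) u x → upd f u x u ≡ x
upd-here f u x = cong (λ b → if b then x else f u) (dec-true (u ≟ u) refl)

upd-other : ∀ {n} {A : Set} (f : Fin n → A) u x w → w ≢ u → upd f u x w ≡ f w
upd-other f u x w ne = cong (λ b → if b then x else f w) (dec-false (w ≟ u) ne)

-- Each transition changes only a
-- few fields of a single node, and this lemma gives all the other fields.
upd-frame : ∀ {n} {A B : Set} (f : A → B) (l : Fin n → A) u L →
  f L ≡ f (l u) → ∀ w → f (upd l u L w) ≡ f (l w)
upd-frame f l u L same w with w ≟ u
... | yes refl = same
... | no _ = refl

upd₂-here : ∀ {n} {A : Set} (c : Fin n → Fin n → A) u v x → upd c u (upd (c u) v x) u v ≡ x
upd₂-here c u v x = trans (cong (λ g → g v) (upd-here c u _)) (upd-here (c u) v x)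

upd₂-other : ∀ {n} {A : Set} (c : Fin n → Fin n → A) u v x a b → (a ≢ u ⊎ b ≢ v) →
  upd c u (upd (c u) v x) a b ≡ c a b
upd₂-other c u v x a b (inj₁ a≢u) = cong (λ g → g b) (upd-other c u _ a a≢u)
upd₂-other c u v x a b (inj₂ b≢v) with a ≟ u
... | yes refl = upd-other (c u) v x b b≢v
... | no _ = refl

send-here : ∀ {n} (c : Fin n → Fin n → ℕ) u v → send c u v u v ≡ suc (c u v)
send-here c u v = upd₂-here c u v _

send-other : ∀ {n} (c : Fin n → Fin n → ℕ) u v a b → (a ≢ u ⊎ b ≢ v) → send c u v a b ≡ c a b
send-other c u v = upd₂-other c u v _

consume-here : ∀ {n} (c : Fin n → Fin n → ℕ) u v → consume c u v u v ≡ c u v ∸ 1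
consume-here c u v = upd₂-here c u v _

consume-other : ∀ {n} (c : Fin n → Fin n → ℕ) u v a b → (a ≢ u ⊎ b ≢ v) → consume c u v a b ≡ c a b
consume-other c u v = upd₂-other c u v _

sendParent-here : ∀ {n} (c : Fin n → Fin n → ℕ) u mp p → mp ≡ just p → sendParent c u mp u p ≡ suc (c u p)
sendParent-here c u (just p) p refl = send-here c u p

sendParent-other : ∀ {n} (c : Fin n → Fin n → ℕ) u mp a b → (mp ≡ just b → a ≢ u) →
  sendParent c u mp a b ≡ c a b
sendParent-other c u nothing a b h = refl
sendParent-other c u (just p) a b h = send-other c u p a b off-channel
  where
  off-channel : a ≢ u ⊎ b ≢ p
  off-channel with a ≟ u
  ... | yes refl = inj₂ λ { refl → h refl refl }
  ... | no a≢u = inj₁ a≢u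

true⇒∈tabulate : ∀ {n} (f : Fin n → Bool) x → f x ≡ true → x ∈ tabulate f
true⇒∈tabulate f x e = lookup⇒[]= x (tabulate f) (trans (lookup∘tabulate f x) e)

∈tabulate⇒true : ∀ {n} (f : Fin n → Bool) x → x ∈ tabulate f → f x ≡ true
∈tabulate⇒true f x h = trans (sym (lookup∘tabulate f x)) ([]=⇒lookup h)

x∈p─q⇒x∉q : ∀ {n} (p q : Subset n) x → x ∈ p ─ q → x ∉ q
x∈p─q⇒x∉q (b ∷ p) (inside ∷ q) fz () here
x∈p─q⇒x∉q (b ∷ p) (outside ∷ q) fz h ()
x∈p─q⇒x∉q (b ∷ p) (c ∷ q) (fs x) (there h) (there h') = x∈p─q⇒x∉q p q x h h'

x∈p-y⇒x≢y : ∀ {n} (p : Subset n) x y → x ∈ p - y → x ≢ y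
x∈p-y⇒x≢y p x y h refl = x∈p─q⇒x∉q p ⁅ y ⁆ x h (x∈⁅x⁆ x)

x∈p-y⇒x∈p : ∀ {n} (p : Subset n) x y → x ∈ p - y → x ∈ p
x∈p-y⇒x∈p p x y h = p─q⊆p p ⁅ y ⁆ h

EXPLORE≢IDLE : EXPLORE ≢ IDLE
EXPLORE≢IDLE ()
IDLE≢EXPLORE : IDLE ≢ EXPLORE
IDLE≢EXPLORE ()
EXPLORE≢DONE : EXPLORE ≢ DONE
EXPLORE≢DONE ()
DONE≢IDLE : DONE ≢ IDLE
DONE≢IDLE ()
IDLE≢DONE : IDLE ≢ DONE
IDLE≢DONE ()
DONE≢INIT : DONE ≢ INIT
DONE≢INIT ()
IDLE≢INIT : IDLE ≢ INIT
IDLE≢INIT ()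
ph1≢ph2 : ph1 ≢ ph2
ph1≢ph2 ()
ph2≢ph1 : ph2 ≢ ph1
ph2≢ph1 ()
nothing≢just : ∀ {A : Set} {a : A} → nothing ≢ just a
nothing≢just ()

module BFS {m : ℕ} (G : Graph (suc (suc m))) (r : Fin (suc (suc m))) where
  N : ℕ
  N = suc (suc m)
  open Graph G using (adj; Edge; 𝒩; irrefl) renaming (sym to adjSym)
  open Algorithm G r

  Cfg : Set
  Cfg = Config N

  S : Cfg → Fin N → Status
  S c u = status (loc c u)
  P : Cfg → Fin N → Maybe (Fin N)
  P c u = parent (loc c u)
  K : Cfg → Fin N → ℕ
  K c u = count (loc c u)
  Ph : Cfg → Fin N → Phase
  Ph c u = phase (loc c u)
  Rm : Cfg → Fin N → Subset N
  Rm c u = rem (loc c u)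
  W : Cfg → Fin N → Maybe (Fin N)
  W c u = waiting (loc c u)
  Cs : Cfg → Fin N → Subset N
  Cs c u = children (loc c u)
  ch : Cfg → Fin N → Fin N → ℕ
  ch c = chan c

  Woken : Cfg → Fin N → Set
  Woken c u = S c u ≢ INIT

  Req : Cfg → Fin N → Fin N → Set
  Req c a b = S c a ≡ EXPLORE × W c a ≡ just b × S c b ≢ EXPLORE

  -- x is the active exploring node: it is about to act, or the message of
  -- its current exchange is in transit.
  Tip : Cfg → Fin N → Set
  Tip c x = S c x ≡ EXPLORE × (W c x ≡ nothing ⊎ Σ (Fin N) λ b → W c x ≡ just b × (ch c x b ≡ 1 ⊎ ch c b x ≡ 1))

  -- w has completed at least one Explore (or is in its final round).
  Fin1 : Cfg → Fin N → Set
  Fin1 c w = (S c w ≡ IDLE × 1 ≤ K c w) ⊎ S c w ≡ DONE ⊎ (S c w ≡ EXPLORE × (2 ≤ K c w ⊎ Ph c w ≡ ph2))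

  -- State of a child y of a node p exploring in loop 1: children not yet
  -- visited are two rounds behind, visited ones one round behind.
  T1 : Cfg → Fin N → Fin N → Set
  T1 c p y = (y ∈ Rm c p → S c y ≡ IDLE × suc (suc (K c y)) ≡ K c p)
           × (y ∉ Rm c p → W c p ≢ just y → S c y ≡ IDLE × suc (K c y) ≡ K c p)
           × (W c p ≡ just y → (ch c p y ≡ 1 × S c y ≡ IDLE × suc (suc (K c y)) ≡ K c p)
                             ⊎ (ch c p y ≡ 0 × suc (K c y) ≡ K c p × (S c y ≡ EXPLORE ⊎ S c y ≡ IDLE)))

  -- The same for the final loop 2 over the children: visited children are DONE.
  T2 : Cfg → Fin N → Fin N → Set
  T2 c p y = (y ∈ Rm c p → S c y ≡ IDLE × suc (K c y) ≡ K c p)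
           × (y ∉ Rm c p → W c p ≢ just y → S c y ≡ DONE)
           × (W c p ≡ just y → (ch c p y ≡ 1 × S c y ≡ IDLE × suc (K c y) ≡ K c p)
                             ⊎ (ch c p y ≡ 0 × K c y ≡ K c p × (S c y ≡ EXPLORE ⊎ S c y ≡ DONE)))

  record Inv (c : Cfg) (d : Fin N → ℕ) : Set where
    field
      rootSt : S c r ≡ EXPLORE ⊎ S c r ≡ DONE
      rootPa : P c r ≡ nothing
      rootD  : d r ≡ 0
      initPa : ∀ y → S c y ≡ INIT → P c y ≡ nothing
      par    : ∀ u → u ≢ r → Woken c u → Σ (Fin N) λ p → P c u ≡ just p × Edge p u × Woken c p × d u ≡ suc (d p)
      chanE  : ∀ a b → ch c a b ≢ 0 → ch c a b ≡ 1 × ch c b a ≡ 0 × Woken c a × (Req c a b ⊎ Req c b a)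
      waitE  : ∀ a b → S c a ≡ EXPLORE → W c a ≡ just b → ch c a b ≡ 1 ⊎ ch c b a ≡ 1 ⊎ (S c b ≡ EXPLORE × P c b ≡ just a)
      -- the exploring nodes form a path from the root whose deepest node is the tip
      explPar : ∀ x q → S c x ≡ EXPLORE → P c x ≡ just q → S c q ≡ EXPLORE × W c q ≡ just x
      explUniq : ∀ x y → S c x ≡ EXPLORE → S c y ≡ EXPLORE → d x ≡ d y → x ≡ y
      tipDeep : ∀ x y → Tip c x → S c y ≡ EXPLORE → d y ≤ d x
      waitOK : ∀ x b → S c x ≡ EXPLORE → W c x ≡ just b → Edge x b × P c x ≢ just b × b ∉ Rm c x
      remOK : ∀ x b → S c x ≡ EXPLORE → b ∈ Rm c x → Edge x b × P c x ≢ just b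
      chOK : ∀ x b → Woken c x → b ∈ Cs c x → Edge x b × P c x ≢ just b
      chAll : ∀ p y → Woken c p → Edge p y → P c p ≢ just y → (S c y ≡ INIT ⊎ P c y ≡ just p) → y ∈ Cs c p
      kMax : ∀ u → K c u ≤ suc m
      kExpl : ∀ u → S c u ≡ EXPLORE ⊎ S c u ≡ DONE → 1 ≤ K c u
      kIdle : ∀ u → S c u ≡ IDLE → K c u ≢ suc m
      kPh2 : ∀ u → S c u ≡ EXPLORE → Ph c u ≡ ph2 → K c u ≡ suc m
      treeIdle : ∀ p y → P c y ≡ just p → S c p ≡ IDLE → S c y ≡ IDLE × suc (K c y) ≡ K c p
      treeDone : ∀ p y → P c y ≡ just p → S c p ≡ DONE → S c y ≡ DONE
      tree1 : ∀ p y → P c y ≡ just p → S c p ≡ EXPLORE → Ph c p ≡ ph1 → T1 c p y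
      tree2 : ∀ p y → P c y ≡ just p → S c p ≡ EXPLORE → Ph c p ≡ ph2 → T2 c p y
      -- neighbours of nodes that have sent to all neighbours are woken
      nb : ∀ w x → Edge w x → Fin1 c w → Woken c x
      nb3 : ∀ w x → S c w ≡ EXPLORE → Ph c w ≡ ph1 → Edge w x → x ∉ Rm c w → W c w ≢ just x → Woken c x
      dMax : ∀ w → Woken c w → d w ≤ K c r
      nbd : ∀ w x → Woken c w → 2 + d w ≤ K c r → Edge w x → Woken c x
      bfs : ∀ a b → Edge a b → Woken c a → Woken c b → d a ≤ suc (d b)

  cases≡ : ∀ {A : Set} (a b : Fin N) → (a ≡ b → A) → (a ≢ b → A) → A
  cases≡ a b f g with a ≟ b
  ... | yes e = f e
  ... | no ne = g ne

  no-loop : ∀ {u} → Edge u u → ⊥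
  no-loop {u} e with trans (sym e) (irrefl u)
  ... | ()

  edge-sym : ∀ {a b} → Edge a b → Edge b a
  edge-sym {a} {b} e = trans (adjSym b a) e

  edge⇒≢ : ∀ {a b} → Edge a b → a ≢ b
  edge⇒≢ e refl = no-loop e

  explore⇒woken : ∀ c u → S c u ≡ EXPLORE → Woken c u
  explore⇒woken c u e e' with trans (sym e) e'
  ... | ()

  phCase : (x : Phase) → x ≡ ph1 ⊎ x ≡ ph2
  phCase ph1 = inj₁ refl
  phCase ph2 = inj₂ refl

  module InvFacts {c : Cfg} {d : Fin N → ℕ} (I : Inv c d) where
    open Inv I

    rootWoken : Woken c r
    rootWoken e with rootSt
    ... | inj₁ x with trans (sym x) e
    ... | ()
    rootWoken e | inj₂ x with trans (sym x) e
    ... | ()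

    initNotRoot : ∀ {u} → S c u ≡ INIT → u ≢ r
    initNotRoot e refl = rootWoken e

    paWoken : ∀ {y p} → P c y ≡ just p → Woken c y
    paWoken {y} e e' with trans (sym (initPa y e')) e
    ... | ()

    paNotRoot : ∀ {y p} → P c y ≡ just p → y ≢ r
    paNotRoot e refl with trans (sym rootPa) e
    ... | ()

    paInfo : ∀ {y p} → P c y ≡ just p → Edge p y × Woken c p × d y ≡ suc (d p)
    paInfo {y} {p} e with par y (paNotRoot e) (paWoken e)
    ... | p' , e' , ed , ip , dd with just-injective (trans (sym e') e)
    ... | refl = ed , ip , dd

    noCyc : ∀ {y p} → P c y ≡ just p → P c p ≢ just y
    noCyc e1 e2 with proj₂ (proj₂ (paInfo e1)) | proj₂ (proj₂ (paInfo e2))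
    ... | d1 | d2 = m≢1+n+m _ {1} (trans d1 (cong suc d2))

    dZeroRoot : ∀ {u} → Woken c u → d u ≡ 0 → u ≡ r
    dZeroRoot {u} iu e with u ≟ r
    ... | yes eq = eq
    ... | no ne with par u ne iu
    ... | _ , _ , _ , _ , dd with trans (sym e) dd
    ... | ()

    reqTip : ∀ {a b} → Req c a b → (ch c a b ≡ 1 ⊎ ch c b a ≡ 1) → Tip c a
    reqTip (e , w , _) h = e , inj₂ (_ , w , h)

    tipUniq : ∀ {x y} → Tip c x → Tip c y → x ≡ y
    tipUniq tx ty = explUniq _ _ (proj₁ tx) (proj₁ ty)
      (≤-antisym (tipDeep _ _ ty (proj₁ tx)) (tipDeep _ _ tx (proj₁ ty)))

    exIdle : ∀ u → S c u ≡ EXPLORE → S c u ≢ IDLE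
    exIdle u e e' = EXPLORE≢IDLE (trans (sym e) e')

    -- Going up the exploring path from x, count + depth is constant (one round
    -- per level), unless an ancestor is in its last loop, where it is ≥ N.
    chainL : ∀ k x → d x ≡ k → S c x ≡ EXPLORE → K c x + d x ≡ K c r ⊎ N ≤ K c x + d x
    chainL zero x dx ex with dZeroRoot (explore⇒woken c x ex) dx
    ... | refl = inj₁ (trans (cong (K c r +_) dx) (+-identityʳ _))
    chainL (suc k) x dx ex with x ≟ r
    ... | yes refl with trans (sym rootD) dx
    ...   | ()
    chainL (suc k) x dx ex | no ne with par x ne (explore⇒woken c x ex)
    ... | p , pe , _ , _ , dd with explPar x p ex pe | suc-injective (trans (sym dd) dx)
    ... | exp , wp | dp with chainL k p dp exp | phCase (Ph c p)
    ... | ih | inj₁ p1 with proj₂ (proj₂ (tree1 p x pe exp p1)) wp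
    ...   | inj₁ (_ , ix , _) = ⊥-elim (exIdle x ex ix)
    ...   | inj₂ (_ , kk , _) = subst (λ z → z ≡ K c r ⊎ N ≤ z) (sym eq) ih
      where
      eq : K c x + d x ≡ K c p + d p
      eq = trans (cong (K c x +_) dd) (trans (+-suc (K c x) (d p)) (cong (_+ d p) kk))
    chainL (suc k) x dx ex | no ne | p , pe , _ , _ , dd | exp , wp | dp | ih | inj₂ p2 with proj₂ (proj₂ (tree2 p x pe exp p2)) wp
    ...   | inj₁ (_ , ix , _) = ⊥-elim (exIdle x ex ix)
    ...   | inj₂ (_ , kk , _) = inj₂ le
      where
      le : N ≤ K c x + d x
      le = subst (N ≤_) (sym (cong₂ _+_ (trans kk (kPh2 p exp p2)) dd))
             (s≤s (subst (suc m ≤_) (sym (+-suc m (d p))) (s≤s (m≤m+n m (d p)))))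

    mb : Maybe (Fin N) → Fin N → Fin N
    mb (just q) _ = q
    mb nothing x = x

    up : Fin N → Fin N
    up x = mb (P c x) x

    anc : ℕ → Fin N → Fin N
    anc zero x = x
    anc (suc k) x = up (anc k x)

    upPar : ∀ {x q} → P c x ≡ just q → up x ≡ q
    upPar {x} e rewrite e = refl

    ancL : ∀ p → Woken c p → ∀ k → k ≤ d p → Woken c (anc k p) × d (anc k p) + k ≡ d p
    ancL p ip zero _ = ip , +-identityʳ _
    ancL p ip (suc k) le with ancL p ip k (≤-trans (n≤1+n k) le)
    ... | ix , de with anc k p ≟ r
    ...   | yes eq = ⊥-elim (<-irrefl refl (≤-trans (subst (λ z → suc k ≤ z) (sym de) le) (≤-reflexive dd)))
      where
      dd : d (anc k p) + k ≡ k
      dd = cong (_+ k) (trans (cong d eq) rootD)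
    ...   | no ne with par (anc k p) ne ix
    ...     | q , qe , _ , iq , dq rewrite upPar qe = iq , trans (+-suc (d q) k) (trans (cong (_+ k) (sym dq)) de)

    -- The ancestors of a woken node p of depth ≥ N - 1 include N distinct
    -- woken nodes (their depths differ), so no node is still INIT.
    pigeon : ∀ p u → Woken c p → N ≤ suc (d p) → S c u ≡ INIT → ⊥
    pigeon p u ip le su =
      let (i , j , i<j , same) = pigeonhole (n<1+n (suc m)) squeeze
      in <-irrefl (depth-separates i j (punchOut-injective (avoids i) (avoids j) same)) i<j
      where
      ancestor : ∀ (i : Fin N) → Woken c (anc (toℕ i) p) × d (anc (toℕ i) p) + toℕ i ≡ d p
      ancestor i = ancL p ip (toℕ i) (≤-pred (≤-trans (toℕ<n i) le))
      avoids : ∀ i → u ≢ anc (toℕ i) p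
      avoids i eq = proj₁ (ancestor i) (subst (λ z → S c z ≡ INIT) eq su)
      squeeze : Fin N → Fin (suc m)
      squeeze i = punchOut (avoids i)
      depth-separates : ∀ i j → anc (toℕ i) p ≡ anc (toℕ j) p → toℕ i ≡ toℕ j
      depth-separates i j eq = +-cancelˡ-≡ (d (anc (toℕ i) p)) _ _
        (trans (proj₂ (ancestor i)) (trans (sym (proj₂ (ancestor j))) (cong (λ z → d z + toℕ j) (sym eq))))

    globRel : S c r ≡ EXPLORE → Ph c r ≡ ph1 → W c r ≡ nothing → Empty (Rm c r) →
              ∀ k w → d w ≡ k → Woken c w → w ≢ r → S c w ≡ IDLE × K c w + d w ≡ K c r
    globRel e1 e4 e2 e3 zero w dw iw ne = ⊥-elim (ne (dZeroRoot iw dw))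
    globRel e1 e4 e2 e3 (suc k) w dw iw ne with par w ne iw
    ... | p , pe , _ , ip , dd = cases≡ p r
      (λ { refl → let (i1 , i2) = proj₁ (proj₂ (tree1 r w pe e1 e4)) (λ h → e3 (w , h)) (λ h → nothing≢just (trans (sym e2) h))
                  in i1 , trans (cong (K c w +_) (trans dd (cong suc rootD))) (trans (+-comm (K c w) 1) i2) })
      (λ nr → let (i1 , i2) = globRel e1 e4 e2 e3 k p (suc-injective (trans (sym dd) dw)) ip nr
                  (j1 , j2) = treeIdle p w pe i1
              in j1 , trans (cong (K c w +_) dd) (trans (+-suc (K c w) (d p)) (trans (cong (_+ d p) j2) i2)))

    noChan : ∀ {u} → S c u ≡ EXPLORE → W c u ≡ nothing → ∀ b → ch c u b ≡ 0 × ch c b u ≡ 0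
    noChan {u} e1 e2 b = h1 (ch c u b ≟ℕ 0) , h2 (ch c b u ≟ℕ 0)
      where
      tu : Tip c u
      tu = e1 , inj₁ e2
      h1 : Dec (ch c u b ≡ 0) → ch c u b ≡ 0
      h1 (yes e) = e
      h1 (no ne) with chanE u b ne
      ... | x1 , x2 , x3 , inj₁ (_ , w , _) = ⊥-elim (nothing≢just (trans (sym e2) w))
      ... | x1 , x2 , x3 , inj₂ rq with tipUniq (reqTip rq (inj₂ x1)) tu
      ...   | refl = ⊥-elim (nothing≢just (trans (sym e2) (proj₁ (proj₂ rq))))
      h2 : Dec (ch c b u ≡ 0) → ch c b u ≡ 0
      h2 (yes e) = e
      h2 (no ne) with chanE b u ne
      ... | x1 , x2 , x3 , inj₂ (_ , w , _) = ⊥-elim (nothing≢just (trans (sym e2) w))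
      ... | x1 , x2 , x3 , inj₁ rq with tipUniq (reqTip rq (inj₁ x1)) tu
      ...   | refl = ⊥-elim (nothing≢just (trans (sym e2) (proj₁ (proj₂ rq))))

    inTransit : ∀ {a b k} → ch c a b ≡ suc k → ch c a b ≡ 1 × ch c b a ≡ 0 × Woken c a × (Req c a b ⊎ Req c b a)
    inTransit {a} {b} e = chanE a b (λ z → 0≢1+n (trans (sym z) e))

  -- (SetParent) u is woken by v: it joins the tree as a child of v at depth d v + 1.
  -- The counter chain along the exploring path (with the pigeonhole lemma excluding
  -- an ancestor in its last round) shows that d v + 1 is the round of the root.
  module StepSetParent {c : Cfg} {d : Fin N → ℕ} (I : Inv c d) {u v : Fin N} {k : ℕ}
           (e0 : ch c v u ≡ suc k) (e1 : S c u ≡ INIT) where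
    open Inv I
    open InvFacts I
    newL : Local N
    newL = record (loc c u) { status = IDLE ; parent = just v ; children = 𝒩 u - v ; count = 0 }
    c' : Cfg
    c' = record { loc = upd (loc c) u newL ; chan = send (consume (chan c) v u) u v }
    d' : Fin N → ℕ
    d' = upd d u (suc (d v))

    -- Effect of the step on each field: xE at every node, xO away from u, xU at u.
    sU : S c' u ≡ IDLE
    sU = cong status (upd-here (loc c) u newL)
    sO : ∀ w → w ≢ u → S c' w ≡ S c w
    sO w ne = cong status (upd-other (loc c) u newL w ne)
    pU : P c' u ≡ just v
    pU = cong parent (upd-here (loc c) u newL)
    pO : ∀ w → w ≢ u → P c' w ≡ P c w
    pO w ne = cong parent (upd-other (loc c) u newL w ne)
    kU : K c' u ≡ 0
    kU = cong count (upd-here (loc c) u newL)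
    kO : ∀ w → w ≢ u → K c' w ≡ K c w
    kO w ne = cong count (upd-other (loc c) u newL w ne)
    cU : Cs c' u ≡ 𝒩 u - v
    cU = cong children (upd-here (loc c) u newL)
    cO : ∀ w → w ≢ u → Cs c' w ≡ Cs c w
    cO w ne = cong children (upd-other (loc c) u newL w ne)
    phE : ∀ w → Ph c' w ≡ Ph c w
    phE = upd-frame phase (loc c) u newL refl
    rmE : ∀ w → Rm c' w ≡ Rm c w
    rmE = upd-frame rem (loc c) u newL refl
    wE : ∀ w → W c' w ≡ W c w
    wE = upd-frame waiting (loc c) u newL refl
    dU : d' u ≡ suc (d v)
    dU = upd-here d u _
    dO : ∀ w → w ≢ u → d' w ≡ d w
    dO w ne = upd-other d u _ w ne

    ce : ch c v u ≡ 1 × ch c u v ≡ 0 × Woken c v × (Req c v u ⊎ Req c u v)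
    ce = inTransit e0
    c1 : ch c v u ≡ 1
    c1 = proj₁ ce
    c2 : ch c u v ≡ 0
    c2 = proj₁ (proj₂ ce)
    iv : Woken c v
    iv = proj₁ (proj₂ (proj₂ ce))
    notIni : ¬ Woken c u
    notIni h = h e1
    iu' : Woken c' u
    iu' h with trans (sym sU) h
    ... | ()
    notEx : S c u ≢ EXPLORE
    notEx h with trans (sym e1) h
    ... | ()
    rqv : Req c v u
    rqv with proj₂ (proj₂ (proj₂ ce))
    ... | inj₁ x = x
    ... | inj₂ (z , _) = ⊥-elim (notEx z)
    tipV : Tip c v
    tipV = reqTip rqv (inj₁ c1)
    sv : S c v ≡ EXPLORE
    sv = proj₁ rqv
    wv : W c v ≡ just u
    wv = proj₁ (proj₂ rqv)
    wo : Edge v u × P c v ≢ just u × u ∉ Rm c v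
    wo = waitOK v u sv wv
    v≢u : v ≢ u
    v≢u = edge⇒≢ (proj₁ wo)
    u≢r : u ≢ r
    u≢r = initNotRoot e1

    kv : K c v ≡ 1 × Ph c v ≡ ph1
    kv with kExpl v (inj₁ sv) | phCase (Ph c v)
    ... | le | inj₂ p2 = ⊥-elim (notIni (nb v u (proj₁ wo) (inj₂ (inj₂ (sv , inj₂ p2)))))
    ... | le | inj₁ p1 with K c v ≤? 1
    ...   | yes le1 = ≤-antisym le1 le , p1
    ...   | no nle = ⊥-elim (notIni (nb v u (proj₁ wo) (inj₂ (inj₂ (sv , inj₁ (≰⇒> nle))))))
    dv : suc (d v) ≡ K c r
    dv with chainL (d v) v refl sv
    ... | inj₁ x = trans (cong (_+ d v) (sym (proj₁ kv))) x
    ... | inj₂ x = ⊥-elim (pigeon v u iv (subst (N ≤_) (cong (_+ d v) (proj₁ kv)) x) e1)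

    nc1 : ∀ b → ch c u b ≡ 0
    nc1 b with ch c u b in eq
    ... | zero = refl
    ... | suc z = ⊥-elim (notIni (proj₁ (proj₂ (proj₂ (chanE u b (λ h → 0≢1+n (trans (sym h) eq)))))))
    nc2 : ∀ a → a ≢ v → ch c a u ≡ 0
    nc2 a na with ch c a u in eq
    ... | zero = refl
    ... | suc z with chanE a u (λ h → 0≢1+n (trans (sym h) eq))
    ... | x1 , _ , _ , inj₂ (x , _) = ⊥-elim (notEx x)
    ... | x1 , _ , _ , inj₁ rq with tipUniq (reqTip rq (inj₁ x1)) tipV
    ...   | refl = ⊥-elim (na refl)
    noChild : ∀ y → P c y ≢ just u
    noChild y h = notIni (proj₁ (proj₂ (paInfo h)))

    chO : ∀ a b → (a ≢ u ⊎ b ≢ v) → (a ≢ v ⊎ b ≢ u) → ch c' a b ≡ ch c a b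
    chO a b h1 h2 = trans (send-other (consume (chan c) v u) u v a b h1) (consume-other (chan c) v u a b h2)
    chUV : ch c' u v ≡ 1
    chUV = trans (send-here (consume (chan c) v u) u v) (cong suc (trans (consume-other (chan c) v u u v (inj₁ (v≢u ∘ sym))) c2))
    chVU : ch c' v u ≡ 0
    chVU = trans (send-other (consume (chan c) v u) u v v u (inj₁ v≢u)) (trans (consume-here (chan c) v u) (cong (_∸ 1) c1))

    iniE : ∀ w → w ≢ u → Woken c' w → Woken c w
    iniE w ne h = subst (_≢ INIT) (sO w ne) h
    iniE' : ∀ w → Woken c w → Woken c' w
    iniE' w h = cases≡ w u (λ { refl → iu' }) (λ ne → subst (_≢ INIT) (sym (sO w ne)) h)
    iniNe : ∀ w → Woken c w → w ≢ u
    iniNe w h refl = notIni h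
    exNe : ∀ w → S c' w ≡ EXPLORE → w ≢ u
    exNe w h refl with trans (sym sU) h
    ... | ()
    exE : ∀ w → S c' w ≡ EXPLORE → S c w ≡ EXPLORE
    exE w h = trans (sym (sO w (exNe w h))) h

    tipE : ∀ x → Tip c' x → Tip c x
    tipE x t = cases≡ x v (λ { refl → tipV }) (λ nv → tr nv (exNe x (proj₁ t)) t)
      where
      tr : x ≢ v → x ≢ u → Tip c' x → Tip c x
      tr nv nu (a , inj₁ w) = exE x a , inj₁ (trans (sym (wE x)) w)
      tr nv nu (a , inj₂ (b , w , inj₁ h)) = exE x a , inj₂ (b , trans (sym (wE x)) w , inj₁ (trans (sym (chO x b (inj₁ nu) (inj₁ nv))) h))
      tr nv nu (a , inj₂ (b , w , inj₂ h)) = exE x a , inj₂ (b , trans (sym (wE x)) w , inj₂ (trans (sym (chO b x (inj₂ nv) (inj₂ nu))) h))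

    ied : IDLE ≡ EXPLORE ⊎ IDLE ≡ DONE → ⊥
    ied (inj₁ ())
    ied (inj₂ ())
    kr : K c' r ≡ K c r
    kr = kO r (u≢r ∘ sym)
    par' : ∀ w → w ≢ r → Woken c' w → Σ (Fin N) λ p → P c' w ≡ just p × Edge p w × Woken c' p × d' w ≡ suc (d' p)
    par' w ne iw = cases≡ w u
      (λ { refl → v , pU , proj₁ wo , iniE' v iv , trans dU (cong suc (sym (dO v v≢u))) })
      (λ nu → let (p , a , b , ip , dd) = par w ne (iniE w nu iw)
                  np : p ≢ u
                  np = iniNe p ip
              in p , trans (pO w nu) a , b , iniE' p ip , trans (dO w nu) (trans dd (cong suc (sym (dO p np)))))
    chanE' : ∀ a b → ch c' a b ≢ 0 → ch c' a b ≡ 1 × ch c' b a ≡ 0 × Woken c' a × (Req c' a b ⊎ Req c' b a)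
    chanE' a b h = cases≡ a u
      (λ eq → subst (λ z → ch c' z b ≡ 1 × ch c' b z ≡ 0 × Woken c' z × (Req c' z b ⊎ Req c' b z)) (sym eq)
         (cases≡ b v (λ { refl → chUV , chVU , iu' , inj₂ (trans (sO v v≢u) sv , trans (wE v) wv , λ z → IDLE≢EXPLORE (trans (sym sU) z)) })
            (λ nb → ⊥-elim (h (trans (cong (λ z → ch c' z b) eq) (trans (chO u b (inj₂ nb) (inj₁ (v≢u ∘ sym))) (nc1 b)))))))
      (λ na → cases≡ b u
        (λ { refl → cases≡ a v (λ { refl → ⊥-elim (h chVU) }) (λ nav → ⊥-elim (h (trans (chO a u (inj₁ na) (inj₁ nav)) (nc2 a nav)))) })
        (λ nb → let (x1 , x2 , x3 , x4) = chanE a b (λ z → h (trans (chO a b (inj₁ na) (inj₂ nb)) z))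
                in trans (chO a b (inj₁ na) (inj₂ nb)) x1 , trans (chO b a (inj₁ nb) (inj₂ na)) x2 , iniE' a x3 , rq na nb x4))
      where
      rq : a ≢ u → b ≢ u → Req c a b ⊎ Req c b a → Req c' a b ⊎ Req c' b a
      rq na nb x rewrite sO a na | sO b nb | wE a | wE b = x
    waitE' : ∀ a b → S c' a ≡ EXPLORE → W c' a ≡ just b → ch c' a b ≡ 1 ⊎ ch c' b a ≡ 1 ⊎ (S c' b ≡ EXPLORE × P c' b ≡ just a)
    waitE' a b h1 h2 = cases≡ b u
        (λ { refl → cases≡ a v (λ { refl → inj₂ (inj₁ chUV) }) (λ nav → ⊥-elim (bu nav (waitE a u (exE a h1) (trans (sym (wE a)) h2)))) })
        (λ nb → tr nb (waitE a b (exE a h1) (trans (sym (wE a)) h2)))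
      where
      na : a ≢ u
      na = exNe a h1
      bu : a ≢ v → ch c a u ≡ 1 ⊎ ch c u a ≡ 1 ⊎ (S c u ≡ EXPLORE × P c u ≡ just a) → ⊥
      bu nav (inj₁ x) = 0≢1+n (trans (sym (nc2 a nav)) x)
      bu nav (inj₂ (inj₁ x)) = 0≢1+n (trans (sym (nc1 a)) x)
      bu nav (inj₂ (inj₂ (x , _))) = notEx x
      tr : b ≢ u → ch c a b ≡ 1 ⊎ ch c b a ≡ 1 ⊎ (S c b ≡ EXPLORE × P c b ≡ just a) → ch c' a b ≡ 1 ⊎ ch c' b a ≡ 1 ⊎ (S c' b ≡ EXPLORE × P c' b ≡ just a)
      tr nb (inj₁ x) = inj₁ (trans (chO a b (inj₁ na) (inj₂ nb)) x)
      tr nb (inj₂ (inj₁ x)) = inj₂ (inj₁ (trans (chO b a (inj₁ nb) (inj₂ na)) x))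
      tr nb (inj₂ (inj₂ (x , y))) = inj₂ (inj₂ (trans (sO b nb) x , trans (pO b nb) y))
    chOK' : ∀ x b → Woken c' x → b ∈ Cs c' x → Edge x b × P c' x ≢ just b
    chOK' x b ix h = cases≡ x u
      (λ { refl → let h' = subst (b ∈_) cU h in ∈tabulate⇒true (adj u) b (x∈p-y⇒x∈p (𝒩 u) b v h') ,
                  (λ z → x∈p-y⇒x≢y (𝒩 u) b v h' (just-injective (trans (sym z) pU))) })
      (λ ne → subst (λ z → Edge x b × z ≢ just b) (sym (pO x ne)) (chOK x b (iniE x ne ix) (subst (b ∈_) (cO x ne) h)))
    chAll' : ∀ p y → Woken c' p → Edge p y → P c' p ≢ just y → (S c' y ≡ INIT ⊎ P c' y ≡ just p) → y ∈ Cs c' p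
    chAll' p y ip e h1 h2 = cases≡ p u
      (λ { refl → subst (y ∈_) (sym cU) (x∈p∧x≢y⇒x∈p-y (true⇒∈tabulate (adj u) y e) (λ eq → h1 (trans pU (cong just (sym eq))))) })
      (λ np → subst (y ∈_) (sym (cO p np)) (cases≡ y u
         (λ { refl → yu h2 })
         (λ ny → chAll p y (iniE p np ip) e (subst (_≢ just y) (pO p np) h1) (Data.Sum.map (trans (sym (sO y ny))) (trans (sym (pO y ny))) h2))))
      where
      yu : (S c' u ≡ INIT ⊎ P c' u ≡ just p) → u ∈ Cs c p
      yu (inj₁ x) = ⊥-elim (iu' x)
      yu (inj₂ x) = subst (λ z → u ∈ Cs c z) (just-injective (trans (sym pU) x)) (chAll v u iv (proj₁ wo) (proj₁ (proj₂ wo)) (inj₁ e1))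
    treeIdle' : ∀ p y → P c' y ≡ just p → S c' p ≡ IDLE → S c' y ≡ IDLE × suc (K c' y) ≡ K c' p
    treeIdle' p y h1 h2 = cases≡ y u
      (λ { refl → ⊥-elim (EXPLORE≢IDLE (trans (sym sv) (trans (cong (S c) (just-injective (trans (sym pU) h1))) (trans (sym (sO p (pu h1))) h2)))) })
      (λ ny → cases≡ p u (λ { refl → ⊥-elim (noChild y (trans (sym (pO y ny)) h1)) })
        (λ np → let (a , b) = treeIdle p y (trans (sym (pO y ny)) h1) (trans (sym (sO p np)) h2)
                in trans (sO y ny) a , trans (cong suc (kO y ny)) (trans b (sym (kO p np)))))
      where
      pu : P c' u ≡ just p → p ≢ u
      pu h refl = v≢u (just-injective (trans (sym pU) h))
    treeDone' : ∀ p y → P c' y ≡ just p → S c' p ≡ DONE → S c' y ≡ DONE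
    treeDone' p y h1 h2 = cases≡ y u
      (λ { refl → ⊥-elim (EXPLORE≢DONE (trans (sym sv) (trans (cong (S c) (just-injective (trans (sym pU) h1))) (trans (sym (sO p (pu h1))) h2)))) })
      (λ ny → cases≡ p u (λ { refl → ⊥-elim (noChild y (trans (sym (pO y ny)) h1)) })
        (λ np → trans (sO y ny) (treeDone p y (trans (sym (pO y ny)) h1) (trans (sym (sO p np)) h2))))
      where
      pu : P c' u ≡ just p → p ≢ u
      pu h refl = v≢u (just-injective (trans (sym pU) h))
    tree1' : ∀ p y → P c' y ≡ just p → S c' p ≡ EXPLORE → Ph c' p ≡ ph1 → T1 c' p y
    tree1' p y h1 h2 h3 = cases≡ y u
      (λ { refl → tU (just-injective (trans (sym pU) h1)) })
      (λ ny → tr ny (tree1 p y (trans (sym (pO y ny)) h1) (exE p h2) (trans (sym (phE p)) h3)))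
      where
      np : p ≢ u
      np = exNe p h2
      tr : y ≢ u → T1 c p y → T1 c' p y
      tr ny t rewrite rmE p | sO y ny | kO y ny | kO p np | wE p | chO p y (inj₁ np) (inj₂ ny) = t
      tU : v ≡ p → T1 c' p u
      tU refl rewrite rmE v | sU | kU | kO v v≢u | wE v | chVU =
        (λ z → ⊥-elim (proj₂ (proj₂ wo) z)) ,
        (λ _ z → ⊥-elim (z wv)) ,
        (λ _ → inj₂ (refl , sym (proj₁ kv) , inj₂ refl))
    tree2' : ∀ p y → P c' y ≡ just p → S c' p ≡ EXPLORE → Ph c' p ≡ ph2 → T2 c' p y
    tree2' p y h1 h2 h3 = cases≡ y u
      (λ { refl → ⊥-elim (ph1≢ph2 (trans (sym (proj₂ kv)) (trans (cong (Ph c) (just-injective (trans (sym pU) h1))) (trans (sym (phE p)) h3)))) })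
      (λ ny → tr ny (tree2 p y (trans (sym (pO y ny)) h1) (exE p h2) (trans (sym (phE p)) h3)))
      where
      np : p ≢ u
      np = exNe p h2
      tr : y ≢ u → T2 c p y → T2 c' p y
      tr ny t rewrite rmE p | sO y ny | kO y ny | kO p np | wE p | chO p y (inj₁ np) (inj₂ ny) = t
    nb' : ∀ w x → Edge w x → Fin1 c' w → Woken c' x
    nb' w x e f = cases≡ w u (λ { refl → ⊥-elim (fu f) })
      (λ nw → iniE' x (nb w x e (fE nw f)))
      where
      fE : w ≢ u → Fin1 c' w → Fin1 c w
      fE ne f rewrite sO w ne | kO w ne | phE w = f
      fu : Fin1 c' u → ⊥
      fu (inj₁ (_ , le)) with subst (1 ≤_) kU le
      ... | ()
      fu (inj₂ (inj₁ a)) with trans (sym sU) a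
      ... | ()
      fu (inj₂ (inj₂ (a , _))) with trans (sym sU) a
      ... | ()
    dMax' : ∀ w → Woken c' w → d' w ≤ K c' r
    dMax' w iw = subst (d' w ≤_) (sym kr) (cases≡ w u (λ { refl → ≤-reflexive (trans dU dv) })
      (λ ne → subst (_≤ K c r) (sym (dO w ne)) (dMax w (iniE w ne iw))))
    nbd' : ∀ w x → Woken c' w → 2 + d' w ≤ K c' r → Edge w x → Woken c' x
    nbd' w x iw le e = cases≡ w u
      (λ { refl → ⊥-elim (<-irrefl refl (≤-trans (≤-reflexive (cong suc (sym dv))) (≤-trans (n≤1+n _) (subst₂ _≤_ (cong (2 +_) dU) kr le)))) })
      (λ nw → iniE' x (nbd w x (iniE w nw iw) (subst₂ (λ a b → 2 + a ≤ b) (dO w nw) kr le) e))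
    bfs' : ∀ a b → Edge a b → Woken c' a → Woken c' b → d' a ≤ suc (d' b)
    bfs' a b e ia ib = cases≡ a u
      (λ { refl → cases≡ b u (λ { refl → ⊥-elim (no-loop e) })
          (λ nb → subst₂ (λ x y → x ≤ suc y) (sym dU) (sym (dO b nb)) (s≤s (lowB b nb (iniE b nb ib) (edge-sym e)))) })
      (λ na → cases≡ b u
        (λ { refl → subst₂ (λ x y → x ≤ suc y) (sym (dO a na)) (sym dU)
               (≤-trans (dMax a (iniE a na ia)) (≤-trans (≤-reflexive (sym dv)) (n≤1+n _))) })
        (λ nb → subst₂ (λ x y → x ≤ suc y) (sym (dO a na)) (sym (dO b nb)) (bfs a b e (iniE a na ia) (iniE b nb ib))))
      where
      lowB : ∀ w → w ≢ u → Woken c w → Edge w u → d v ≤ d w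
      lowB w nw iw ew with d v ≤? d w
      ... | yes le = le
      ... | no nle = ⊥-elim (notIni (nbd w u iw (≤-trans (s≤s (≰⇒> nle)) (≤-reflexive dv)) ew))

    pres : Inv c' d'
    pres = record
      { rootSt = subst (λ s → s ≡ EXPLORE ⊎ s ≡ DONE) (sym (sO r (u≢r ∘ sym))) rootSt
      ; rootPa = trans (pO r (u≢r ∘ sym)) rootPa
      ; rootD = trans (dO r (u≢r ∘ sym)) rootD
      ; initPa = λ y h → cases≡ y u (λ { refl → ⊥-elim (iu' h) }) (λ ne → trans (pO y ne) (initPa y (trans (sym (sO y ne)) h)))
      ; par = par'
      ; chanE = chanE'
      ; waitE = waitE'
      ; explPar = λ x q h1 h2 → let nx = exNe x h1
                                    (y1 , y2) = explPar x q (exE x h1) (trans (sym (pO x nx)) h2)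
                                    nq = λ (eq : q ≡ u) → notEx (subst (λ z → S c z ≡ EXPLORE) eq y1)
                                in trans (sO q nq) y1 , trans (wE q) y2
      ; explUniq = λ x y h1 h2 h3 → explUniq x y (exE x h1) (exE y h2) (trans (sym (dO x (exNe x h1))) (trans h3 (dO y (exNe y h2))))
      ; tipDeep = λ x y t h → subst₂ _≤_ (sym (dO y (exNe y h))) (sym (dO x (exNe x (proj₁ t)))) (tipDeep x y (tipE x t) (exE y h))
      ; waitOK = λ x b h1 h2 → let nx = exNe x h1
                                   (a , b' , c0) = waitOK x b (exE x h1) (trans (sym (wE x)) h2)
                               in a , subst (λ z → z ≢ just b) (sym (pO x nx)) b' , subst (b ∉_) (sym (rmE x)) c0
      ; remOK = λ x b h1 h2 → subst (λ z → Edge x b × z ≢ just b) (sym (pO x (exNe x h1))) (remOK x b (exE x h1) (subst (b ∈_) (rmE x) h2))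
      ; chOK = chOK'
      ; chAll = chAll'
      ; kMax = λ w → cases≡ w u (λ { refl → subst (_≤ suc m) (sym kU) z≤n }) (λ ne → subst (_≤ suc m) (sym (kO w ne)) (kMax w))
      ; kExpl = λ w h → cases≡ w u (λ { refl → ⊥-elim (ied (subst (λ s → s ≡ EXPLORE ⊎ s ≡ DONE) sU h)) })
                   (λ ne → subst (1 ≤_) (sym (kO w ne)) (kExpl w (subst (λ s → s ≡ EXPLORE ⊎ s ≡ DONE) (sO w ne) h)))
      ; kIdle = λ w h → cases≡ w u (λ { refl → subst (_≢ suc m) (sym kU) (λ ()) }) (λ ne → subst (_≢ suc m) (sym (kO w ne)) (kIdle w (trans (sym (sO w ne)) h)))
      ; kPh2 = λ w h1 h2 → let nw = exNe w h1 in trans (kO w nw) (kPh2 w (exE w h1) (trans (sym (phE w)) h2))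
      ; treeIdle = treeIdle'
      ; treeDone = treeDone'
      ; tree1 = tree1'
      ; tree2 = tree2'
      ; nb = nb'
      ; nb3 = λ w x h1 h2 e h3 h4 → iniE' x (nb3 w x (exE w h1) (trans (sym (phE w)) h2) e (subst (x ∉_) (rmE w) h3) (subst (_≢ just x) (wE w) h4))
      ; dMax = dMax'
      ; nbd = nbd'
      ; bfs = bfs'
      }

  module StepMarkSibling {c : Cfg} {d : Fin N → ℕ} (I : Inv c d) {u v : Fin N} {k : ℕ}
           (e0 : ch c v u ≡ suc k) (e1 : S c u ≡ IDLE ⊎ S c u ≡ DONE) (e2 : P c u ≢ just v) where
    open Inv I
    open InvFacts I
    newL : Local N
    newL = record (loc c u) { children = children (loc c u) - v }
    c' : Cfg
    c' = record { loc = upd (loc c) u newL ; chan = send (consume (chan c) v u) u v }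

    sE : ∀ w → S c' w ≡ S c w
    sE = upd-frame status (loc c) u newL refl
    pE : ∀ w → P c' w ≡ P c w
    pE = upd-frame parent (loc c) u newL refl
    kE : ∀ w → K c' w ≡ K c w
    kE = upd-frame count (loc c) u newL refl
    wE : ∀ w → W c' w ≡ W c w
    wE = upd-frame waiting (loc c) u newL refl
    phE : ∀ w → Ph c' w ≡ Ph c w
    phE = upd-frame phase (loc c) u newL refl
    rmE : ∀ w → Rm c' w ≡ Rm c w
    rmE = upd-frame rem (loc c) u newL refl
    cO : ∀ w → w ≢ u → Cs c' w ≡ Cs c w
    cO w ne = cong children (upd-other (loc c) u newL w ne)
    cU : Cs c' u ≡ Cs c u - v
    cU = cong children (upd-here (loc c) u newL)

    ce : ch c v u ≡ 1 × ch c u v ≡ 0 × Woken c v × (Req c v u ⊎ Req c u v)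
    ce = inTransit e0
    c1 : ch c v u ≡ 1
    c1 = proj₁ ce
    c2 : ch c u v ≡ 0
    c2 = proj₁ (proj₂ ce)
    iv : Woken c v
    iv = proj₁ (proj₂ (proj₂ ce))
    notEx' : ∀ {s} → S c u ≡ s → (s ≡ IDLE ⊎ s ≡ DONE) → s ≢ EXPLORE
    notEx' _ (inj₁ refl) ()
    notEx' _ (inj₂ refl) ()
    notEx : S c u ≢ EXPLORE
    notEx h = notEx' refl (subst (λ z → z ≡ IDLE ⊎ z ≡ DONE) refl e1) h
    iu' : ∀ {s} → (s ≡ IDLE ⊎ s ≡ DONE) → s ≢ INIT
    iu' (inj₁ refl) ()
    iu' (inj₂ refl) ()
    iu : Woken c u
    iu = iu' e1
    rqv : Req c v u
    rqv with proj₂ (proj₂ (proj₂ ce))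
    ... | inj₁ x = x
    ... | inj₂ (z , _) = ⊥-elim (notEx z)
    tipV : Tip c v
    tipV = reqTip rqv (inj₁ c1)
    wo : Edge v u × P c v ≢ just u × u ∉ Rm c v
    wo = waitOK v u (proj₁ rqv) (proj₁ (proj₂ rqv))
    v≢u : v ≢ u
    v≢u = edge⇒≢ (proj₁ wo)

    chO : ∀ a b → (a ≢ u ⊎ b ≢ v) → (a ≢ v ⊎ b ≢ u) → ch c' a b ≡ ch c a b
    chO a b h1 h2 = trans (send-other (consume (chan c) v u) u v a b h1) (consume-other (chan c) v u a b h2)
    chUV : ch c' u v ≡ 1
    chUV = trans (send-here (consume (chan c) v u) u v) (cong suc (trans (consume-other (chan c) v u u v (inj₁ (v≢u ∘ sym))) c2))
    chVU : ch c' v u ≡ 0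
    chVU = trans (send-other (consume (chan c) v u) u v v u (inj₁ v≢u)) (trans (consume-here (chan c) v u) (cong (_∸ 1) c1))

    iniE : ∀ w → Woken c' w → Woken c w
    iniE w h rewrite sym (sE w) = h
    iniE' : ∀ w → Woken c w → Woken c' w
    iniE' w h rewrite sE w = h

    tipE : ∀ x → Tip c' x → Tip c x
    tipE x t = cases≡ x v (λ { refl → tipV }) (λ nv → cases≡ x u (λ { refl → ⊥-elim (notEx (trans (sym (sE u)) (proj₁ t))) }) (λ nu → tr nv nu t))
      where
      tr : x ≢ v → x ≢ u → Tip c' x → Tip c x
      tr nv nu (a , inj₁ w) = trans (sym (sE x)) a , inj₁ (trans (sym (wE x)) w)
      tr nv nu (a , inj₂ (b , w , inj₁ h)) = trans (sym (sE x)) a , inj₂ (b , trans (sym (wE x)) w , inj₁ (trans (sym (chO x b (inj₁ nu) (inj₁ nv))) h))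
      tr nv nu (a , inj₂ (b , w , inj₂ h)) = trans (sym (sE x)) a , inj₂ (b , trans (sym (wE x)) w , inj₂ (trans (sym (chO b x (inj₂ nv) (inj₂ nu))) h))

    rqE : ∀ a b → Req c a b → Req c' a b
    rqE a b x rewrite sE a | sE b | wE a = x

    fE : ∀ w → Fin1 c' w → Fin1 c w
    fE w f rewrite sE w | kE w | phE w = f
    chanE' : ∀ a b → ch c' a b ≢ 0 → ch c' a b ≡ 1 × ch c' b a ≡ 0 × Woken c' a × (Req c' a b ⊎ Req c' b a)
    chanE' a b h = cases≡ a u
      (λ { refl → cases≡ b v
          (λ { refl → chUV , chVU , iniE' u iu , inj₂ (rqE v u rqv) })
          (λ nb → old (inj₂ nb) (inj₁ (v≢u ∘ sym)) (inj₂ (v≢u ∘ sym)) (inj₁ nb)) })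
      (λ na → cases≡ a v
          (λ { refl → cases≡ b u
               (λ { refl → ⊥-elim (h chVU) })
               (λ nb → old (inj₁ v≢u) (inj₂ nb) (inj₁ nb) (inj₂ v≢u)) })
          (λ nav → old (inj₁ na) (inj₁ nav) (inj₂ nav) (inj₂ na)))
      where
      old : (a ≢ u ⊎ b ≢ v) → (a ≢ v ⊎ b ≢ u) → (b ≢ u ⊎ a ≢ v) → (b ≢ v ⊎ a ≢ u) → ch c' a b ≡ 1 × ch c' b a ≡ 0 × Woken c' a × (Req c' a b ⊎ Req c' b a)
      old x1 x2 x3 x4 = let (y1 , y2 , y3 , y4) = chanE a b (λ z → h (trans (chO a b x1 x2) z))
                        in trans (chO a b x1 x2) y1 , trans (chO b a x3 x4) y2 , iniE' a y3 , Data.Sum.map (rqE a b) (rqE b a) y4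
    waitE' : ∀ a b → S c' a ≡ EXPLORE → W c' a ≡ just b → ch c' a b ≡ 1 ⊎ ch c' b a ≡ 1 ⊎ (S c' b ≡ EXPLORE × P c' b ≡ just a)
    waitE' a b h1 h2 = cases≡ a u (λ { refl → ⊥-elim (notEx (trans (sym (sE u)) h1)) })
      (λ na → cases≡ a v
        (λ { refl → cases≡ b u (λ { refl → inj₂ (inj₁ chUV) }) (λ nb → tr (inj₁ v≢u) (inj₂ nb) (inj₁ nb) (inj₂ v≢u) old) })
        (λ nav → tr (inj₁ na) (inj₁ nav) (inj₂ nav) (inj₂ na) old))
      where
      old = waitE a b (trans (sym (sE a)) h1) (trans (sym (wE a)) h2)
      tr : (a ≢ u ⊎ b ≢ v) → (a ≢ v ⊎ b ≢ u) → (b ≢ u ⊎ a ≢ v) → (b ≢ v ⊎ a ≢ u) → ch c a b ≡ 1 ⊎ ch c b a ≡ 1 ⊎ (S c b ≡ EXPLORE × P c b ≡ just a) → ch c' a b ≡ 1 ⊎ ch c' b a ≡ 1 ⊎ (S c' b ≡ EXPLORE × P c' b ≡ just a)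
      tr x1 x2 x3 x4 (inj₁ x) = inj₁ (trans (chO a b x1 x2) x)
      tr x1 x2 x3 x4 (inj₂ (inj₁ x)) = inj₂ (inj₁ (trans (chO b a x3 x4) x))
      tr x1 x2 x3 x4 (inj₂ (inj₂ (x , y))) = inj₂ (inj₂ (trans (sE b) x , trans (pE b) y))
    chOK' : ∀ x b → Woken c' x → b ∈ Cs c' x → Edge x b × P c' x ≢ just b
    chOK' x b ix h = subst (λ z → Edge x b × z ≢ just b) (sym (pE x)) (chOK x b (iniE x ix)
      (cases≡ x u (λ { refl → x∈p-y⇒x∈p (Cs c u) b v (subst (b ∈_) cU h) }) (λ ne → subst (b ∈_) (cO x ne) h)))
    chAll' : ∀ p y → Woken c' p → Edge p y → P c' p ≢ just y → (S c' y ≡ INIT ⊎ P c' y ≡ just p) → y ∈ Cs c' p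
    chAll' p y ip e h1 h2 = cases≡ p u
      (λ { refl → subst (y ∈_) (sym cU) (x∈p∧x≢y⇒x∈p-y old (λ { refl → yv h2 })) })
      (λ ne → subst (y ∈_) (sym (cO p ne)) old)
      where
      h2' : S c y ≡ INIT ⊎ P c y ≡ just p
      h2' rewrite sym (sE y) | sym (pE y) = h2
      old = chAll p y (iniE p ip) e (subst (_≢ just y) (pE p) h1) h2'
      yv : (S c' v ≡ INIT ⊎ P c' v ≡ just u) → ⊥
      yv (inj₁ x) = iv (trans (sym (sE v)) x)
      yv (inj₂ x) = proj₁ (proj₂ wo) (trans (sym (pE v)) x)
    treeIdle' : ∀ p y → P c' y ≡ just p → S c' p ≡ IDLE → S c' y ≡ IDLE × suc (K c' y) ≡ K c' p
    treeIdle' p y h1 h2 rewrite pE y | sE p | sE y | kE y | kE p = treeIdle p y h1 h2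
    chPY : ∀ p y → P c y ≡ just p → ch c' p y ≡ ch c p y
    chPY p y py = chO p y (cases≡ p u (λ { refl → inj₂ (λ { refl → proj₁ (proj₂ wo) py }) }) inj₁)
                           (cases≡ p v (λ { refl → inj₂ (λ { refl → e2 py }) }) inj₁)
    tree1' : ∀ p y → P c' y ≡ just p → S c' p ≡ EXPLORE → Ph c' p ≡ ph1 → T1 c' p y
    tree1' p y h1 h2 h3 = tr (tree1 p y py (trans (sym (sE p)) h2) (trans (sym (phE p)) h3))
      where
      py : P c y ≡ just p
      py = trans (sym (pE y)) h1
      tr : T1 c p y → T1 c' p y
      tr t rewrite rmE p | sE y | kE y | kE p | wE p | chPY p y py = t
    tree2' : ∀ p y → P c' y ≡ just p → S c' p ≡ EXPLORE → Ph c' p ≡ ph2 → T2 c' p y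
    tree2' p y h1 h2 h3 = tr (tree2 p y py (trans (sym (sE p)) h2) (trans (sym (phE p)) h3))
      where
      py : P c y ≡ just p
      py = trans (sym (pE y)) h1
      tr : T2 c p y → T2 c' p y
      tr t rewrite rmE p | sE y | kE y | kE p | wE p | chPY p y py = t

    pres : Inv c' d
    pres = record
      { rootSt = subst (λ s → s ≡ EXPLORE ⊎ s ≡ DONE) (sym (sE r)) rootSt
      ; rootPa = trans (pE r) rootPa
      ; rootD = rootD
      ; initPa = λ y h → trans (pE y) (initPa y (trans (sym (sE y)) h))
      ; par = λ w ne iw → let (p , a , b , ip , dd) = par w ne (iniE w iw) in p , trans (pE w) a , b , iniE' p ip , dd
      ; chanE = chanE'
      ; waitE = waitE'
      ; explPar = λ x q h1 h2 → let (y1 , y2) = explPar x q (trans (sym (sE x)) h1) (trans (sym (pE x)) h2) in trans (sE q) y1 , trans (wE q) y2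
      ; explUniq = λ x y h1 h2 h3 → explUniq x y (trans (sym (sE x)) h1) (trans (sym (sE y)) h2) h3
      ; tipDeep = λ x y t h → tipDeep x y (tipE x t) (trans (sym (sE y)) h)
      ; waitOK = λ x b h1 h2 → let (a , b' , c0) = waitOK x b (trans (sym (sE x)) h1) (trans (sym (wE x)) h2)
                               in a , subst (λ z → z ≢ just b) (sym (pE x)) b' , subst (b ∉_) (sym (rmE x)) c0
      ; remOK = λ x b h1 h2 → subst (λ z → Edge x b × z ≢ just b) (sym (pE x)) (remOK x b (trans (sym (sE x)) h1) (subst (b ∈_) (rmE x) h2))
      ; chOK = chOK'
      ; chAll = chAll'
      ; kMax = λ w → subst (_≤ suc m) (sym (kE w)) (kMax w)
      ; kExpl = λ w h → subst (1 ≤_) (sym (kE w)) (kExpl w (subst (λ s → s ≡ EXPLORE ⊎ s ≡ DONE) (sE w) h))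
      ; kIdle = λ w h → subst (_≢ suc m) (sym (kE w)) (kIdle w (trans (sym (sE w)) h))
      ; kPh2 = λ w h1 h2 → trans (kE w) (kPh2 w (trans (sym (sE w)) h1) (trans (sym (phE w)) h2))
      ; treeIdle = treeIdle'
      ; treeDone = λ p y h1 h2 → trans (sE y) (treeDone p y (trans (sym (pE y)) h1) (trans (sym (sE p)) h2))
      ; tree1 = tree1'
      ; tree2 = tree2'
      ; nb = λ w x e f → iniE' x (nb w x e (fE w f))
      ; nb3 = λ w x h1 h2 e h3 h4 → iniE' x (nb3 w x (trans (sym (sE w)) h1) (trans (sym (phE w)) h2) e (subst (x ∉_) (rmE w) h3) (subst (_≢ just x) (wE w) h4))
      ; dMax = λ w iw → subst (d w ≤_) (sym (kE r)) (dMax w (iniE w iw))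
      ; nbd = λ w x iw le e → iniE' x (nbd w x (iniE w iw) (subst (2 + d w ≤_) (kE r) le) e)
      ; bfs = λ a b e ia ib → bfs a b e (iniE a ia) (iniE b ib)
      }

  module StepExplore {c : Cfg} {d : Fin N → ℕ} (I : Inv c d) {u v : Fin N} {k : ℕ}
           (e0 : ch c v u ≡ suc k) (e1 : S c u ≡ IDLE) (e2 : P c u ≡ just v) where
    open Inv I
    open InvFacts I
    newL : Local N
    newL = beginExplore u (loc c u)
    c' : Cfg
    c' = record { loc = upd (loc c) u newL ; chan = consume (chan c) v u }

    sU : S c' u ≡ EXPLORE
    sU = cong status (upd-here (loc c) u newL)
    sO : ∀ w → w ≢ u → S c' w ≡ S c w
    sO w ne = cong status (upd-other (loc c) u newL w ne)
    pE : ∀ w → P c' w ≡ P c w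
    pE = upd-frame parent (loc c) u newL refl
    kU : K c' u ≡ suc (K c u)
    kU = cong count (upd-here (loc c) u newL)
    kO : ∀ w → w ≢ u → K c' w ≡ K c w
    kO w ne = cong count (upd-other (loc c) u newL w ne)
    phU : Ph c' u ≡ ph1
    phU = cong phase (upd-here (loc c) u newL)
    phO : ∀ w → w ≢ u → Ph c' w ≡ Ph c w
    phO w ne = cong phase (upd-other (loc c) u newL w ne)
    rmU : Rm c' u ≡ 𝒩 u - v
    rmU rewrite upd-here (loc c) u newL | e2 = refl
    rmO : ∀ w → w ≢ u → Rm c' w ≡ Rm c w
    rmO w ne = cong rem (upd-other (loc c) u newL w ne)
    wU : W c' u ≡ nothing
    wU = cong waiting (upd-here (loc c) u newL)
    wO : ∀ w → w ≢ u → W c' w ≡ W c w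
    wO w ne = cong waiting (upd-other (loc c) u newL w ne)
    cE : ∀ w → Cs c' w ≡ Cs c w
    cE = upd-frame children (loc c) u newL refl
    chO : ∀ a b → (a ≢ v ⊎ b ≢ u) → ch c' a b ≡ ch c a b
    chO a b h = consume-other (chan c) v u a b h

    ce : ch c v u ≡ 1 × ch c u v ≡ 0 × Woken c v × (Req c v u ⊎ Req c u v)
    ce = inTransit e0
    c1 : ch c v u ≡ 1
    c1 = proj₁ ce
    c2 : ch c u v ≡ 0
    c2 = proj₁ (proj₂ ce)
    iv : Woken c v
    iv = proj₁ (proj₂ (proj₂ ce))
    notEx : S c u ≢ EXPLORE
    notEx h with trans (sym e1) h
    ... | ()
    iu : Woken c u
    iu h with trans (sym e1) h
    ... | ()
    rqv : Req c v u
    rqv with proj₂ (proj₂ (proj₂ ce))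
    ... | inj₁ x = x
    ... | inj₂ (z , _) = ⊥-elim (notEx z)
    tipV : Tip c v
    tipV = reqTip rqv (inj₁ c1)
    sv : S c v ≡ EXPLORE
    sv = proj₁ rqv
    wv : W c v ≡ just u
    wv = proj₁ (proj₂ rqv)
    wo : Edge v u × P c v ≢ just u × u ∉ Rm c v
    wo = waitOK v u sv wv
    v≢u : v ≢ u
    v≢u = edge⇒≢ (proj₁ wo)
    u≢r : u ≢ r
    u≢r = paNotRoot e2
    pinf : Edge v u × Woken c v × d u ≡ suc (d v)
    pinf = paInfo e2
    chVU : ch c' v u ≡ 0
    chVU = trans (consume-here (chan c) v u) (cong (_∸ 1) c1)

    nc1 : ∀ b → ch c u b ≡ 0
    nc1 b with ch c u b in eq
    ... | zero = refl
    ... | suc z with chanE u b (λ h → 0≢1+n (trans (sym h) eq))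
    ... | x1 , _ , _ , inj₁ (x , _) = ⊥-elim (notEx x)
    ... | x1 , _ , _ , inj₂ rq with tipUniq (reqTip rq (inj₂ x1)) tipV
    ...   | refl = ⊥-elim (1+n≢0 (trans (sym x1) c2))
    nc2 : ∀ a → a ≢ v → ch c a u ≡ 0
    nc2 a na with ch c a u in eq
    ... | zero = refl
    ... | suc z with chanE a u (λ h → 0≢1+n (trans (sym h) eq))
    ... | x1 , _ , _ , inj₂ (x , _) = ⊥-elim (notEx x)
    ... | x1 , _ , _ , inj₁ rq with tipUniq (reqTip rq (inj₁ x1)) tipV
    ...   | refl = ⊥-elim (na refl)

    iniE : ∀ w → Woken c' w → Woken c w
    iniE w h = cases≡ w u (λ { refl → iu }) (λ ne → subst (_≢ INIT) (sO w ne) h)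
    iniE' : ∀ w → Woken c w → Woken c' w
    iniE' w h = cases≡ w u (λ { refl → explore⇒woken c' u sU }) (λ ne → subst (_≢ INIT) (sym (sO w ne)) h)
    sInit : ∀ w → S c' w ≡ INIT → S c w ≡ INIT
    sInit w h = cases≡ w u (λ { refl → ⊥-elim (explore⇒woken c' u sU h) }) (λ ne → trans (sym (sO w ne)) h)
    exE : ∀ w → w ≢ u → S c' w ≡ EXPLORE → S c w ≡ EXPLORE
    exE w ne h = trans (sym (sO w ne)) h

    rel : (Ph c v ≡ ph1 × suc (suc (K c u)) ≡ K c v) ⊎ (Ph c v ≡ ph2 × suc (K c u) ≡ K c v)
    rel with phCase (Ph c v)
    ... | inj₁ p1 with proj₂ (proj₂ (tree1 v u e2 sv p1)) wv
    ...   | inj₁ (_ , _ , x) = inj₁ (p1 , x)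
    ...   | inj₂ (x , _) = ⊥-elim (1+n≢0 (trans (sym c1) x))
    rel | inj₂ p2 with proj₂ (proj₂ (tree2 v u e2 sv p2)) wv
    ...   | inj₁ (_ , _ , x) = inj₂ (p2 , x)
    ...   | inj₂ (x , _) = ⊥-elim (1+n≢0 (trans (sym c1) x))

    vt : Tip c' v → ⊥
    vt (a , inj₁ w) = nothing≢just (trans (sym w) (trans (wO v v≢u) wv))
    vt (a , inj₂ (b , w , h)) with just-injective (trans (sym (trans (wO v v≢u) wv)) w)
    ... | refl with h
    ...   | inj₁ h' = 0≢1+n (trans (sym chVU) h')
    ...   | inj₂ h' = 0≢1+n (trans (sym (trans (chO u v (inj₁ (v≢u ∘ sym))) c2)) h')

    tipE : ∀ x → x ≢ u → Tip c' x → Tip c x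
    tipE x ne t = cases≡ x v (λ { refl → ⊥-elim (vt t) }) (λ nv → tr nv t)
      where
      tr : x ≢ v → Tip c' x → Tip c x
      tr nv (a , inj₁ w) = exE x ne a , inj₁ (trans (sym (wO x ne)) w)
      tr nv (a , inj₂ (b , w , inj₁ h)) = exE x ne a , inj₂ (b , trans (sym (wO x ne)) w , inj₁ (trans (sym (chO x b (inj₁ nv))) h))
      tr nv (a , inj₂ (b , w , inj₂ h)) = exE x ne a , inj₂ (b , trans (sym (wO x ne)) w , inj₂ (trans (sym (chO b x (inj₂ ne))) h))

    chanE' : ∀ a b → ch c' a b ≢ 0 → ch c' a b ≡ 1 × ch c' b a ≡ 0 × Woken c' a × (Req c' a b ⊎ Req c' b a)
    chanE' a b h = cases≡ a u (λ { refl → ⊥-elim (h (trans (chO u b (inj₁ (v≢u ∘ sym))) (nc1 b))) })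
      (λ na → cases≡ b u
        (λ { refl → cases≡ a v (λ { refl → ⊥-elim (h chVU) }) (λ nav → ⊥-elim (h (trans (chO a u (inj₁ nav)) (nc2 a nav)))) })
        (λ nb → let (x1 , x2 , x3 , x4) = chanE a b (λ z → h (trans (chO a b (inj₂ nb)) z))
                in trans (chO a b (inj₂ nb)) x1 , trans (chO b a (inj₂ na)) x2 , iniE' a x3 , rq na nb x4))
      where
      rq : a ≢ u → b ≢ u → Req c a b ⊎ Req c b a → Req c' a b ⊎ Req c' b a
      rq na nb x rewrite sO a na | sO b nb | wO a na | wO b nb = x
    waitE' : ∀ a b → S c' a ≡ EXPLORE → W c' a ≡ just b → ch c' a b ≡ 1 ⊎ ch c' b a ≡ 1 ⊎ (S c' b ≡ EXPLORE × P c' b ≡ just a)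
    waitE' a b h1 h2 = cases≡ a u (λ { refl → ⊥-elim (nothing≢just (trans (sym wU) h2)) })
      (λ na → cases≡ b u
        (λ { refl → cases≡ a v (λ { refl → inj₂ (inj₂ (sU , trans (pE u) e2)) })
               (λ nav → ⊥-elim (bu nav (waitE a u (exE a na h1) (trans (sym (wO a na)) h2)))) })
        (λ nb → tr na nb (waitE a b (exE a na h1) (trans (sym (wO a na)) h2))))
      where
      bu : a ≢ v → ch c a u ≡ 1 ⊎ ch c u a ≡ 1 ⊎ (S c u ≡ EXPLORE × P c u ≡ just a) → ⊥
      bu nav (inj₁ x) = 0≢1+n (trans (sym (nc2 a nav)) x)
      bu nav (inj₂ (inj₁ x)) = 0≢1+n (trans (sym (nc1 a)) x)
      bu nav (inj₂ (inj₂ (x , _))) = notEx x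
      tr : a ≢ u → b ≢ u → ch c a b ≡ 1 ⊎ ch c b a ≡ 1 ⊎ (S c b ≡ EXPLORE × P c b ≡ just a) → ch c' a b ≡ 1 ⊎ ch c' b a ≡ 1 ⊎ (S c' b ≡ EXPLORE × P c' b ≡ just a)
      tr na nb (inj₁ x) = inj₁ (trans (chO a b (inj₂ nb)) x)
      tr na nb (inj₂ (inj₁ x)) = inj₂ (inj₁ (trans (chO b a (inj₂ na)) x))
      tr na nb (inj₂ (inj₂ (x , y))) = inj₂ (inj₂ (trans (sO b nb) x , trans (pE b) y))
    explPar' : ∀ x q → S c' x ≡ EXPLORE → P c' x ≡ just q → S c' q ≡ EXPLORE × W c' q ≡ just x
    explPar' x q h1 h2 = cases≡ x u
      (λ { refl → let qv = just-injective (trans (sym h2) (trans (pE u) e2)) in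
           subst (λ z → S c' z ≡ EXPLORE × W c' z ≡ just u) (sym qv) (trans (sO v v≢u) sv , trans (wO v v≢u) wv) })
      (λ nx → let (y1 , y2) = explPar x q (exE x nx h1) (trans (sym (pE x)) h2)
                  nq : q ≢ u
                  nq = λ { refl → notEx y1 }
              in trans (sO q nq) y1 , trans (wO q nq) y2)
    -- no node other than u explores at the depth of u (it would be a second child of v on the path)
    eqDepth : ∀ y → y ≢ u → S c y ≡ EXPLORE → d y ≡ d u → y ≡ u
    eqDepth y ny ey dy = cases≡ y r (λ { refl → ⊥-elim (0≢s (trans (sym rootD) (trans dy (proj₂ (proj₂ pinf))))) })
      (λ nr → let (q , qe , _ , _ , dq) = par y nr (explore⇒woken c y ey)
                  (eq , wq) = explPar y q ey qe
                  qv = explUniq q v eq sv (suc-injective (trans (sym dq) (trans dy (proj₂ (proj₂ pinf)))))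
              in ⊥-elim (ny (just-injective (trans (sym wq) (trans (cong W' qv) wv)))))
      where
      0≢s : ∀ {z} → 0 ≢ suc z
      0≢s ()
      W' : Fin N → Maybe (Fin N)
      W' = W c
    explUniq' : ∀ x y → S c' x ≡ EXPLORE → S c' y ≡ EXPLORE → d x ≡ d y → x ≡ y
    explUniq' x y h1 h2 h3 = cases≡ x u
      (λ { refl → cases≡ y u (λ { refl → refl }) (λ ny → sym (eqDepth y ny (exE y ny h2) (sym h3))) })
      (λ nx → cases≡ y u (λ { refl → eqDepth x nx (exE x nx h1) h3 })
         (λ ny → explUniq x y (exE x nx h1) (exE y ny h2) h3))
    tipDeep' : ∀ x y → Tip c' x → S c' y ≡ EXPLORE → d y ≤ d x
    tipDeep' x y t h = cases≡ x u
      (λ { refl → cases≡ y u (λ { refl → ≤-refl })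
           (λ ny → ≤-trans (tipDeep v y tipV (exE y ny h)) (≤-trans (n≤1+n (d v)) (≤-reflexive (sym (proj₂ (proj₂ pinf)))))) })
      (λ nx → ⊥-elim (vt (subst (Tip c') (tipUniq (tipE x nx t) tipV) t)))
    waitOK' : ∀ x b → S c' x ≡ EXPLORE → W c' x ≡ just b → Edge x b × P c' x ≢ just b × b ∉ Rm c' x
    waitOK' x b h1 h2 = cases≡ x u (λ { refl → ⊥-elim (nothing≢just (trans (sym wU) h2)) })
      (λ ne → let (a , b' , c0) = waitOK x b (exE x ne h1) (trans (sym (wO x ne)) h2)
              in a , subst (λ z → z ≢ just b) (sym (pE x)) b' , subst (b ∉_) (sym (rmO x ne)) c0)
    remOK' : ∀ x b → S c' x ≡ EXPLORE → b ∈ Rm c' x → Edge x b × P c' x ≢ just b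
    remOK' x b h1 h2 = cases≡ x u
      (λ { refl → let h' = subst (b ∈_) rmU h2 in
           ∈tabulate⇒true (adj u) b (x∈p-y⇒x∈p (𝒩 u) b v h') , (λ z → x∈p-y⇒x≢y (𝒩 u) b v h' (just-injective (trans (sym z) (trans (pE u) e2)))) })
      (λ ne → subst (λ z → Edge x b × z ≢ just b) (sym (pE x)) (remOK x b (exE x ne h1) (subst (b ∈_) (rmO x ne) h2)))
    kMax' : ∀ w → K c' w ≤ suc m
    kMax' w = cases≡ w u (λ { refl → subst (_≤ suc m) (sym kU) kk }) (λ ne → subst (_≤ suc m) (sym (kO w ne)) (kMax w))
      where
      kk : suc (K c u) ≤ suc m
      kk with rel
      ... | inj₁ (_ , x) = ≤-trans (n≤1+n _) (subst (_≤ suc m) (sym x) (kMax v))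
      ... | inj₂ (_ , x) = subst (_≤ suc m) (sym x) (kMax v)
    kExpl' : ∀ w → S c' w ≡ EXPLORE ⊎ S c' w ≡ DONE → 1 ≤ K c' w
    kExpl' w h = cases≡ w u (λ { refl → subst (1 ≤_) (sym kU) (s≤s z≤n) })
      (λ ne → subst (1 ≤_) (sym (kO w ne)) (kExpl w (subst (λ s → s ≡ EXPLORE ⊎ s ≡ DONE) (sO w ne) h)))
    kIdle' : ∀ w → S c' w ≡ IDLE → K c' w ≢ suc m
    kIdle' w h = cases≡ w u (λ { refl → ⊥-elim (EXPLORE≢IDLE (trans (sym sU) h)) })
      (λ ne → subst (_≢ suc m) (sym (kO w ne)) (kIdle w (trans (sym (sO w ne)) h)))
    kPh2' : ∀ w → S c' w ≡ EXPLORE → Ph c' w ≡ ph2 → K c' w ≡ suc m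
    kPh2' w h1 h2 = cases≡ w u (λ { refl → ⊥-elim (ph1≢ph2 (trans (sym phU) h2)) })
      (λ ne → trans (kO w ne) (kPh2 w (exE w ne h1) (trans (sym (phO w ne)) h2)))
    treeIdle' : ∀ p y → P c' y ≡ just p → S c' p ≡ IDLE → S c' y ≡ IDLE × suc (K c' y) ≡ K c' p
    treeIdle' p y h1 h2 = cases≡ p u (λ { refl → ⊥-elim (EXPLORE≢IDLE (trans (sym sU) h2)) })
      (λ np → cases≡ y u
        (λ { refl → ⊥-elim (EXPLORE≢IDLE (trans (sym sv) (trans (cong (S c) (just-injective (trans (sym e2) (trans (sym (pE u)) h1)))) (trans (sym (sO p np)) h2)))) })
        (λ ny → let (a , b) = treeIdle p y (trans (sym (pE y)) h1) (trans (sym (sO p np)) h2)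
                in trans (sO y ny) a , trans (cong suc (kO y ny)) (trans b (sym (kO p np)))))
    treeDone' : ∀ p y → P c' y ≡ just p → S c' p ≡ DONE → S c' y ≡ DONE
    treeDone' p y h1 h2 = cases≡ p u (λ { refl → ⊥-elim (EXPLORE≢DONE (trans (sym sU) h2)) })
      (λ np → cases≡ y u
        (λ { refl → ⊥-elim (EXPLORE≢DONE (trans (sym sv) (trans (cong (S c) (just-injective (trans (sym e2) (trans (sym (pE u)) h1)))) (trans (sym (sO p np)) h2)))) })
        (λ ny → trans (sO y ny) (treeDone p y (trans (sym (pE y)) h1) (trans (sym (sO p np)) h2))))
    tree1' : ∀ p y → P c' y ≡ just p → S c' p ≡ EXPLORE → Ph c' p ≡ ph1 → T1 c' p y
    tree1' p y h1 h2 h3 = cases≡ p u (λ { refl → tU (trans (sym (pE y)) h1) })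
      (λ np → cases≡ y u (λ { refl → tV (just-injective (trans (sym e2) (trans (sym (pE u)) h1))) np (trans (sym (phO p np)) h3) })
        (λ ny → tr np ny (tree1 p y (trans (sym (pE y)) h1) (exE p np h2) (trans (sym (phO p np)) h3))))
      where
      tr : p ≢ u → y ≢ u → T1 c p y → T1 c' p y
      tr np ny t rewrite rmO p np | sO y ny | kO y ny | kO p np | wO p np | chO p y (inj₂ ny) = t
      tU : P c y ≡ just u → T1 c' u y
      tU py rewrite rmU | sO y (λ { refl → noCyc py py }) | kO y (λ { refl → noCyc py py }) | kU | wU =
        (λ _ → proj₁ old , cong suc (proj₂ old)) ,
        (λ h _ → ⊥-elim (h (x∈p∧x≢y⇒x∈p-y (true⇒∈tabulate (adj u) y (proj₁ (paInfo py))) (λ { refl → noCyc py e2 })))) ,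
        (λ h → ⊥-elim (nothing≢just h))
        where
        old : S c y ≡ IDLE × suc (K c y) ≡ K c u
        old = treeIdle u y py e1
      tV : v ≡ p → p ≢ u → Ph c p ≡ ph1 → T1 c' p u
      tV refl np p1 rewrite rmO v np | sU | kU | wO v np | chVU =
        (λ h → ⊥-elim (proj₂ (proj₂ wo) h)) ,
        (λ _ h → ⊥-elim (h wv)) ,
        (λ _ → inj₂ (refl , trans kk (sym (kO _ np)) , inj₁ refl))
        where
        kk : suc (suc (K c u)) ≡ K c v
        kk with rel
        ... | inj₁ (_ , x) = x
        ... | inj₂ (x , _) with trans (sym p1) x
        ...   | ()
    tree2' : ∀ p y → P c' y ≡ just p → S c' p ≡ EXPLORE → Ph c' p ≡ ph2 → T2 c' p y
    tree2' p y h1 h2 h3 = cases≡ p u (λ { refl → ⊥-elim (ph1≢ph2 (trans (sym phU) h3)) })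
      (λ np → cases≡ y u (λ { refl → tV (just-injective (trans (sym e2) (trans (sym (pE u)) h1))) np (trans (sym (phO p np)) h3) })
        (λ ny → tr np ny (tree2 p y (trans (sym (pE y)) h1) (exE p np h2) (trans (sym (phO p np)) h3))))
      where
      tr : p ≢ u → y ≢ u → T2 c p y → T2 c' p y
      tr np ny t rewrite rmO p np | sO y ny | kO y ny | kO p np | wO p np | chO p y (inj₂ ny) = t
      tV : v ≡ p → p ≢ u → Ph c p ≡ ph2 → T2 c' p u
      tV refl np p2 rewrite rmO v np | sU | kU | wO v np | chVU =
        (λ h → ⊥-elim (proj₂ (proj₂ wo) h)) ,
        (λ _ h → ⊥-elim (h wv)) ,
        (λ _ → inj₂ (refl , trans kk (sym (kO _ np)) , inj₁ refl))
        where
        kk : suc (K c u) ≡ K c v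
        kk with rel
        ... | inj₂ (_ , x) = x
        ... | inj₁ (x , _) with trans (sym p2) x
        ...   | ()
    nb' : ∀ w x → Edge w x → Fin1 c' w → Woken c' x
    nb' w x e f = cases≡ w u (λ { refl → iniE' x (nb u x e (inj₁ (e1 , fu f))) })
      (λ ne → iniE' x (nb w x e (fE ne f)))
      where
      fE : w ≢ u → Fin1 c' w → Fin1 c w
      fE ne f rewrite sO w ne | kO w ne | phO w ne = f
      fu : Fin1 c' u → 1 ≤ K c u
      fu (inj₁ (a , _)) with trans (sym sU) a
      ... | ()
      fu (inj₂ (inj₁ a)) with trans (sym sU) a
      ... | ()
      fu (inj₂ (inj₂ (_ , inj₁ le))) = ≤-pred (subst (2 ≤_) kU le)
      fu (inj₂ (inj₂ (_ , inj₂ p))) with trans (sym phU) p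
      ... | ()
    nb3' : ∀ w x → S c' w ≡ EXPLORE → Ph c' w ≡ ph1 → Edge w x → x ∉ Rm c' w → W c' w ≢ just x → Woken c' x
    nb3' w x h1 h2 e h3 h4 = cases≡ w u
      (λ { refl → cases≡ x v (λ xv → iniE' x (subst (Woken c) (sym xv) iv))
            (λ nv → ⊥-elim (h3 (subst (x ∈_) (sym rmU) (x∈p∧x≢y⇒x∈p-y (true⇒∈tabulate (adj u) x e) nv)))) })
      (λ ne → iniE' x (nb3 w x (exE w ne h1) (trans (sym (phO w ne)) h2) e (subst (x ∉_) (rmO w ne) h3) (subst (_≢ just x) (wO w ne) h4)))

    pres : Inv c' d
    pres = record
      { rootSt = subst (λ s → s ≡ EXPLORE ⊎ s ≡ DONE) (sym (sO r (u≢r ∘ sym))) rootSt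
      ; rootPa = trans (pE r) rootPa
      ; rootD = rootD
      ; initPa = λ y h → trans (pE y) (initPa y (sInit y h))
      ; par = λ w ne iw → let (p , a , b , ip , dd) = par w ne (iniE w iw) in p , trans (pE w) a , b , iniE' p ip , dd
      ; chanE = chanE'
      ; waitE = waitE'
      ; explPar = explPar'
      ; explUniq = explUniq'
      ; tipDeep = tipDeep'
      ; waitOK = waitOK'
      ; remOK = remOK'
      ; chOK = λ x b ix h → subst (λ z → Edge x b × z ≢ just b) (sym (pE x)) (chOK x b (iniE x ix) (subst (b ∈_) (cE x) h))
      ; chAll = λ p y ip e h1 h2 → subst (y ∈_) (sym (cE p)) (chAll p y (iniE p ip) e (subst (_≢ just y) (pE p) h1)
                   (Data.Sum.map (sInit y) (trans (sym (pE y))) h2))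
      ; kMax = kMax'
      ; kExpl = kExpl'
      ; kIdle = kIdle'
      ; kPh2 = kPh2'
      ; treeIdle = treeIdle'
      ; treeDone = treeDone'
      ; tree1 = tree1'
      ; tree2 = tree2'
      ; nb = nb'
      ; nb3 = nb3'
      ; dMax = λ w iw → subst (d w ≤_) (sym (kO r (u≢r ∘ sym))) (dMax w (iniE w iw))
      ; nbd = λ w x iw le e → iniE' x (nbd w x (iniE w iw) (subst (2 + d w ≤_) (kO r (u≢r ∘ sym)) le) e)
      ; bfs = λ a b e ia ib → bfs a b e (iniE a ia) (iniE b ib)
      }

  module StepNext {c : Cfg} {d : Fin N → ℕ} (I : Inv c d) {u v : Fin N}
           (e1 : S c u ≡ EXPLORE) (e2 : W c u ≡ nothing) (e3 : v ∈ Rm c u) where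
    open Inv I
    open InvFacts I
    newL : Local N
    newL = record (loc c u) { rem = rem (loc c u) - v ; waiting = just v }
    c' : Cfg
    c' = record { loc = upd (loc c) u newL ; chan = send (chan c) u v }

    sE : ∀ w → S c' w ≡ S c w
    sE = upd-frame status (loc c) u newL refl
    pE : ∀ w → P c' w ≡ P c w
    pE = upd-frame parent (loc c) u newL refl
    kE : ∀ w → K c' w ≡ K c w
    kE = upd-frame count (loc c) u newL refl
    cE : ∀ w → Cs c' w ≡ Cs c w
    cE = upd-frame children (loc c) u newL refl
    phE : ∀ w → Ph c' w ≡ Ph c w
    phE = upd-frame phase (loc c) u newL refl
    rmO : ∀ w → w ≢ u → Rm c' w ≡ Rm c w
    rmO w ne = cong rem (upd-other (loc c) u newL w ne)
    wO : ∀ w → w ≢ u → W c' w ≡ W c w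
    wO w ne = cong waiting (upd-other (loc c) u newL w ne)
    rmU : Rm c' u ≡ Rm c u - v
    rmU = cong rem (upd-here (loc c) u newL)
    wU : W c' u ≡ just v
    wU = cong waiting (upd-here (loc c) u newL)
    chO : ∀ a b → (a ≢ u ⊎ b ≢ v) → ch c' a b ≡ ch c a b
    chO a b h = send-other (chan c) u v a b h
    tipU : Tip c u
    tipU = e1 , inj₁ e2
    ro : Edge u v × P c u ≢ just v
    ro = remOK u v e1 e3
    nc : ∀ b → ch c u b ≡ 0 × ch c b u ≡ 0
    nc = noChan e1 e2
    chU : ch c' u v ≡ 1
    chU = trans (send-here (chan c) u v) (cong suc (proj₁ (nc v)))
    u≢v : u ≢ v
    u≢v = edge⇒≢ (proj₁ ro)

    s1 : S c v ≢ EXPLORE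
    s1 ex with tipDeep u v tipU ex | bfs u v (proj₁ ro) (explore⇒woken c u e1) (explore⇒woken c v ex)
    ... | le1 | le2 with m≤n⇒m<n∨m≡n le1
    ... | inj₂ eq = u≢v (sym (explUniq v u ex e1 eq))
    ... | inj₁ lt with u ≟ r
    ...   | yes refl = ⊥-elim (n≮0 (subst (d v <_) rootD lt))
    ...   | no ne with par u ne (explore⇒woken c u e1)
    ...     | q , qe , _ , _ , dq with explPar u q e1 qe
    ...       | eq' , _ = proj₂ ro (subst (λ z → P c u ≡ just z) (explUniq q v eq' ex dd) qe)
      where
      dd : d q ≡ d v
      dd = suc-injective (≤-antisym (subst (_≤ suc (d v)) dq le2) (subst (suc (d v) ≤_) dq lt))

    iniE : ∀ w → Woken c' w → Woken c w
    iniE w h rewrite sym (sE w) = h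
    iniE' : ∀ w → Woken c w → Woken c' w
    iniE' w h rewrite sE w = h

    tipE : ∀ x → Tip c' x → Tip c x
    tipE x t = cases≡ x u (λ { refl → tipU }) (λ ne → tr ne t)
      where
      tr : x ≢ u → Tip c' x → Tip c x
      tr ne (a , inj₁ w) = trans (sym (sE x)) a , inj₁ (trans (sym (wO x ne)) w)
      tr ne (a , inj₂ (b , w , inj₁ h)) = trans (sym (sE x)) a , inj₂ (b , trans (sym (wO x ne)) w , inj₁ (trans (sym (chO x b (inj₁ ne))) h))
      tr ne (a , inj₂ (b , w , inj₂ h)) = cases≡ x v (λ { refl → ⊥-elim (s1 (trans (sym (sE v)) a)) })
        (λ nv → trans (sym (sE x)) a , inj₂ (b , trans (sym (wO x ne)) w , inj₂ (trans (sym (chO b x (inj₂ nv))) h)))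

    fE : ∀ w → Fin1 c' w → Fin1 c w
    fE w f rewrite sE w | kE w | phE w = f
    chanE' : ∀ a b → ch c' a b ≢ 0 → ch c' a b ≡ 1 × ch c' b a ≡ 0 × Woken c' a × (Req c' a b ⊎ Req c' b a)
    chanE' a b h = cases≡ a u (λ { refl → cases≡ b v (λ { refl → chU , trans (chO v u (inj₁ (u≢v ∘ sym))) (proj₂ (nc v)) , iniE' u (explore⇒woken c u e1) , inj₁ (trans (sE u) e1 , wU , λ z → s1 (trans (sym (sE v)) z)) })
                                                    (λ nb → ⊥-elim (h (trans (chO u b (inj₂ nb)) (proj₁ (nc b))))) })
                 (λ na → cases≡ b u (λ { refl → ⊥-elim (h (trans (chO a u (inj₁ na)) (proj₂ (nc a)))) })
                   (λ nb → let old = chanE a b (λ z → h (trans (chO a b (inj₁ na)) z))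
                               (x1 , x2 , x3 , x4) = old
                           in trans (chO a b (inj₁ na)) x1 , trans (chO b a (inj₁ nb)) x2 , iniE' a x3 , rq na nb x4))
      where
      rq : a ≢ u → b ≢ u → Req c a b ⊎ Req c b a → Req c' a b ⊎ Req c' b a
      rq na nb x rewrite sE a | sE b | wO a na | wO b nb = x
    waitE' : ∀ a b → S c' a ≡ EXPLORE → W c' a ≡ just b → ch c' a b ≡ 1 ⊎ ch c' b a ≡ 1 ⊎ (S c' b ≡ EXPLORE × P c' b ≡ just a)
    waitE' a b h1 h2 = cases≡ a u (λ { refl → inj₁ (subst (λ z → ch c' u z ≡ 1) (just-injective (trans (sym wU) h2)) chU) })
      (λ na → tr na (waitE a b (trans (sym (sE a)) h1) (trans (sym (wO a na)) h2)))
      where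
      tr : a ≢ u → ch c a b ≡ 1 ⊎ ch c b a ≡ 1 ⊎ (S c b ≡ EXPLORE × P c b ≡ just a) → ch c' a b ≡ 1 ⊎ ch c' b a ≡ 1 ⊎ (S c' b ≡ EXPLORE × P c' b ≡ just a)
      tr na (inj₁ x) = inj₁ (trans (chO a b (inj₁ na)) x)
      tr na (inj₂ (inj₁ x)) = cases≡ b u (λ { refl → ⊥-elim (0≢1+n (trans (sym (proj₁ (nc a))) x)) })
        (λ nb → inj₂ (inj₁ (trans (chO b a (inj₁ nb)) x)))
      tr na (inj₂ (inj₂ (x , y))) = inj₂ (inj₂ (trans (sE b) x , trans (pE b) y))
    explPar' : ∀ x q → S c' x ≡ EXPLORE → P c' x ≡ just q → S c' q ≡ EXPLORE × W c' q ≡ just x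
    explPar' x q h1 h2 = let (y1 , y2) = explPar x q (trans (sym (sE x)) h1) (trans (sym (pE x)) h2)
                         in trans (sE q) y1 , cases≡ q u (λ { refl → ⊥-elim (nothing≢just (trans (sym e2) y2)) }) (λ nq → trans (wO q nq) y2)
    waitOK' : ∀ x b → S c' x ≡ EXPLORE → W c' x ≡ just b → Edge x b × P c' x ≢ just b × b ∉ Rm c' x
    waitOK' x b h1 h2 = cases≡ x u
      (λ { refl → let bv = just-injective (trans (sym wU) h2) in
           subst (λ z → Edge u z × P c' u ≢ just z × z ∉ Rm c' u) bv
             (proj₁ ro , subst (_≢ just v) (sym (pE u)) (proj₂ ro) , λ h → x∈p-y⇒x≢y (Rm c u) v v (subst (v ∈_) rmU h) refl) })
      (λ ne → let (a , b' , c0) = waitOK x b (trans (sym (sE x)) h1) (trans (sym (wO x ne)) h2)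
              in a , subst (λ z → z ≢ just b) (sym (pE x)) b' , subst (b ∉_) (sym (rmO x ne)) c0)
    remOK' : ∀ x b → S c' x ≡ EXPLORE → b ∈ Rm c' x → Edge x b × P c' x ≢ just b
    remOK' x b h1 h2 = subst (λ z → Edge x b × z ≢ just b) (sym (pE x)) (remOK x b (trans (sym (sE x)) h1)
      (cases≡ x u (λ { refl → x∈p-y⇒x∈p (Rm c u) b v (subst (b ∈_) rmU h2) }) (λ ne → subst (b ∈_) (rmO x ne) h2)))
    chOK' : ∀ x b → Woken c' x → b ∈ Cs c' x → Edge x b × P c' x ≢ just b
    chOK' x b ix h rewrite pE x | cE x = chOK x b (iniE x ix) h
    chAll' : ∀ p y → Woken c' p → Edge p y → P c' p ≢ just y → (S c' y ≡ INIT ⊎ P c' y ≡ just p) → y ∈ Cs c' p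
    chAll' p y ip e h1 h2 rewrite cE p | pE p | sE y | pE y = chAll p y (iniE p ip) e h1 h2
    treeIdle' : ∀ p y → P c' y ≡ just p → S c' p ≡ IDLE → S c' y ≡ IDLE × suc (K c' y) ≡ K c' p
    treeIdle' p y h1 h2 rewrite pE y | sE p | sE y | kE y | kE p = treeIdle p y h1 h2
    tree1' : ∀ p y → P c' y ≡ just p → S c' p ≡ EXPLORE → Ph c' p ≡ ph1 → T1 c' p y
    tree1' p y h1 h2 h3 = cases≡ p u (λ { refl → tr2 old })
      (λ ne → tr ne old)
      where
      old : T1 c p y
      old = tree1 p y (trans (sym (pE y)) h1) (trans (sym (sE p)) h2) (trans (sym (phE p)) h3)
      tr : p ≢ u → T1 c p y → T1 c' p y
      tr ne t rewrite rmO p ne | sE y | kE y | kE p | wO p ne | chO p y (inj₁ ne) = t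
      tr2 : T1 c u y → T1 c' u y
      tr2 (t1 , t2 , t3) rewrite rmU | sE y | kE y | kE u | wU =
        (λ h → t1 (x∈p-y⇒x∈p (Rm c u) y v h)) ,
        (λ h hw → t2 (λ h' → h (x∈p∧x≢y⇒x∈p-y h' (λ eq → hw (cong just (sym eq))))) (λ h' → nothing≢just (trans (sym e2) h'))) ,
        (λ { refl → let (a , b) = t1 e3 in inj₁ (chU , a , b) })
    tree2' : ∀ p y → P c' y ≡ just p → S c' p ≡ EXPLORE → Ph c' p ≡ ph2 → T2 c' p y
    tree2' p y h1 h2 h3 = cases≡ p u (λ { refl → tr2 old })
      (λ ne → tr ne old)
      where
      old : T2 c p y
      old = tree2 p y (trans (sym (pE y)) h1) (trans (sym (sE p)) h2) (trans (sym (phE p)) h3)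
      tr : p ≢ u → T2 c p y → T2 c' p y
      tr ne t rewrite rmO p ne | sE y | kE y | kE p | wO p ne | chO p y (inj₁ ne) = t
      tr2 : T2 c u y → T2 c' u y
      tr2 (t1 , t2 , t3) rewrite rmU | sE y | kE y | kE u | wU =
        (λ h → t1 (x∈p-y⇒x∈p (Rm c u) y v h)) ,
        (λ h hw → t2 (λ h' → h (x∈p∧x≢y⇒x∈p-y h' (λ eq → hw (cong just (sym eq))))) (λ h' → nothing≢just (trans (sym e2) h'))) ,
        (λ { refl → let (a , b) = t1 e3 in inj₁ (chU , a , b) })
    nb3' : ∀ w x → S c' w ≡ EXPLORE → Ph c' w ≡ ph1 → Edge w x → x ∉ Rm c' w → W c' w ≢ just x → Woken c' x
    nb3' w x h1 h2 e h3 h4 = cases≡ w u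
      (λ { refl → iniE' x (nb3 u x e1 (trans (sym (phE u)) h2) e
                 (λ h' → h3 (subst (x ∈_) (sym rmU) (x∈p∧x≢y⇒x∈p-y h' (λ eq → h4 (trans wU (cong just (sym eq)))))))
                 (λ h' → nothing≢just (trans (sym e2) h'))) })
      (λ ne → iniE' x (nb3 w x (trans (sym (sE w)) h1) (trans (sym (phE w)) h2) e (subst (x ∉_) (rmO w ne) h3) (subst (_≢ just x) (wO w ne) h4)))

    pres : Inv c' d
    pres = record
      { rootSt = subst (λ s → s ≡ EXPLORE ⊎ s ≡ DONE) (sym (sE r)) rootSt
      ; rootPa = trans (pE r) rootPa
      ; rootD = rootD
      ; initPa = λ y h → trans (pE y) (initPa y (trans (sym (sE y)) h))
      ; par = λ w ne iw → let (p , a , b , ip , dd) = par w ne (iniE w iw) in p , trans (pE w) a , b , iniE' p ip , dd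
      ; chanE = chanE'
      ; waitE = waitE'
      ; explPar = explPar'
      ; explUniq = λ x y h1 h2 h3 → explUniq x y (trans (sym (sE x)) h1) (trans (sym (sE y)) h2) h3
      ; tipDeep = λ x y t h → tipDeep x y (tipE x t) (trans (sym (sE y)) h)
      ; waitOK = waitOK'
      ; remOK = remOK'
      ; chOK = chOK'
      ; chAll = chAll'
      ; kMax = λ w → subst (_≤ suc m) (sym (kE w)) (kMax w)
      ; kExpl = λ w h → subst (1 ≤_) (sym (kE w)) (kExpl w (subst (λ s → s ≡ EXPLORE ⊎ s ≡ DONE) (sE w) h))
      ; kIdle = λ w h → subst (_≢ suc m) (sym (kE w)) (kIdle w (trans (sym (sE w)) h))
      ; kPh2 = λ w h1 h2 → trans (kE w) (kPh2 w (trans (sym (sE w)) h1) (trans (sym (phE w)) h2))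
      ; treeIdle = treeIdle'
      ; treeDone = λ p y h1 h2 → trans (sE y) (treeDone p y (trans (sym (pE y)) h1) (trans (sym (sE p)) h2))
      ; tree1 = tree1'
      ; tree2 = tree2'
      ; nb = λ w x e f → iniE' x (nb w x e (fE w f))
      ; nb3 = nb3'
      ; dMax = λ w iw → subst (d w ≤_) (sym (kE r)) (dMax w (iniE w iw))
      ; nbd = λ w x iw le e → iniE' x (nbd w x (iniE w iw) (subst (2 + d w ≤_) (kE r) le) e)
      ; bfs = λ a b e ia ib → bfs a b e (iniE a ia) (iniE b ib)
      }

  module StepReply {c : Cfg} {d : Fin N → ℕ} (I : Inv c d) {u v : Fin N} {k : ℕ}
           (e0 : ch c v u ≡ suc k) (e1 : S c u ≡ EXPLORE) (e2 : W c u ≡ just v) where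
    open Inv I
    open InvFacts I
    newL : Local N
    newL = record (loc c u) { waiting = nothing }
    c' : Cfg
    c' = record { loc = upd (loc c) u newL ; chan = consume (chan c) v u }

    sE : ∀ w → S c' w ≡ S c w
    sE = upd-frame status (loc c) u newL refl
    pE : ∀ w → P c' w ≡ P c w
    pE = upd-frame parent (loc c) u newL refl
    kE : ∀ w → K c' w ≡ K c w
    kE = upd-frame count (loc c) u newL refl
    cE : ∀ w → Cs c' w ≡ Cs c w
    cE = upd-frame children (loc c) u newL refl
    phE : ∀ w → Ph c' w ≡ Ph c w
    phE = upd-frame phase (loc c) u newL refl
    rmE : ∀ w → Rm c' w ≡ Rm c w
    rmE = upd-frame rem (loc c) u newL refl
    wO : ∀ w → w ≢ u → W c' w ≡ W c w
    wO w ne = cong waiting (upd-other (loc c) u newL w ne)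
    wU : W c' u ≡ nothing
    wU = cong waiting (upd-here (loc c) u newL)
    chO : ∀ a b → (a ≢ v ⊎ b ≢ u) → ch c' a b ≡ ch c a b
    chO a b h = consume-other (chan c) v u a b h

    ce : ch c v u ≡ 1 × ch c u v ≡ 0 × Woken c v × (Req c v u ⊎ Req c u v)
    ce = inTransit e0
    c1 : ch c v u ≡ 1
    c1 = proj₁ ce
    c2 : ch c u v ≡ 0
    c2 = proj₁ (proj₂ ce)
    iv : Woken c v
    iv = proj₁ (proj₂ (proj₂ ce))
    sv : S c v ≢ EXPLORE
    sv with proj₂ (proj₂ (proj₂ ce))
    ... | inj₁ (_ , _ , z) = ⊥-elim (z e1)
    ... | inj₂ (_ , _ , z) = z
    chU : ch c' v u ≡ 0
    chU = trans (consume-here (chan c) v u) (cong (_∸ 1) c1)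
    tipU : Tip c u
    tipU = e1 , inj₂ (v , e2 , inj₂ c1)
    wo : Edge u v × P c u ≢ just v × v ∉ Rm c u
    wo = waitOK u v e1 e2
    u≢v : u ≢ v
    u≢v = edge⇒≢ (proj₁ wo)

    nc1 : ∀ b → ch c u b ≡ 0
    nc1 b with ch c u b in eq
    ... | zero = refl
    ... | suc z with chanE u b (λ h → 0≢1+n (trans (sym h) eq))
    ... | x1 , _ , _ , inj₁ (_ , w , _) with just-injective (trans (sym e2) w)
    ...   | refl = ⊥-elim (1+n≢0 (trans (sym x1) c2))
    nc1 b | suc z | x1 , _ , _ , inj₂ rq with tipUniq (reqTip rq (inj₂ x1)) tipU
    ...   | refl = ⊥-elim (u≢v (just-injective (trans (sym (proj₁ (proj₂ rq))) e2)))
    nc2 : ∀ a → a ≢ v → ch c a u ≡ 0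
    nc2 a na with ch c a u in eq
    ... | zero = refl
    ... | suc z with chanE a u (λ h → 0≢1+n (trans (sym h) eq))
    ... | x1 , _ , _ , inj₂ (_ , w , _) = ⊥-elim (na (just-injective (trans (sym w) e2)))
    ... | x1 , _ , _ , inj₁ rq with tipUniq (reqTip rq (inj₁ x1)) tipU
    ...   | refl = ⊥-elim (u≢v (just-injective (trans (sym (proj₁ (proj₂ rq))) e2)))

    iniE : ∀ w → Woken c' w → Woken c w
    iniE w h rewrite sym (sE w) = h
    iniE' : ∀ w → Woken c w → Woken c' w
    iniE' w h rewrite sE w = h

    tipE : ∀ x → Tip c' x → Tip c x
    tipE x t = cases≡ x u (λ { refl → tipU }) (λ ne → cases≡ x v (λ { refl → ⊥-elim (sv (trans (sym (sE v)) (proj₁ t))) }) (λ nv → tr ne nv t))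
      where
      tr : x ≢ u → x ≢ v → Tip c' x → Tip c x
      tr ne nv (a , inj₁ w) = trans (sym (sE x)) a , inj₁ (trans (sym (wO x ne)) w)
      tr ne nv (a , inj₂ (b , w , inj₁ h)) = trans (sym (sE x)) a , inj₂ (b , trans (sym (wO x ne)) w , inj₁ (trans (sym (chO x b (inj₁ nv))) h))
      tr ne nv (a , inj₂ (b , w , inj₂ h)) = trans (sym (sE x)) a , inj₂ (b , trans (sym (wO x ne)) w , inj₂ (trans (sym (chO b x (inj₂ ne))) h))

    fE : ∀ w → Fin1 c' w → Fin1 c w
    fE w f rewrite sE w | kE w | phE w = f
    chanE' : ∀ a b → ch c' a b ≢ 0 → ch c' a b ≡ 1 × ch c' b a ≡ 0 × Woken c' a × (Req c' a b ⊎ Req c' b a)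
    chanE' a b h = cases≡ a u (λ { refl → ⊥-elim (h (trans (chO u b (inj₁ u≢v)) (nc1 b))) })
      (λ na → cases≡ b u
        (λ { refl → cases≡ a v (λ { refl → ⊥-elim (h chU) }) (λ nav → ⊥-elim (h (trans (chO a u (inj₁ nav)) (nc2 a nav)))) })
        (λ nb → let (x1 , x2 , x3 , x4) = chanE a b (λ z → h (trans (chO a b (inj₂ nb)) z))
                in trans (chO a b (inj₂ nb)) x1 , trans (chO b a (inj₂ na)) x2 , iniE' a x3 , rq na nb x4))
      where
      rq : a ≢ u → b ≢ u → Req c a b ⊎ Req c b a → Req c' a b ⊎ Req c' b a
      rq na nb x rewrite sE a | sE b | wO a na | wO b nb = x
    waitE' : ∀ a b → S c' a ≡ EXPLORE → W c' a ≡ just b → ch c' a b ≡ 1 ⊎ ch c' b a ≡ 1 ⊎ (S c' b ≡ EXPLORE × P c' b ≡ just a)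
    waitE' a b h1 h2 = cases≡ a u (λ { refl → ⊥-elim (nothing≢just (trans (sym wU) h2)) })
      (λ na → tr na (waitE a b (trans (sym (sE a)) h1) (trans (sym (wO a na)) h2)))
      where
      tr : a ≢ u → ch c a b ≡ 1 ⊎ ch c b a ≡ 1 ⊎ (S c b ≡ EXPLORE × P c b ≡ just a) → ch c' a b ≡ 1 ⊎ ch c' b a ≡ 1 ⊎ (S c' b ≡ EXPLORE × P c' b ≡ just a)
      tr na (inj₁ x) = cases≡ a v (λ { refl → ⊥-elim (sv (trans (sym (sE v)) h1)) })
        (λ nav → inj₁ (trans (chO a b (inj₁ nav)) x))
      tr na (inj₂ (inj₁ x)) = inj₂ (inj₁ (trans (chO b a (inj₂ na)) x))
      tr na (inj₂ (inj₂ (x , y))) = inj₂ (inj₂ (trans (sE b) x , trans (pE b) y))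
    explPar' : ∀ x q → S c' x ≡ EXPLORE → P c' x ≡ just q → S c' q ≡ EXPLORE × W c' q ≡ just x
    explPar' x q h1 h2 = let (y1 , y2) = explPar x q (trans (sym (sE x)) h1) (trans (sym (pE x)) h2)
                         in trans (sE q) y1 , cases≡ q u (λ { refl → ⊥-elim (sv (subst (λ z → S c z ≡ EXPLORE) (just-injective (trans (sym y2) e2)) (trans (sym (sE x)) h1))) }) (λ nq → trans (wO q nq) y2)
    waitOK' : ∀ x b → S c' x ≡ EXPLORE → W c' x ≡ just b → Edge x b × P c' x ≢ just b × b ∉ Rm c' x
    waitOK' x b h1 h2 = cases≡ x u (λ { refl → ⊥-elim (nothing≢just (trans (sym wU) h2)) })
      (λ ne → let (a , b' , c0) = waitOK x b (trans (sym (sE x)) h1) (trans (sym (wO x ne)) h2)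
              in a , subst (λ z → z ≢ just b) (sym (pE x)) b' , subst (b ∉_) (sym (rmE x)) c0)
    chOK' : ∀ x b → Woken c' x → b ∈ Cs c' x → Edge x b × P c' x ≢ just b
    chOK' x b ix h rewrite pE x | cE x = chOK x b (iniE x ix) h
    chAll' : ∀ p y → Woken c' p → Edge p y → P c' p ≢ just y → (S c' y ≡ INIT ⊎ P c' y ≡ just p) → y ∈ Cs c' p
    chAll' p y ip e h1 h2 rewrite cE p | pE p | sE y | pE y = chAll p y (iniE p ip) e h1 h2
    treeIdle' : ∀ p y → P c' y ≡ just p → S c' p ≡ IDLE → S c' y ≡ IDLE × suc (K c' y) ≡ K c' p
    treeIdle' p y h1 h2 rewrite pE y | sE p | sE y | kE y | kE p = treeIdle p y h1 h2
    chPY : ∀ p y → P c y ≡ just p → ch c' p y ≡ ch c p y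
    chPY p y py = cases≡ p v (λ { refl → chO v y (inj₂ (λ { refl → proj₁ (proj₂ wo) py })) }) (λ nv → chO p y (inj₁ nv))
    tree1' : ∀ p y → P c' y ≡ just p → S c' p ≡ EXPLORE → Ph c' p ≡ ph1 → T1 c' p y
    tree1' p y h1 h2 h3 = cases≡ p u (λ { refl → tr2 old })
      (λ ne → tr ne old)
      where
      py : P c y ≡ just p
      py = trans (sym (pE y)) h1
      old : T1 c p y
      old = tree1 p y py (trans (sym (sE p)) h2) (trans (sym (phE p)) h3)
      tr : p ≢ u → T1 c p y → T1 c' p y
      tr ne t rewrite rmE p | sE y | kE y | kE p | wO p ne | chPY p y py = t
      tr2 : T1 c u y → T1 c' u y
      tr2 (t1 , t2 , t3) rewrite rmE u | sE y | kE y | kE u | wU =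
        t1 ,
        (λ h _ → cases≡ y v (λ eq → sec eq (t3 (trans e2 (cong just (sym eq))))) (λ nv → t2 h (λ h' → nv (sym (just-injective (trans (sym e2) h')))))) ,
        (λ h → ⊥-elim (nothing≢just h))
        where
        sec : y ≡ v → (ch c u y ≡ 1 × S c y ≡ IDLE × suc (suc (K c y)) ≡ K c u) ⊎ (ch c u y ≡ 0 × suc (K c y) ≡ K c u × (S c y ≡ EXPLORE ⊎ S c y ≡ IDLE)) → S c y ≡ IDLE × suc (K c y) ≡ K c u
        sec eq (inj₁ (a , _)) = ⊥-elim (1+n≢0 (trans (sym a) (subst (λ z → ch c u z ≡ 0) (sym eq) c2)))
        sec eq (inj₂ (_ , b , inj₁ x)) = ⊥-elim (sv (subst (λ z → S c z ≡ EXPLORE) eq x))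
        sec eq (inj₂ (_ , b , inj₂ x)) = x , b
    tree2' : ∀ p y → P c' y ≡ just p → S c' p ≡ EXPLORE → Ph c' p ≡ ph2 → T2 c' p y
    tree2' p y h1 h2 h3 = cases≡ p u (λ { refl → tr2 old })
      (λ ne → tr ne old)
      where
      py : P c y ≡ just p
      py = trans (sym (pE y)) h1
      old : T2 c p y
      old = tree2 p y py (trans (sym (sE p)) h2) (trans (sym (phE p)) h3)
      tr : p ≢ u → T2 c p y → T2 c' p y
      tr ne t rewrite rmE p | sE y | kE y | kE p | wO p ne | chPY p y py = t
      tr2 : T2 c u y → T2 c' u y
      tr2 (t1 , t2 , t3) rewrite rmE u | sE y | kE y | kE u | wU =
        t1 ,
        (λ h _ → cases≡ y v (λ eq → sec eq (t3 (trans e2 (cong just (sym eq))))) (λ nv → t2 h (λ h' → nv (sym (just-injective (trans (sym e2) h')))))) ,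
        (λ h → ⊥-elim (nothing≢just h))
        where
        sec : y ≡ v → (ch c u y ≡ 1 × S c y ≡ IDLE × suc (K c y) ≡ K c u) ⊎ (ch c u y ≡ 0 × K c y ≡ K c u × (S c y ≡ EXPLORE ⊎ S c y ≡ DONE)) → S c y ≡ DONE
        sec eq (inj₁ (a , _)) = ⊥-elim (1+n≢0 (trans (sym a) (subst (λ z → ch c u z ≡ 0) (sym eq) c2)))
        sec eq (inj₂ (_ , b , inj₁ x)) = ⊥-elim (sv (subst (λ z → S c z ≡ EXPLORE) eq x))
        sec eq (inj₂ (_ , b , inj₂ x)) = x
    nb3' : ∀ w x → S c' w ≡ EXPLORE → Ph c' w ≡ ph1 → Edge w x → x ∉ Rm c' w → W c' w ≢ just x → Woken c' x
    nb3' w x h1 h2 e h3 h4 = cases≡ w u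
      (λ { refl → cases≡ x v (λ eq → iniE' x (subst (Woken c) (sym eq) iv))
           (λ nv → iniE' x (nb3 u x e1 (trans (sym (phE u)) h2) e (subst (x ∉_) (rmE u) h3) (λ h' → nv (sym (just-injective (trans (sym e2) h')))))) })
      (λ ne → iniE' x (nb3 w x (trans (sym (sE w)) h1) (trans (sym (phE w)) h2) e (subst (x ∉_) (rmE w) h3) (subst (_≢ just x) (wO w ne) h4)))

    pres : Inv c' d
    pres = record
      { rootSt = subst (λ s → s ≡ EXPLORE ⊎ s ≡ DONE) (sym (sE r)) rootSt
      ; rootPa = trans (pE r) rootPa
      ; rootD = rootD
      ; initPa = λ y h → trans (pE y) (initPa y (trans (sym (sE y)) h))
      ; par = λ w ne iw → let (p , a , b , ip , dd) = par w ne (iniE w iw) in p , trans (pE w) a , b , iniE' p ip , dd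
      ; chanE = chanE'
      ; waitE = waitE'
      ; explPar = explPar'
      ; explUniq = λ x y h1 h2 h3 → explUniq x y (trans (sym (sE x)) h1) (trans (sym (sE y)) h2) h3
      ; tipDeep = λ x y t h → tipDeep x y (tipE x t) (trans (sym (sE y)) h)
      ; waitOK = waitOK'
      ; remOK = λ x b h1 h2 → subst (λ z → Edge x b × z ≢ just b) (sym (pE x)) (remOK x b (trans (sym (sE x)) h1) (subst (b ∈_) (rmE x) h2))
      ; chOK = chOK'
      ; chAll = chAll'
      ; kMax = λ w → subst (_≤ suc m) (sym (kE w)) (kMax w)
      ; kExpl = λ w h → subst (1 ≤_) (sym (kE w)) (kExpl w (subst (λ s → s ≡ EXPLORE ⊎ s ≡ DONE) (sE w) h))
      ; kIdle = λ w h → subst (_≢ suc m) (sym (kE w)) (kIdle w (trans (sym (sE w)) h))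
      ; kPh2 = λ w h1 h2 → trans (kE w) (kPh2 w (trans (sym (sE w)) h1) (trans (sym (phE w)) h2))
      ; treeIdle = treeIdle'
      ; treeDone = λ p y h1 h2 → trans (sE y) (treeDone p y (trans (sym (pE y)) h1) (trans (sym (sE p)) h2))
      ; tree1 = tree1'
      ; tree2 = tree2'
      ; nb = λ w x e f → iniE' x (nb w x e (fE w f))
      ; nb3 = nb3'
      ; dMax = λ w iw → subst (d w ≤_) (sym (kE r)) (dMax w (iniE w iw))
      ; nbd = λ w x iw le e → iniE' x (nbd w x (iniE w iw) (subst (2 + d w ≤_) (kE r) le) e)
      ; bfs = λ a b e ia ib → bfs a b e (iniE a ia) (iniE b ib)
      }

  module StepToPhase2 {c : Cfg} {d : Fin N → ℕ} (I : Inv c d) {u : Fin N}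
           (e1 : S c u ≡ EXPLORE) (e2 : W c u ≡ nothing) (e3 : Empty (Rm c u))
           (e4 : Ph c u ≡ ph1) (e5 : K c u ≡ suc m) where
    open Inv I
    open InvFacts I
    newL : Local N
    newL = record (loc c u) { phase = ph2 ; rem = children (loc c u) }
    c' : Cfg
    c' = record c { loc = upd (loc c) u newL }

    sE : ∀ w → S c' w ≡ S c w
    sE = upd-frame status (loc c) u newL refl
    pE : ∀ w → P c' w ≡ P c w
    pE = upd-frame parent (loc c) u newL refl
    kE : ∀ w → K c' w ≡ K c w
    kE = upd-frame count (loc c) u newL refl
    wE : ∀ w → W c' w ≡ W c w
    wE = upd-frame waiting (loc c) u newL refl
    cE : ∀ w → Cs c' w ≡ Cs c w
    cE = upd-frame children (loc c) u newL refl
    phO : ∀ w → w ≢ u → Ph c' w ≡ Ph c w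
    phO w ne = cong phase (upd-other (loc c) u newL w ne)
    rmO : ∀ w → w ≢ u → Rm c' w ≡ Rm c w
    rmO w ne = cong rem (upd-other (loc c) u newL w ne)
    phU : Ph c' u ≡ ph2
    phU = cong phase (upd-here (loc c) u newL)
    rmU : Rm c' u ≡ Cs c u
    rmU = cong rem (upd-here (loc c) u newL)

    iniE : ∀ w → Woken c' w → Woken c w
    iniE w h rewrite sym (sE w) = h
    iniE' : ∀ w → Woken c w → Woken c' w
    iniE' w h rewrite sE w = h

    tipE : ∀ x → Tip c' x → Tip c x
    tipE x t rewrite sE x | wE x = t

    reqE : ∀ a b → Req c a b ⊎ Req c b a → Req c' a b ⊎ Req c' b a
    reqE a b h rewrite sE a | sE b | wE a | wE b = h
    waitEE : ∀ a b → (ch c a b ≡ 1 ⊎ ch c b a ≡ 1 ⊎ (S c b ≡ EXPLORE × P c b ≡ just a)) → (ch c' a b ≡ 1 ⊎ ch c' b a ≡ 1 ⊎ (S c' b ≡ EXPLORE × P c' b ≡ just a))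
    waitEE a b h rewrite sE b | pE b = h
    waitOK' : ∀ x b → S c' x ≡ EXPLORE → W c' x ≡ just b → Edge x b × P c' x ≢ just b × b ∉ Rm c' x
    waitOK' x b h1 h2 = cases≡ x u (λ { refl → ⊥-elim (nothing≢just (trans (sym e2) (trans (sym (wE u)) h2))) })
      (λ ne → let (a , b' , c0) = waitOK x b (trans (sym (sE x)) h1) (trans (sym (wE x)) h2)
              in a , subst (λ z → z ≢ just b) (sym (pE x)) b' , subst (b ∉_) (sym (rmO x ne)) c0)
    remOK' : ∀ x b → S c' x ≡ EXPLORE → b ∈ Rm c' x → Edge x b × P c' x ≢ just b
    remOK' x b h1 h2 = cases≡ x u (λ { refl → subst (λ z → Edge u b × z ≢ just b) (sym (pE u)) (chOK u b (explore⇒woken c u e1) (subst (b ∈_) rmU h2)) })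
      (λ ne → subst (λ z → Edge x b × z ≢ just b) (sym (pE x)) (remOK x b (trans (sym (sE x)) h1) (subst (b ∈_) (rmO x ne) h2)))
    chOK' : ∀ x b → Woken c' x → b ∈ Cs c' x → Edge x b × P c' x ≢ just b
    chOK' x b ix h rewrite pE x | cE x = chOK x b (iniE x ix) h
    chAll' : ∀ p y → Woken c' p → Edge p y → P c' p ≢ just y → (S c' y ≡ INIT ⊎ P c' y ≡ just p) → y ∈ Cs c' p
    chAll' p y ip e h1 h2 rewrite cE p | pE p | sE y | pE y = chAll p y (iniE p ip) e h1 h2
    kPh2' : ∀ w → S c' w ≡ EXPLORE → Ph c' w ≡ ph2 → K c' w ≡ suc m
    kPh2' w h1 h2 = cases≡ w u (λ { refl → trans (kE u) e5 })
      (λ ne → trans (kE w) (kPh2 w (trans (sym (sE w)) h1) (trans (sym (phO w ne)) h2)))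
    treeIdle' : ∀ p y → P c' y ≡ just p → S c' p ≡ IDLE → S c' y ≡ IDLE × suc (K c' y) ≡ K c' p
    treeIdle' p y h1 h2 rewrite pE y | sE p | sE y | kE y | kE p = treeIdle p y h1 h2
    tree1' : ∀ p y → P c' y ≡ just p → S c' p ≡ EXPLORE → Ph c' p ≡ ph1 → T1 c' p y
    tree1' p y h1 h2 h3 = cases≡ p u (λ { refl → ⊥-elim (ph2≢ph1 (trans (sym phU) h3)) })
      (λ ne → tr ne (tree1 p y (trans (sym (pE y)) h1) (trans (sym (sE p)) h2) (trans (sym (phO p ne)) h3)))
      where
      tr : p ≢ u → T1 c p y → T1 c' p y
      tr ne t rewrite rmO p ne | sE y | kE y | kE p | wE p = t
    tree2' : ∀ p y → P c' y ≡ just p → S c' p ≡ EXPLORE → Ph c' p ≡ ph2 → T2 c' p y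
    tree2' p y h1 h2 h3 = cases≡ p u (λ { refl → tr2 (trans (sym (pE y)) h1) })
      (λ ne → tr ne (tree2 p y (trans (sym (pE y)) h1) (trans (sym (sE p)) h2) (trans (sym (phO p ne)) h3)))
      where
      tr : p ≢ u → T2 c p y → T2 c' p y
      tr ne t rewrite rmO p ne | sE y | kE y | kE p | wE p = t
      tr2 : P c y ≡ just u → T2 c' u y
      tr2 py rewrite rmU | sE y | kE y | kE u | wE u =
        (λ _ → old) ,
        (λ h _ → ⊥-elim (h (chAll u y (explore⇒woken c u e1) (proj₁ (paInfo py)) (noCyc py) (inj₂ py)))) ,
        (λ h → ⊥-elim (nothing≢just (trans (sym e2) h)))
        where
        old : S c y ≡ IDLE × suc (K c y) ≡ K c u
        old = proj₁ (proj₂ (tree1 u y py e1 e4)) (λ h → e3 (y , h)) (λ h → nothing≢just (trans (sym e2) h))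
    nb' : ∀ w x → Edge w x → Fin1 c' w → Woken c' x
    nb' w x e f = cases≡ w u (λ { refl → iniE' x (nb3 u x e1 e4 e (λ h → e3 (x , h)) (λ h → nothing≢just (trans (sym e2) h))) })
      (λ ne → iniE' x (nb w x e (fE ne f)))
      where
      fE : w ≢ u → Fin1 c' w → Fin1 c w
      fE ne f rewrite sE w | kE w | phO w ne = f
    nb3' : ∀ w x → S c' w ≡ EXPLORE → Ph c' w ≡ ph1 → Edge w x → x ∉ Rm c' w → W c' w ≢ just x → Woken c' x
    nb3' w x h1 h2 e h3 h4 = cases≡ w u (λ { refl → ⊥-elim (ph2≢ph1 (trans (sym phU) h2)) })
      (λ ne → iniE' x (nb3 w x (trans (sym (sE w)) h1) (trans (sym (phO w ne)) h2) e (subst (x ∉_) (rmO w ne) h3) (subst (_≢ just x) (wE w) h4)))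

    pres : Inv c' d
    pres = record
      { rootSt = subst (λ s → s ≡ EXPLORE ⊎ s ≡ DONE) (sym (sE r)) rootSt
      ; rootPa = trans (pE r) rootPa
      ; rootD = rootD
      ; initPa = λ y h → trans (pE y) (initPa y (trans (sym (sE y)) h))
      ; par = λ w ne iw → let (p , a , b , ip , dd) = par w ne (iniE w iw) in p , trans (pE w) a , b , iniE' p ip , dd
      ; chanE = λ a b h → let (x1 , x2 , x3 , x4) = chanE a b h in x1 , x2 , iniE' a x3 , reqE a b x4
      ; waitE = λ a b h1 h2 → waitEE a b (waitE a b (trans (sym (sE a)) h1) (trans (sym (wE a)) h2))
      ; explPar = λ x q h1 h2 → let (y1 , y2) = explPar x q (trans (sym (sE x)) h1) (trans (sym (pE x)) h2) in trans (sE q) y1 , trans (wE q) y2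
      ; explUniq = λ x y h1 h2 h3 → explUniq x y (trans (sym (sE x)) h1) (trans (sym (sE y)) h2) h3
      ; tipDeep = λ x y t h → tipDeep x y (tipE x t) (trans (sym (sE y)) h)
      ; waitOK = waitOK'
      ; remOK = remOK'
      ; chOK = λ x b ix h → chOK' x b ix h
      ; chAll = chAll'
      ; kMax = λ w → subst (_≤ suc m) (sym (kE w)) (kMax w)
      ; kExpl = λ w h → subst (1 ≤_) (sym (kE w)) (kExpl w (subst (λ s → s ≡ EXPLORE ⊎ s ≡ DONE) (sE w) h))
      ; kIdle = λ w h → subst (_≢ suc m) (sym (kE w)) (kIdle w (trans (sym (sE w)) h))
      ; kPh2 = kPh2'
      ; treeIdle = treeIdle'
      ; treeDone = λ p y h1 h2 → trans (sE y) (treeDone p y (trans (sym (pE y)) h1) (trans (sym (sE p)) h2))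
      ; tree1 = tree1'
      ; tree2 = tree2'
      ; nb = nb'
      ; nb3 = nb3'
      ; dMax = λ w iw → subst (d w ≤_) (sym (kE r)) (dMax w (iniE w iw))
      ; nbd = λ w x iw le e → iniE' x (nbd w x (iniE w iw) (subst (2 + d w ≤_) (kE r) le) e)
      ; bfs = λ a b e ia ib → bfs a b e (iniE a ia) (iniE b ib)
      }

  module StepFinishDone {c : Cfg} {d : Fin N → ℕ} (I : Inv c d) {u : Fin N}
           (e1 : S c u ≡ EXPLORE) (e2 : W c u ≡ nothing) (e3 : Empty (Rm c u)) (e4 : Ph c u ≡ ph2) where
    open Inv I
    open InvFacts I
    newL : Local N
    newL = record (loc c u) { status = DONE }
    c' : Cfg
    c' = record { loc = upd (loc c) u newL ; chan = sendParent (chan c) u (parent (loc c u)) }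

    sU : S c' u ≡ DONE
    sU = cong status (upd-here (loc c) u newL)
    sO : ∀ w → w ≢ u → S c' w ≡ S c w
    sO w ne = cong status (upd-other (loc c) u newL w ne)
    pE : ∀ w → P c' w ≡ P c w
    pE = upd-frame parent (loc c) u newL refl
    kE : ∀ w → K c' w ≡ K c w
    kE = upd-frame count (loc c) u newL refl
    phE : ∀ w → Ph c' w ≡ Ph c w
    phE = upd-frame phase (loc c) u newL refl
    rmE : ∀ w → Rm c' w ≡ Rm c w
    rmE = upd-frame rem (loc c) u newL refl
    wE : ∀ w → W c' w ≡ W c w
    wE = upd-frame waiting (loc c) u newL refl
    cE : ∀ w → Cs c' w ≡ Cs c w
    cE = upd-frame children (loc c) u newL refl
    chO : ∀ a b → (P c u ≡ just b → a ≢ u) → ch c' a b ≡ ch c a b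
    chO a b h = sendParent-other (chan c) u (P c u) a b h
    chP : ∀ p → P c u ≡ just p → ch c' u p ≡ suc (ch c u p)
    chP p h = sendParent-here (chan c) u (P c u) p h

    tipU : Tip c u
    tipU = e1 , inj₁ e2
    nc : ∀ b → ch c u b ≡ 0 × ch c b u ≡ 0
    nc = noChan e1 e2
    ku : K c u ≡ suc m
    ku = kPh2 u e1 e4
    iu : Woken c u
    iu = explore⇒woken c u e1
    notEx : S c' u ≢ EXPLORE
    notEx h with trans (sym sU) h
    ... | ()
    exE : ∀ w → S c' w ≡ EXPLORE → S c w ≡ EXPLORE
    exE w h = cases≡ w u (λ { refl → ⊥-elim (notEx h) }) (λ ne → trans (sym (sO w ne)) h)
    exNe : ∀ w → S c' w ≡ EXPLORE → w ≢ u
    exNe w h refl = notEx h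
    iniE : ∀ w → Woken c' w → Woken c w
    iniE w h = cases≡ w u (λ { refl → iu }) (λ ne → subst (_≢ INIT) (sO w ne) h)
    iniE' : ∀ w → Woken c w → Woken c' w
    iniE' w h = cases≡ w u (λ { refl → λ z → DONE≢INIT (trans (sym sU) z) }) (λ ne → subst (_≢ INIT) (sym (sO w ne)) h)
    sInit : ∀ w → S c' w ≡ INIT → S c w ≡ INIT
    sInit w h = cases≡ w u (λ { refl → ⊥-elim (iniE' u iu h) }) (λ ne → trans (sym (sO w ne)) h)

    parInfo : ∀ p → P c u ≡ just p → S c p ≡ EXPLORE × W c p ≡ just u × Ph c p ≡ ph2 × K c u ≡ K c p × p ≢ u
    parInfo p pe with explPar u p e1 pe
    ... | sp , wp with phCase (Ph c p)
    ... | inj₁ p1 with proj₂ (proj₂ (tree1 p u pe sp p1)) wp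
    ...   | inj₁ (x , _) = ⊥-elim (0≢1+n (trans (sym (proj₂ (nc p))) x))
    ...   | inj₂ (_ , x , _) = ⊥-elim (<-irrefl refl (≤-trans (≤-reflexive (trans (cong suc (sym ku)) x)) (kMax p)))
    parInfo p pe | sp , wp | inj₂ p2 with proj₂ (proj₂ (tree2 p u pe sp p2)) wp
    ...   | inj₁ (x , _) = ⊥-elim (0≢1+n (trans (sym (proj₂ (nc p))) x))
    ...   | inj₂ (_ , x , _) = sp , wp , p2 , x , λ { refl → noCyc pe pe }

    tipE : ∀ x → Tip c' x → (Σ (Fin N) λ p → P c u ≡ just p × x ≡ p) ⊎ Tip c x
    tipE x t = cases≡ x u (λ { refl → ⊥-elim (notEx (proj₁ t)) }) (λ nx → tr nx t)
      where
      tr : x ≢ u → Tip c' x → (Σ (Fin N) λ p → P c u ≡ just p × x ≡ p) ⊎ Tip c x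
      tr nx (a , inj₁ w) = inj₂ (exE x a , inj₁ (trans (sym (wE x)) w))
      tr nx (a , inj₂ (b , w , inj₁ h)) = inj₂ (exE x a , inj₂ (b , trans (sym (wE x)) w , inj₁ (trans (sym (chO x b (λ _ → nx))) h)))
      tr nx (a , inj₂ (b , w , inj₂ h)) with Maybe.≡-dec _≟_ (P c u) (just x)
      ... | yes pe = inj₁ (x , pe , refl)
      ... | no npe = inj₂ (exE x a , inj₂ (b , trans (sym (wE x)) w , inj₂ (trans (sym (chO b x (λ h' _ → npe h'))) h)))

    fE : ∀ w → w ≢ u → Fin1 c' w → Fin1 c w
    fE w ne f rewrite sO w ne | kE w | phE w = f
    chanE' : ∀ a b → ch c' a b ≢ 0 → ch c' a b ≡ 1 × ch c' b a ≡ 0 × Woken c' a × (Req c' a b ⊎ Req c' b a)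
    chanE' a b h = cases≡ a u
      (λ eq → subst (λ z → ch c' z b ≡ 1 × ch c' b z ≡ 0 × Woken c' z × (Req c' z b ⊎ Req c' b z)) (sym eq) (helper (subst (λ z → ch c' z b ≢ 0) eq h) (Maybe.≡-dec _≟_ (P c u) (just b))))
      (λ na → cases≡ b u (λ { refl → ⊥-elim (h (trans (chO a u (λ _ → na)) (proj₂ (nc a)))) })
        (λ nb → let (x1 , x2 , x3 , x4) = chanE a b (λ z → h (trans (chO a b (λ _ → na)) z))
                in trans (chO a b (λ _ → na)) x1 , trans (chO b a (λ _ → nb)) x2 , iniE' a x3 , rq na nb x4))
      where
      rq : a ≢ u → b ≢ u → Req c a b ⊎ Req c b a → Req c' a b ⊎ Req c' b a
      rq na nb x rewrite sO a na | sO b nb | wE a | wE b = x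
      helper : ch c' u b ≢ 0 → Dec (P c u ≡ just b) → ch c' u b ≡ 1 × ch c' b u ≡ 0 × Woken c' u × (Req c' u b ⊎ Req c' b u)
      helper h' (no npe) = ⊥-elim (h' (trans (chO u b (λ z → ⊥-elim (npe z))) (proj₁ (nc b))))
      helper h' (yes pe) = let (sp , wp , _ , _ , pu) = parInfo b pe in
        trans (chP b pe) (cong suc (proj₁ (nc b))) ,
        trans (chO b u (λ _ → pu)) (proj₂ (nc b)) ,
        iniE' u iu ,
        inj₂ (trans (sO b pu) sp , trans (wE b) wp , notEx)
    waitE' : ∀ a b → S c' a ≡ EXPLORE → W c' a ≡ just b → ch c' a b ≡ 1 ⊎ ch c' b a ≡ 1 ⊎ (S c' b ≡ EXPLORE × P c' b ≡ just a)
    waitE' a b h1 h2 = cases≡ b u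
      (λ { refl → bu (waitE a u (exE a h1) (trans (sym (wE a)) h2)) })
      (λ nb → tr nb (waitE a b (exE a h1) (trans (sym (wE a)) h2)))
      where
      na : a ≢ u
      na = exNe a h1
      bu : ch c a u ≡ 1 ⊎ ch c u a ≡ 1 ⊎ (S c u ≡ EXPLORE × P c u ≡ just a) → ch c' a u ≡ 1 ⊎ ch c' u a ≡ 1 ⊎ (S c' u ≡ EXPLORE × P c' u ≡ just a)
      bu (inj₁ x) = ⊥-elim (0≢1+n (trans (sym (proj₂ (nc a))) x))
      bu (inj₂ (inj₁ x)) = ⊥-elim (0≢1+n (trans (sym (proj₁ (nc a))) x))
      bu (inj₂ (inj₂ (_ , pe))) = inj₂ (inj₁ (trans (chP a pe) (cong suc (proj₁ (nc a)))))
      tr : b ≢ u → ch c a b ≡ 1 ⊎ ch c b a ≡ 1 ⊎ (S c b ≡ EXPLORE × P c b ≡ just a) → ch c' a b ≡ 1 ⊎ ch c' b a ≡ 1 ⊎ (S c' b ≡ EXPLORE × P c' b ≡ just a)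
      tr nb (inj₁ x) = inj₁ (trans (chO a b (λ _ → na)) x)
      tr nb (inj₂ (inj₁ x)) = inj₂ (inj₁ (trans (chO b a (λ _ → nb)) x))
      tr nb (inj₂ (inj₂ (x , y))) = inj₂ (inj₂ (trans (sO b nb) x , trans (pE b) y))
    explPar' : ∀ x q → S c' x ≡ EXPLORE → P c' x ≡ just q → S c' q ≡ EXPLORE × W c' q ≡ just x
    explPar' x q h1 h2 = let (y1 , y2) = explPar x q (exE x h1) (trans (sym (pE x)) h2)
                             nq : q ≢ u
                             nq = λ { refl → nothing≢just (trans (sym e2) y2) }
                         in trans (sO q nq) y1 , trans (wE q) y2
    tipDeep' : ∀ x y → Tip c' x → S c' y ≡ EXPLORE → d y ≤ d x
    tipDeep' x y t h with tipE x t
    ... | inj₂ tx = ⊥-elim (exNe x (proj₁ t) (tipUniq tx tipU))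
    ... | inj₁ (p , pe , refl) = le (m≤n⇒m<n∨m≡n (tipDeep u y tipU (exE y h)))
      where
      dd : d u ≡ suc (d x)
      dd = proj₂ (proj₂ (paInfo pe))
      le : d y < d u ⊎ d y ≡ d u → d y ≤ d x
      le (inj₁ lt) = ≤-pred (subst (d y <_) dd lt)
      le (inj₂ eq) = ⊥-elim (exNe y h (explUniq y u (exE y h) e1 eq))
    treeIdle' : ∀ p y → P c' y ≡ just p → S c' p ≡ IDLE → S c' y ≡ IDLE × suc (K c' y) ≡ K c' p
    treeIdle' p y h1 h2 = cases≡ p u (λ { refl → ⊥-elim (DONE≢IDLE (trans (sym sU) h2)) })
      (λ np → cases≡ y u
        (λ { refl → ⊥-elim (EXPLORE≢IDLE (trans (sym (proj₁ (parInfo p (trans (sym (pE u)) h1)))) (trans (sym (sO p np)) h2))) })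
        (λ ny → let (a , b) = treeIdle p y (trans (sym (pE y)) h1) (trans (sym (sO p np)) h2)
                in trans (sO y ny) a , trans (cong suc (kE y)) (trans b (sym (kE p)))))
    treeDone' : ∀ p y → P c' y ≡ just p → S c' p ≡ DONE → S c' y ≡ DONE
    treeDone' p y h1 h2 = cases≡ y u (λ { refl → sU })
      (λ ny → trans (sO y ny) (cases≡ p u
        (λ { refl → proj₁ (proj₂ (tree2 u y (trans (sym (pE y)) h1) e1 e4)) (λ z → e3 (y , z)) (λ z → nothing≢just (trans (sym e2) z)) })
        (λ np → treeDone p y (trans (sym (pE y)) h1) (trans (sym (sO p np)) h2))))
    tree1' : ∀ p y → P c' y ≡ just p → S c' p ≡ EXPLORE → Ph c' p ≡ ph1 → T1 c' p y
    tree1' p y h1 h2 h3 = cases≡ y u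
      (λ { refl → ⊥-elim (ph2≢ph1 (trans (sym (proj₁ (proj₂ (proj₂ (parInfo p (trans (sym (pE u)) h1)))))) (trans (sym (phE p)) h3))) })
      (λ ny → tr ny (tree1 p y (trans (sym (pE y)) h1) (exE p h2) (trans (sym (phE p)) h3)))
      where
      tr : y ≢ u → T1 c p y → T1 c' p y
      tr ny t rewrite rmE p | sO y ny | kE y | kE p | wE p | chO p y (λ _ → exNe p h2) = t
    tree2' : ∀ p y → P c' y ≡ just p → S c' p ≡ EXPLORE → Ph c' p ≡ ph2 → T2 c' p y
    tree2' p y h1 h2 h3 = cases≡ y u
      (λ { refl → tU (trans (sym (pE u)) h1) })
      (λ ny → tr ny (tree2 p y (trans (sym (pE y)) h1) (exE p h2) (trans (sym (phE p)) h3)))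
      where
      tr : y ≢ u → T2 c p y → T2 c' p y
      tr ny t rewrite rmE p | sO y ny | kE y | kE p | wE p | chO p y (λ _ → exNe p h2) = t
      tU : P c u ≡ just p → T2 c' p u
      tU pe = let (sp , wp , _ , kk , pu) = parInfo p pe
                  wo = waitOK p u sp wp in
        (λ z → ⊥-elim (proj₂ (proj₂ wo) (subst (u ∈_) (rmE p) z))) ,
        (λ _ z → ⊥-elim (z (trans (wE p) wp))) ,
        (λ _ → inj₂ (trans (chO p u (λ _ → pu)) (proj₂ (nc p)) , trans (kE u) (trans kk (sym (kE p))) , inj₂ sU))

    pres : Inv c' d
    pres = record
      { rootSt = cases≡ r u (λ { refl → inj₂ sU }) (λ ne → subst (λ s → s ≡ EXPLORE ⊎ s ≡ DONE) (sym (sO r ne)) rootSt)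
      ; rootPa = trans (pE r) rootPa
      ; rootD = rootD
      ; initPa = λ y h → trans (pE y) (initPa y (sInit y h))
      ; par = λ w ne iw → let (p , a , b , ip , dd) = par w ne (iniE w iw) in p , trans (pE w) a , b , iniE' p ip , dd
      ; chanE = chanE'
      ; waitE = waitE'
      ; explPar = explPar'
      ; explUniq = λ x y h1 h2 h3 → explUniq x y (exE x h1) (exE y h2) h3
      ; tipDeep = tipDeep'
      ; waitOK = λ x b h1 h2 → let (a , b' , c0) = waitOK x b (exE x h1) (trans (sym (wE x)) h2)
                               in a , subst (λ z → z ≢ just b) (sym (pE x)) b' , subst (b ∉_) (sym (rmE x)) c0
      ; remOK = λ x b h1 h2 → subst (λ z → Edge x b × z ≢ just b) (sym (pE x)) (remOK x b (exE x h1) (subst (b ∈_) (rmE x) h2))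
      ; chOK = λ x b ix h → subst (λ z → Edge x b × z ≢ just b) (sym (pE x)) (chOK x b (iniE x ix) (subst (b ∈_) (cE x) h))
      ; chAll = λ p y ip e h1 h2 → subst (y ∈_) (sym (cE p)) (chAll p y (iniE p ip) e (subst (_≢ just y) (pE p) h1)
                   (Data.Sum.map (sInit y) (trans (sym (pE y))) h2))
      ; kMax = λ w → subst (_≤ suc m) (sym (kE w)) (kMax w)
      ; kExpl = λ w h → subst (1 ≤_) (sym (kE w)) (cases≡ w u (λ { refl → kExpl u (inj₁ e1) })
                   (λ ne → kExpl w (subst (λ s → s ≡ EXPLORE ⊎ s ≡ DONE) (sO w ne) h)))
      ; kIdle = λ w h → subst (_≢ suc m) (sym (kE w)) (kIdle w (cases≡ w u (λ { refl → ⊥-elim (DONE≢IDLE (trans (sym sU) h)) }) (λ ne → trans (sym (sO w ne)) h)))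
      ; kPh2 = λ w h1 h2 → trans (kE w) (kPh2 w (exE w h1) (trans (sym (phE w)) h2))
      ; treeIdle = treeIdle'
      ; treeDone = treeDone'
      ; tree1 = tree1'
      ; tree2 = tree2'
      ; nb = λ w x e f → iniE' x (cases≡ w u (λ { refl → nb u x e (inj₂ (inj₂ (e1 , inj₂ e4))) }) (λ ne → nb w x e (fE w ne f)))
      ; nb3 = λ w x h1 h2 e h3 h4 → iniE' x (nb3 w x (exE w h1) (trans (sym (phE w)) h2) e (subst (x ∉_) (rmE w) h3) (subst (_≢ just x) (wE w) h4))
      ; dMax = λ w iw → subst (d w ≤_) (sym (kE r)) (dMax w (iniE w iw))
      ; nbd = λ w x iw le e → iniE' x (nbd w x (iniE w iw) (subst (2 + d w ≤_) (kE r) le) e)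
      ; bfs = λ a b e ia ib → bfs a b e (iniE a ia) (iniE b ib)
      }

  module StepFinishIdle {c : Cfg} {d : Fin N → ℕ} (I : Inv c d) {u : Fin N}
           (e1 : S c u ≡ EXPLORE) (e2 : W c u ≡ nothing) (e3 : Empty (Rm c u)) (e4 : Ph c u ≡ ph1) (e5 : K c u ≢ suc m) (e6 : u ≢ r) where
    open Inv I
    open InvFacts I
    newL : Local N
    newL = record (loc c u) { status = IDLE }
    c' : Cfg
    c' = record { loc = upd (loc c) u newL ; chan = sendParent (chan c) u (parent (loc c u)) }

    sU : S c' u ≡ IDLE
    sU = cong status (upd-here (loc c) u newL)
    sO : ∀ w → w ≢ u → S c' w ≡ S c w
    sO w ne = cong status (upd-other (loc c) u newL w ne)
    pE : ∀ w → P c' w ≡ P c w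
    pE = upd-frame parent (loc c) u newL refl
    kE : ∀ w → K c' w ≡ K c w
    kE = upd-frame count (loc c) u newL refl
    phE : ∀ w → Ph c' w ≡ Ph c w
    phE = upd-frame phase (loc c) u newL refl
    rmE : ∀ w → Rm c' w ≡ Rm c w
    rmE = upd-frame rem (loc c) u newL refl
    wE : ∀ w → W c' w ≡ W c w
    wE = upd-frame waiting (loc c) u newL refl
    cE : ∀ w → Cs c' w ≡ Cs c w
    cE = upd-frame children (loc c) u newL refl
    chO : ∀ a b → (P c u ≡ just b → a ≢ u) → ch c' a b ≡ ch c a b
    chO a b h = sendParent-other (chan c) u (P c u) a b h
    chP : ∀ p → P c u ≡ just p → ch c' u p ≡ suc (ch c u p)
    chP p h = sendParent-here (chan c) u (P c u) p h

    tipU : Tip c u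
    tipU = e1 , inj₁ e2
    nc : ∀ b → ch c u b ≡ 0 × ch c b u ≡ 0
    nc = noChan e1 e2
    iu : Woken c u
    iu = explore⇒woken c u e1
    notEx : S c' u ≢ EXPLORE
    notEx h with trans (sym sU) h
    ... | ()
    exE : ∀ w → S c' w ≡ EXPLORE → S c w ≡ EXPLORE
    exE w h = cases≡ w u (λ { refl → ⊥-elim (notEx h) }) (λ ne → trans (sym (sO w ne)) h)
    exNe : ∀ w → S c' w ≡ EXPLORE → w ≢ u
    exNe w h refl = notEx h
    iniE : ∀ w → Woken c' w → Woken c w
    iniE w h = cases≡ w u (λ { refl → iu }) (λ ne → subst (_≢ INIT) (sO w ne) h)
    iniE' : ∀ w → Woken c w → Woken c' w
    iniE' w h = cases≡ w u (λ { refl → λ z → IDLE≢INIT (trans (sym sU) z) }) (λ ne → subst (_≢ INIT) (sym (sO w ne)) h)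
    sInit : ∀ w → S c' w ≡ INIT → S c w ≡ INIT
    sInit w h = cases≡ w u (λ { refl → ⊥-elim (iniE' u iu h) }) (λ ne → trans (sym (sO w ne)) h)

    parInfo : ∀ p → P c u ≡ just p → S c p ≡ EXPLORE × W c p ≡ just u × Ph c p ≡ ph1 × suc (K c u) ≡ K c p × p ≢ u
    parInfo p pe with explPar u p e1 pe
    ... | sp , wp with phCase (Ph c p)
    ... | inj₂ p2 with proj₂ (proj₂ (tree2 p u pe sp p2)) wp
    ...   | inj₁ (x , _) = ⊥-elim (0≢1+n (trans (sym (proj₂ (nc p))) x))
    ...   | inj₂ (_ , x , _) = ⊥-elim (e5 (trans x (kPh2 p sp p2)))
    parInfo p pe | sp , wp | inj₁ p1 with proj₂ (proj₂ (tree1 p u pe sp p1)) wp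
    ...   | inj₁ (x , _) = ⊥-elim (0≢1+n (trans (sym (proj₂ (nc p))) x))
    ...   | inj₂ (_ , x , _) = sp , wp , p1 , x , λ { refl → noCyc pe pe }

    tipE : ∀ x → Tip c' x → (Σ (Fin N) λ p → P c u ≡ just p × x ≡ p) ⊎ Tip c x
    tipE x t = cases≡ x u (λ { refl → ⊥-elim (notEx (proj₁ t)) }) (λ nx → tr nx t)
      where
      tr : x ≢ u → Tip c' x → (Σ (Fin N) λ p → P c u ≡ just p × x ≡ p) ⊎ Tip c x
      tr nx (a , inj₁ w) = inj₂ (exE x a , inj₁ (trans (sym (wE x)) w))
      tr nx (a , inj₂ (b , w , inj₁ h)) = inj₂ (exE x a , inj₂ (b , trans (sym (wE x)) w , inj₁ (trans (sym (chO x b (λ _ → nx))) h)))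
      tr nx (a , inj₂ (b , w , inj₂ h)) with Maybe.≡-dec _≟_ (P c u) (just x)
      ... | yes pe = inj₁ (x , pe , refl)
      ... | no npe = inj₂ (exE x a , inj₂ (b , trans (sym (wE x)) w , inj₂ (trans (sym (chO b x (λ h' _ → npe h'))) h)))

    ied : IDLE ≡ EXPLORE ⊎ IDLE ≡ DONE → ⊥
    ied (inj₁ ())
    ied (inj₂ ())
    fE : ∀ w → w ≢ u → Fin1 c' w → Fin1 c w
    fE w ne f rewrite sO w ne | kE w | phE w = f
    chanE' : ∀ a b → ch c' a b ≢ 0 → ch c' a b ≡ 1 × ch c' b a ≡ 0 × Woken c' a × (Req c' a b ⊎ Req c' b a)
    chanE' a b h = cases≡ a u
      (λ eq → subst (λ z → ch c' z b ≡ 1 × ch c' b z ≡ 0 × Woken c' z × (Req c' z b ⊎ Req c' b z)) (sym eq) (helper (subst (λ z → ch c' z b ≢ 0) eq h) (Maybe.≡-dec _≟_ (P c u) (just b))))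
      (λ na → cases≡ b u (λ { refl → ⊥-elim (h (trans (chO a u (λ _ → na)) (proj₂ (nc a)))) })
        (λ nb → let (x1 , x2 , x3 , x4) = chanE a b (λ z → h (trans (chO a b (λ _ → na)) z))
                in trans (chO a b (λ _ → na)) x1 , trans (chO b a (λ _ → nb)) x2 , iniE' a x3 , rq na nb x4))
      where
      rq : a ≢ u → b ≢ u → Req c a b ⊎ Req c b a → Req c' a b ⊎ Req c' b a
      rq na nb x rewrite sO a na | sO b nb | wE a | wE b = x
      helper : ch c' u b ≢ 0 → Dec (P c u ≡ just b) → ch c' u b ≡ 1 × ch c' b u ≡ 0 × Woken c' u × (Req c' u b ⊎ Req c' b u)
      helper h' (no npe) = ⊥-elim (h' (trans (chO u b (λ z → ⊥-elim (npe z))) (proj₁ (nc b))))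
      helper h' (yes pe) = let (sp , wp , _ , _ , pu) = parInfo b pe in
        trans (chP b pe) (cong suc (proj₁ (nc b))) ,
        trans (chO b u (λ _ → pu)) (proj₂ (nc b)) ,
        iniE' u iu ,
        inj₂ (trans (sO b pu) sp , trans (wE b) wp , notEx)
    waitE' : ∀ a b → S c' a ≡ EXPLORE → W c' a ≡ just b → ch c' a b ≡ 1 ⊎ ch c' b a ≡ 1 ⊎ (S c' b ≡ EXPLORE × P c' b ≡ just a)
    waitE' a b h1 h2 = cases≡ b u
      (λ { refl → bu (waitE a u (exE a h1) (trans (sym (wE a)) h2)) })
      (λ nb → tr nb (waitE a b (exE a h1) (trans (sym (wE a)) h2)))
      where
      na : a ≢ u
      na = exNe a h1
      bu : ch c a u ≡ 1 ⊎ ch c u a ≡ 1 ⊎ (S c u ≡ EXPLORE × P c u ≡ just a) → ch c' a u ≡ 1 ⊎ ch c' u a ≡ 1 ⊎ (S c' u ≡ EXPLORE × P c' u ≡ just a)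
      bu (inj₁ x) = ⊥-elim (0≢1+n (trans (sym (proj₂ (nc a))) x))
      bu (inj₂ (inj₁ x)) = ⊥-elim (0≢1+n (trans (sym (proj₁ (nc a))) x))
      bu (inj₂ (inj₂ (_ , pe))) = inj₂ (inj₁ (trans (chP a pe) (cong suc (proj₁ (nc a)))))
      tr : b ≢ u → ch c a b ≡ 1 ⊎ ch c b a ≡ 1 ⊎ (S c b ≡ EXPLORE × P c b ≡ just a) → ch c' a b ≡ 1 ⊎ ch c' b a ≡ 1 ⊎ (S c' b ≡ EXPLORE × P c' b ≡ just a)
      tr nb (inj₁ x) = inj₁ (trans (chO a b (λ _ → na)) x)
      tr nb (inj₂ (inj₁ x)) = inj₂ (inj₁ (trans (chO b a (λ _ → nb)) x))
      tr nb (inj₂ (inj₂ (x , y))) = inj₂ (inj₂ (trans (sO b nb) x , trans (pE b) y))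
    explPar' : ∀ x q → S c' x ≡ EXPLORE → P c' x ≡ just q → S c' q ≡ EXPLORE × W c' q ≡ just x
    explPar' x q h1 h2 = let (y1 , y2) = explPar x q (exE x h1) (trans (sym (pE x)) h2)
                             nq : q ≢ u
                             nq = λ { refl → nothing≢just (trans (sym e2) y2) }
                         in trans (sO q nq) y1 , trans (wE q) y2
    tipDeep' : ∀ x y → Tip c' x → S c' y ≡ EXPLORE → d y ≤ d x
    tipDeep' x y t h with tipE x t
    ... | inj₂ tx = ⊥-elim (exNe x (proj₁ t) (tipUniq tx tipU))
    ... | inj₁ (p , pe , refl) = le (m≤n⇒m<n∨m≡n (tipDeep u y tipU (exE y h)))
      where
      dd : d u ≡ suc (d x)
      dd = proj₂ (proj₂ (paInfo pe))
      le : d y < d u ⊎ d y ≡ d u → d y ≤ d x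
      le (inj₁ lt) = ≤-pred (subst (d y <_) dd lt)
      le (inj₂ eq) = ⊥-elim (exNe y h (explUniq y u (exE y h) e1 eq))
    treeIdle' : ∀ p y → P c' y ≡ just p → S c' p ≡ IDLE → S c' y ≡ IDLE × suc (K c' y) ≡ K c' p
    treeIdle' p y h1 h2 = cases≡ y u
        (λ { refl → ⊥-elim (EXPLORE≢IDLE (trans (sym (proj₁ (parInfo p (trans (sym (pE u)) h1)))) (trans (sym (sO p (proj₂ (proj₂ (proj₂ (proj₂ (parInfo p (trans (sym (pE u)) h1)))))))) h2))) })
        (λ ny → let r' = cases≡ p u (λ { refl → proj₁ (proj₂ (tree1 u y (trans (sym (pE y)) h1) e1 e4)) (λ z → e3 (y , z)) (λ z → nothing≢just (trans (sym e2) z)) })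
                        (λ np → treeIdle p y (trans (sym (pE y)) h1) (trans (sym (sO p np)) h2))
                in trans (sO y ny) (proj₁ r') , trans (cong suc (kE y)) (trans (proj₂ r') (sym (kE p))))
    treeDone' : ∀ p y → P c' y ≡ just p → S c' p ≡ DONE → S c' y ≡ DONE
    treeDone' p y h1 h2 = cases≡ p u (λ { refl → ⊥-elim (IDLE≢DONE (trans (sym sU) h2)) })
      (λ np → cases≡ y u
        (λ { refl → ⊥-elim (EXPLORE≢DONE (trans (sym (proj₁ (parInfo p (trans (sym (pE u)) h1)))) (trans (sym (sO p np)) h2))) })
        (λ ny → trans (sO y ny) (treeDone p y (trans (sym (pE y)) h1) (trans (sym (sO p np)) h2))))
    tree1' : ∀ p y → P c' y ≡ just p → S c' p ≡ EXPLORE → Ph c' p ≡ ph1 → T1 c' p y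
    tree1' p y h1 h2 h3 = cases≡ y u
      (λ { refl → tU (trans (sym (pE u)) h1) })
      (λ ny → tr ny (tree1 p y (trans (sym (pE y)) h1) (exE p h2) (trans (sym (phE p)) h3)))
      where
      tr : y ≢ u → T1 c p y → T1 c' p y
      tr ny t rewrite rmE p | sO y ny | kE y | kE p | wE p | chO p y (λ _ → exNe p h2) = t
      tU : P c u ≡ just p → T1 c' p u
      tU pe = let (sp , wp , _ , kk , pu) = parInfo p pe
                  wo = waitOK p u sp wp in
        (λ z → ⊥-elim (proj₂ (proj₂ wo) (subst (u ∈_) (rmE p) z))) ,
        (λ _ z → ⊥-elim (z (trans (wE p) wp))) ,
        (λ _ → inj₂ (trans (chO p u (λ _ → pu)) (proj₂ (nc p)) , trans (cong suc (kE u)) (trans kk (sym (kE p))) , inj₂ sU))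
    tree2' : ∀ p y → P c' y ≡ just p → S c' p ≡ EXPLORE → Ph c' p ≡ ph2 → T2 c' p y
    tree2' p y h1 h2 h3 = cases≡ y u
      (λ { refl → ⊥-elim (ph1≢ph2 (trans (sym (proj₁ (proj₂ (proj₂ (parInfo p (trans (sym (pE u)) h1)))))) (trans (sym (phE p)) h3))) })
      (λ ny → tr ny (tree2 p y (trans (sym (pE y)) h1) (exE p h2) (trans (sym (phE p)) h3)))
      where
      tr : y ≢ u → T2 c p y → T2 c' p y
      tr ny t rewrite rmE p | sO y ny | kE y | kE p | wE p | chO p y (λ _ → exNe p h2) = t

    pres : Inv c' d
    pres = record
      { rootSt = subst (λ s → s ≡ EXPLORE ⊎ s ≡ DONE) (sym (sO r (e6 ∘ sym))) rootSt
      ; rootPa = trans (pE r) rootPa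
      ; rootD = rootD
      ; initPa = λ y h → trans (pE y) (initPa y (sInit y h))
      ; par = λ w ne iw → let (p , a , b , ip , dd) = par w ne (iniE w iw) in p , trans (pE w) a , b , iniE' p ip , dd
      ; chanE = chanE'
      ; waitE = waitE'
      ; explPar = explPar'
      ; explUniq = λ x y h1 h2 h3 → explUniq x y (exE x h1) (exE y h2) h3
      ; tipDeep = tipDeep'
      ; waitOK = λ x b h1 h2 → let (a , b' , c0) = waitOK x b (exE x h1) (trans (sym (wE x)) h2)
                               in a , subst (λ z → z ≢ just b) (sym (pE x)) b' , subst (b ∉_) (sym (rmE x)) c0
      ; remOK = λ x b h1 h2 → subst (λ z → Edge x b × z ≢ just b) (sym (pE x)) (remOK x b (exE x h1) (subst (b ∈_) (rmE x) h2))
      ; chOK = λ x b ix h → subst (λ z → Edge x b × z ≢ just b) (sym (pE x)) (chOK x b (iniE x ix) (subst (b ∈_) (cE x) h))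
      ; chAll = λ p y ip e h1 h2 → subst (y ∈_) (sym (cE p)) (chAll p y (iniE p ip) e (subst (_≢ just y) (pE p) h1)
                   (Data.Sum.map (sInit y) (trans (sym (pE y))) h2))
      ; kMax = λ w → subst (_≤ suc m) (sym (kE w)) (kMax w)
      ; kExpl = λ w h → subst (1 ≤_) (sym (kE w)) (cases≡ w u (λ { refl → ⊥-elim (ied (subst (λ s → s ≡ EXPLORE ⊎ s ≡ DONE) sU h)) })
                   (λ ne → kExpl w (subst (λ s → s ≡ EXPLORE ⊎ s ≡ DONE) (sO w ne) h)))
      ; kIdle = λ w h → subst (_≢ suc m) (sym (kE w)) (cases≡ w u (λ { refl → e5 }) (λ ne → kIdle w (trans (sym (sO w ne)) h)))
      ; kPh2 = λ w h1 h2 → trans (kE w) (kPh2 w (exE w h1) (trans (sym (phE w)) h2))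
      ; treeIdle = treeIdle'
      ; treeDone = treeDone'
      ; tree1 = tree1'
      ; tree2 = tree2'
      ; nb = λ w x e f → iniE' x (cases≡ w u (λ { refl → nb3 u x e1 e4 e (λ z → e3 (x , z)) (λ z → nothing≢just (trans (sym e2) z)) }) (λ ne → nb w x e (fE w ne f)))
      ; nb3 = λ w x h1 h2 e h3 h4 → iniE' x (nb3 w x (exE w h1) (trans (sym (phE w)) h2) e (subst (x ∉_) (rmE w) h3) (subst (_≢ just x) (wE w) h4))
      ; dMax = λ w iw → subst (d w ≤_) (sym (kE r)) (dMax w (iniE w iw))
      ; nbd = λ w x iw le e → iniE' x (nbd w x (iniE w iw) (subst (2 + d w ≤_) (kE r) le) e)
      ; bfs = λ a b e ia ib → bfs a b e (iniE a ia) (iniE b ib)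
      }

  module StepRootRestart {c : Cfg} {d : Fin N → ℕ} (I : Inv c d)
           (e1 : S c r ≡ EXPLORE) (e2 : W c r ≡ nothing) (e3 : Empty (Rm c r))
           (e4 : Ph c r ≡ ph1) (e5 : K c r ≢ suc m) where
    open Inv I
    open InvFacts I
    u : Fin N
    u = r
    newL : Local N
    newL = beginExplore r (record (loc c r) { status = IDLE })
    c' : Cfg
    c' = record c { loc = upd (loc c) r newL }

    sE : ∀ w → S c' w ≡ S c w
    sE = upd-frame status (loc c) u newL (sym e1)
    pE : ∀ w → P c' w ≡ P c w
    pE = upd-frame parent (loc c) u newL refl
    wE : ∀ w → W c' w ≡ W c w
    wE = upd-frame waiting (loc c) u newL (sym e2)
    cE : ∀ w → Cs c' w ≡ Cs c w
    cE = upd-frame children (loc c) u newL refl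
    phE : ∀ w → Ph c' w ≡ Ph c w
    phE = upd-frame phase (loc c) u newL (sym e4)
    rmO : ∀ w → w ≢ u → Rm c' w ≡ Rm c w
    rmO w ne = cong rem (upd-other (loc c) u newL w ne)
    kO : ∀ w → w ≢ u → K c' w ≡ K c w
    kO w ne = cong count (upd-other (loc c) u newL w ne)
    rmU : Rm c' u ≡ 𝒩 r
    rmU rewrite upd-here (loc c) u newL | rootPa = refl
    kU : K c' u ≡ suc (K c u)
    kU = cong count (upd-here (loc c) u newL)

    iniE : ∀ w → Woken c' w → Woken c w
    iniE w h rewrite sym (sE w) = h
    iniE' : ∀ w → Woken c w → Woken c' w
    iniE' w h rewrite sE w = h

    tipE : ∀ x → Tip c' x → Tip c x
    tipE x t rewrite sE x | wE x = t

    kle : K c r ≤ K c' r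
    kle rewrite kU = n≤1+n _

    reqE : ∀ a b → Req c a b ⊎ Req c b a → Req c' a b ⊎ Req c' b a
    reqE a b h rewrite sE a | sE b | wE a | wE b = h
    waitEE : ∀ a b → (ch c a b ≡ 1 ⊎ ch c b a ≡ 1 ⊎ (S c b ≡ EXPLORE × P c b ≡ just a)) → (ch c' a b ≡ 1 ⊎ ch c' b a ≡ 1 ⊎ (S c' b ≡ EXPLORE × P c' b ≡ just a))
    waitEE a b h rewrite sE b | pE b = h
    waitOK' : ∀ x b → S c' x ≡ EXPLORE → W c' x ≡ just b → Edge x b × P c' x ≢ just b × b ∉ Rm c' x
    waitOK' x b h1 h2 = cases≡ x u (λ { refl → ⊥-elim (nothing≢just (trans (sym e2) (trans (sym (wE u)) h2))) })
      (λ ne → let (a , b' , c0) = waitOK x b (trans (sym (sE x)) h1) (trans (sym (wE x)) h2)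
              in a , subst (λ z → z ≢ just b) (sym (pE x)) b' , subst (b ∉_) (sym (rmO x ne)) c0)
    remOK' : ∀ x b → S c' x ≡ EXPLORE → b ∈ Rm c' x → Edge x b × P c' x ≢ just b
    remOK' x b h1 h2 = cases≡ x u (λ { refl → ∈tabulate⇒true (adj r) b (subst (b ∈_) rmU h2) , (λ h → nothing≢just (trans (sym rootPa) (trans (sym (pE r)) h))) })
      (λ ne → subst (λ z → Edge x b × z ≢ just b) (sym (pE x)) (remOK x b (trans (sym (sE x)) h1) (subst (b ∈_) (rmO x ne) h2)))
    chOK' : ∀ x b → Woken c' x → b ∈ Cs c' x → Edge x b × P c' x ≢ just b
    chOK' x b ix h rewrite pE x | cE x = chOK x b (iniE x ix) h
    chAll' : ∀ p y → Woken c' p → Edge p y → P c' p ≢ just y → (S c' y ≡ INIT ⊎ P c' y ≡ just p) → y ∈ Cs c' p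
    chAll' p y ip e h1 h2 rewrite cE p | pE p | sE y | pE y = chAll p y (iniE p ip) e h1 h2
    kMax' : ∀ w → K c' w ≤ suc m
    kMax' w = cases≡ w u (λ { refl → subst (_≤ suc m) (sym kU) (≤∧≢⇒< (kMax r) e5) })
      (λ ne → subst (_≤ suc m) (sym (kO w ne)) (kMax w))
    kExpl' : ∀ w → S c' w ≡ EXPLORE ⊎ S c' w ≡ DONE → 1 ≤ K c' w
    kExpl' w h = cases≡ w u (λ { refl → subst (1 ≤_) (sym kU) (s≤s z≤n) })
      (λ ne → subst (1 ≤_) (sym (kO w ne)) (kExpl w (subst (λ s → s ≡ EXPLORE ⊎ s ≡ DONE) (sE w) h)))
    kIdle' : ∀ w → S c' w ≡ IDLE → K c' w ≢ suc m
    kIdle' w h = cases≡ w u (λ { refl → ⊥-elim (exIdle r e1 (trans (sym (sE r)) h)) })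
      (λ ne → subst (_≢ suc m) (sym (kO w ne)) (kIdle w (trans (sym (sE w)) h)))
    kPh2' : ∀ w → S c' w ≡ EXPLORE → Ph c' w ≡ ph2 → K c' w ≡ suc m
    kPh2' w h1 h2 = cases≡ w u (λ { refl → ⊥-elim (ph1≢ph2 (trans (sym e4) (trans (sym (phE r)) h2))) })
      (λ ne → trans (kO w ne) (kPh2 w (trans (sym (sE w)) h1) (trans (sym (phE w)) h2)))
    treeIdle' : ∀ p y → P c' y ≡ just p → S c' p ≡ IDLE → S c' y ≡ IDLE × suc (K c' y) ≡ K c' p
    treeIdle' p y h1 h2 = cases≡ p u (λ { refl → ⊥-elim (exIdle r e1 (trans (sym (sE r)) h2)) })
      (λ ne → let py = trans (sym (pE y)) h1
                  (a , b) = treeIdle p y py (trans (sym (sE p)) h2)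
              in trans (sE y) a , trans (cong suc (kO y (paNotRoot py))) (trans b (sym (kO p ne))))
    tree1' : ∀ p y → P c' y ≡ just p → S c' p ≡ EXPLORE → Ph c' p ≡ ph1 → T1 c' p y
    tree1' p y h1 h2 h3 = cases≡ p u (λ { refl → tr2 (trans (sym (pE y)) h1) })
      (λ ne → tr ne (trans (sym (pE y)) h1) (tree1 p y (trans (sym (pE y)) h1) (trans (sym (sE p)) h2) (trans (sym (phE p)) h3)))
      where
      tr : p ≢ u → P c y ≡ just p → T1 c p y → T1 c' p y
      tr ne py t rewrite rmO p ne | sE y | kO y (paNotRoot py) | kO p ne | wE p = t
      tr2 : P c y ≡ just u → T1 c' u y
      tr2 py rewrite rmU | sE y | kO y (paNotRoot py) | kU | wE u =
        (λ _ → proj₁ old , cong suc (proj₂ old)) ,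
        (λ h _ → ⊥-elim (h (true⇒∈tabulate (adj r) y (proj₁ (paInfo py))))) ,
        (λ h → ⊥-elim (nothing≢just (trans (sym e2) h)))
        where
        old : S c y ≡ IDLE × suc (K c y) ≡ K c u
        old = proj₁ (proj₂ (tree1 u y py e1 e4)) (λ h → e3 (y , h)) (λ h → nothing≢just (trans (sym e2) h))
    tree2' : ∀ p y → P c' y ≡ just p → S c' p ≡ EXPLORE → Ph c' p ≡ ph2 → T2 c' p y
    tree2' p y h1 h2 h3 = cases≡ p u (λ { refl → ⊥-elim (ph1≢ph2 (trans (sym e4) (trans (sym (phE r)) h3))) })
      (λ ne → tr ne (trans (sym (pE y)) h1) (tree2 p y (trans (sym (pE y)) h1) (trans (sym (sE p)) h2) (trans (sym (phE p)) h3)))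
      where
      tr : p ≢ u → P c y ≡ just p → T2 c p y → T2 c' p y
      tr ne py t rewrite rmO p ne | sE y | kO y (paNotRoot py) | kO p ne | wE p = t
    nb' : ∀ w x → Edge w x → Fin1 c' w → Woken c' x
    nb' w x e f = cases≡ w u (λ { refl → iniE' x (nb3 u x e1 e4 e (λ h → e3 (x , h)) (λ h → nothing≢just (trans (sym e2) h))) })
      (λ ne → iniE' x (nb w x e (fE ne f)))
      where
      fE : w ≢ u → Fin1 c' w → Fin1 c w
      fE ne f rewrite sE w | kO w ne | phE w = f
    nb3' : ∀ w x → S c' w ≡ EXPLORE → Ph c' w ≡ ph1 → Edge w x → x ∉ Rm c' w → W c' w ≢ just x → Woken c' x
    nb3' w x h1 h2 e h3 h4 = cases≡ w u (λ { refl → ⊥-elim (h3 (subst (x ∈_) (sym rmU) (true⇒∈tabulate (adj r) x e))) })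
      (λ ne → iniE' x (nb3 w x (trans (sym (sE w)) h1) (trans (sym (phE w)) h2) e (subst (x ∉_) (rmO w ne) h3) (subst (_≢ just x) (wE w) h4)))
    nbd' : ∀ w x → Woken c' w → 2 + d w ≤ K c' r → Edge w x → Woken c' x
    nbd' w x iw le e with 2 + d w ≤? K c r
    ... | yes le' = iniE' x (nbd w x (iniE w iw) le' e)
    ... | no nle = cases≡ w r
      (λ { refl → iniE' x (nb3 r x e1 e4 e (λ h → e3 (x , h)) (λ h → nothing≢just (trans (sym e2) h))) })
      (λ ne → let (i1 , i2) = globRel e1 e4 e2 e3 (d w) w refl (iniE w iw) ne
                  dw1 : suc (d w) ≡ K c r
                  dw1 = ≤-antisym (≤-pred (subst (2 + d w ≤_) kU le)) (≮⇒≥ nle)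
                  k1 : K c w ≡ 1
                  k1 = +-cancelʳ-≡ (d w) (K c w) 1 (trans i2 (sym dw1))
              in iniE' x (nb w x e (inj₁ (i1 , ≤-reflexive (sym k1)))))

    pres : Inv c' d
    pres = record
      { rootSt = subst (λ s → s ≡ EXPLORE ⊎ s ≡ DONE) (sym (sE r)) rootSt
      ; rootPa = trans (pE r) rootPa
      ; rootD = rootD
      ; initPa = λ y h → trans (pE y) (initPa y (trans (sym (sE y)) h))
      ; par = λ w ne iw → let (p , a , b , ip , dd) = par w ne (iniE w iw) in p , trans (pE w) a , b , iniE' p ip , dd
      ; chanE = λ a b h → let (x1 , x2 , x3 , x4) = chanE a b h in x1 , x2 , iniE' a x3 , reqE a b x4
      ; waitE = λ a b h1 h2 → waitEE a b (waitE a b (trans (sym (sE a)) h1) (trans (sym (wE a)) h2))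
      ; explPar = λ x q h1 h2 → let (y1 , y2) = explPar x q (trans (sym (sE x)) h1) (trans (sym (pE x)) h2) in trans (sE q) y1 , trans (wE q) y2
      ; explUniq = λ x y h1 h2 h3 → explUniq x y (trans (sym (sE x)) h1) (trans (sym (sE y)) h2) h3
      ; tipDeep = λ x y t h → tipDeep x y (tipE x t) (trans (sym (sE y)) h)
      ; waitOK = waitOK'
      ; remOK = remOK'
      ; chOK = chOK'
      ; chAll = chAll'
      ; kMax = kMax'
      ; kExpl = kExpl'
      ; kIdle = kIdle'
      ; kPh2 = kPh2'
      ; treeIdle = treeIdle'
      ; treeDone = λ p y h1 h2 → trans (sE y) (treeDone p y (trans (sym (pE y)) h1) (trans (sym (sE p)) h2))
      ; tree1 = tree1'
      ; tree2 = tree2'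
      ; nb = nb'
      ; nb3 = nb3'
      ; dMax = λ w iw → ≤-trans (dMax w (iniE w iw)) kle
      ; nbd = nbd'
      ; bfs = λ a b e ia ib → bfs a b e (iniE a ia) (iniE b ib)
      }

  module RootWoke where
    L0 : Local N
    L0 = beginExplore r (record (loc (initConfig {N}) r) { status = IDLE ; parent = nothing ; children = 𝒩 r ; count = 0 })
    c1 : Cfg
    c1 = record (initConfig {N}) { loc = upd (loc (initConfig {N})) r L0 }

    d0 : Fin N → ℕ
    d0 _ = 0

    isR : ∀ w → Woken c1 w → w ≡ r
    isR w h with w ≟ r
    ... | yes e = e
    ... | no _ = ⊥-elim (h refl)

    sR : S c1 r ≡ EXPLORE
    sR = cong status (upd-here (loc (initConfig {N})) r L0)
    pN : ∀ w → P c1 w ≡ nothing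
    pN = upd-frame parent (loc (initConfig {N})) r L0 refl
    wN : ∀ w → W c1 w ≡ nothing
    wN = upd-frame waiting (loc (initConfig {N})) r L0 refl
    kR : K c1 r ≡ 1
    kR = cong count (upd-here (loc (initConfig {N})) r L0)
    phR : Ph c1 r ≡ ph1
    phR = cong phase (upd-here (loc (initConfig {N})) r L0)
    rmR : Rm c1 r ≡ 𝒩 r
    rmR = cong rem (upd-here (loc (initConfig {N})) r L0)
    csR : Cs c1 r ≡ 𝒩 r
    csR = cong children (upd-here (loc (initConfig {N})) r L0)
    exR : ∀ w → S c1 w ≡ EXPLORE → w ≡ r
    exR w h = isR w (explore⇒woken c1 w h)

    initInv : Inv c1 d0
    initInv = record
      { rootSt = inj₁ sR
      ; rootPa = pN r
      ; rootD = refl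
      ; initPa = λ y _ → pN y
      ; par = λ w ne iw → ⊥-elim (ne (isR w iw))
      ; chanE = λ a b h → ⊥-elim (h refl)
      ; waitE = λ a b _ h → ⊥-elim (nothing≢just (trans (sym (wN a)) h))
      ; explPar = λ x q _ h → ⊥-elim (nothing≢just (trans (sym (pN x)) h))
      ; explUniq = λ x y h1 h2 _ → trans (exR x h1) (sym (exR y h2))
      ; tipDeep = λ _ _ _ _ → z≤n
      ; waitOK = λ x b _ h → ⊥-elim (nothing≢just (trans (sym (wN x)) h))
      ; remOK = λ x b h1 h2 → rr x b h1 h2
      ; chOK = λ x b ix h → cc x b ix h
      ; chAll = λ p y ip e _ _ → subst (λ z → y ∈ Cs c1 z) (sym (isR p ip)) (subst (y ∈_) (sym csR) (true⇒∈tabulate (adj r) y (subst (λ z → Edge z y) (isR p ip) e)))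
      ; kMax = km
      ; kExpl = λ w h → subst (λ z → 1 ≤ K c1 z) (sym (isR w (ie w h))) (≤-reflexive (sym kR))
      ; kIdle = λ w h → ⊥-elim (EXPLORE≢IDLE (trans (sym sR) (subst (λ z → S c1 z ≡ IDLE) (isR w (λ z → IDLE≢INIT (trans (sym h) z))) h)))
      ; kPh2 = λ w h1 h2 → ⊥-elim (ph1≢ph2 (trans (sym phR) (subst (λ z → Ph c1 z ≡ ph2) (exR w h1) h2)))
      ; treeIdle = λ p y h → ⊥-elim (nothing≢just (trans (sym (pN y)) h))
      ; treeDone = λ p y h → ⊥-elim (nothing≢just (trans (sym (pN y)) h))
      ; tree1 = λ p y h → ⊥-elim (nothing≢just (trans (sym (pN y)) h))
      ; tree2 = λ p y h → ⊥-elim (nothing≢just (trans (sym (pN y)) h))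
      ; nb = λ w x e f → ⊥-elim (fin1 w f)
      ; nb3 = λ w x h1 _ e h3 _ → ⊥-elim (h3 (subst (λ z → x ∈ Rm c1 z) (sym (exR w h1)) (subst (x ∈_) (sym rmR) (true⇒∈tabulate (adj r) x (subst (λ z → Edge z x) (exR w h1) e)))))
      ; dMax = λ _ _ → z≤n
      ; nbd = λ w x _ le _ → ⊥-elim (2≰1 (subst (2 ≤_) kR le))
      ; bfs = λ _ _ _ _ _ → z≤n
      }
      where
      2≰1 : ¬ (2 ≤ 1)
      2≰1 (s≤s ())
      ie : ∀ w → S c1 w ≡ EXPLORE ⊎ S c1 w ≡ DONE → Woken c1 w
      ie w (inj₁ h) z with trans (sym h) z
      ... | ()
      ie w (inj₂ h) z with trans (sym h) z
      ... | ()
      rr : ∀ x b → S c1 x ≡ EXPLORE → b ∈ Rm c1 x → Edge x b × P c1 x ≢ just b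
      rr x b h1 h2 with exR x h1
      ... | refl = ∈tabulate⇒true (adj r) b (subst (b ∈_) rmR h2) , (λ z → nothing≢just (trans (sym (pN r)) z))
      cc : ∀ x b → Woken c1 x → b ∈ Cs c1 x → Edge x b × P c1 x ≢ just b
      cc x b ix h with isR x ix
      ... | refl = ∈tabulate⇒true (adj r) b (subst (b ∈_) csR h) , (λ z → nothing≢just (trans (sym (pN r)) z))
      km : ∀ w → K c1 w ≤ suc m
      km w with w ≟ r
      ... | yes refl = s≤s z≤n
      ... | no _ = z≤n
      fin1 : ∀ w → Fin1 c1 w → ⊥
      fin1 w with w ≟ r
      ... | yes refl = λ { (inj₁ (() , _)) ; (inj₂ (inj₁ ())) ; (inj₂ (inj₂ (_ , inj₁ (s≤s ())))) ; (inj₂ (inj₂ (_ , inj₂ ()))) }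
      ... | no _ = λ { (inj₁ (() , _)) ; (inj₂ (inj₁ ())) ; (inj₂ (inj₂ (() , _))) }

  Good : Cfg → Set
  Good c = c ≡ initConfig ⊎ Σ (Fin N → ℕ) (Inv c)

  presStep : ∀ {c c'} → Good c → c ⟶ c' → Good c'
  presStep (inj₁ refl) (rootWake _) = inj₂ (_ , RootWoke.initInv)
  presStep (inj₁ refl) (setParent () _)
  presStep (inj₁ refl) (markSibling () _ _)
  presStep (inj₁ refl) (explore () _ _)
  presStep (inj₁ refl) (reply () _ _)
  presStep (inj₁ refl) (next () _ _)
  presStep (inj₁ refl) (toPhase2 () _ _ _ _)
  presStep (inj₁ refl) (finishDone () _ _ _)
  presStep (inj₁ refl) (finishIdle () _ _ _ _ _)
  presStep (inj₁ refl) (rootRestart () _ _ _ _)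
  presStep (inj₂ (d , I)) (rootWake e) = ⊥-elim (InvFacts.rootWoken I e)
  presStep (inj₂ (d , I)) (setParent {c} {u} {v} {k} e0 e1) = inj₂ (_ , StepSetParent.pres I {u} {v} {k} e0 e1)
  presStep (inj₂ (d , I)) (markSibling {c} {u} {v} {k} e0 e1 e2) = inj₂ (_ , StepMarkSibling.pres I {u} {v} {k} e0 e1 e2)
  presStep (inj₂ (d , I)) (explore {c} {u} {v} {k} e0 e1 e2) = inj₂ (_ , StepExplore.pres I {u} {v} {k} e0 e1 e2)
  presStep (inj₂ (d , I)) (reply {c} {u} {v} {k} e0 e1 e2) = inj₂ (_ , StepReply.pres I {u} {v} {k} e0 e1 e2)
  presStep (inj₂ (d , I)) (next {c} {u} {v} e1 e2 e3) = inj₂ (_ , StepNext.pres I {u} {v} e1 e2 e3)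
  presStep (inj₂ (d , I)) (toPhase2 {c} {u} e1 e2 e3 e4 e5) = inj₂ (_ , StepToPhase2.pres I {u} e1 e2 e3 e4 e5)
  presStep (inj₂ (d , I)) (finishDone {c} {u} e1 e2 e3 e4) = inj₂ (_ , StepFinishDone.pres I {u} e1 e2 e3 e4)
  presStep (inj₂ (d , I)) (finishIdle {c} {u} e1 e2 e3 e4 e5 e6) = inj₂ (_ , StepFinishIdle.pres I {u} e1 e2 e3 e4 e5 e6)
  presStep (inj₂ (d , I)) (rootRestart {c} e1 e2 e3 e4 e5) = inj₂ (_ , StepRootRestart.pres I e1 e2 e3 e4 e5)

  goodReach : ∀ {c} → Reachable c → Good c
  goodReach = Star-invariant Good presStep (inj₁ refl)

  module Prog {c : Cfg} {d : Fin N → ℕ} (I : Inv c d) where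
    open Inv I
    open InvFacts I

    Step : Set
    Step = Σ Cfg (c ⟶_)

    localStep : ∀ x → S c x ≡ EXPLORE → W c x ≡ nothing → Step
    localStep x ex wn with nonempty? (Rm c x)
    ... | yes (v , vin) = _ , next {c} {x} {v} ex wn vin
    ... | no em with phCase (Ph c x)
    ...   | inj₂ p2 = _ , finishDone {c} {x} ex wn em p2
    ...   | inj₁ p1 with K c x ≟ℕ suc m
    ...     | yes kk = _ , toPhase2 {c} {x} ex wn em p1 kk
    ...     | no nk with x ≟ r
    ...       | yes refl = _ , rootRestart {c} ex wn em p1 nk
    ...       | no nr = _ , finishIdle {c} {x} ex wn em p1 nk nr

    consumer : ∀ a b → S c a ≡ EXPLORE → W c a ≡ just b → ch c a b ≡ 1 → Step
    consumer a b ea wa cab = go (S c b) refl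
      where
      sb : S c b ≢ EXPLORE
      sb with proj₂ (proj₂ (proj₂ (chanE a b (λ z → 1+n≢0 (trans (sym cab) z)))))
      ... | inj₁ (_ , _ , z) = z
      ... | inj₂ (_ , _ , z) = ⊥-elim (z ea)
      go : ∀ s → S c b ≡ s → Step
      go INIT e = _ , setParent {c} {b} {a} {0} cab e
      go IDLE e with Maybe.≡-dec _≟_ (P c b) (just a)
      ... | yes pe = _ , explore {c} {b} {a} {0} cab e pe
      ... | no npe = _ , markSibling {c} {b} {a} {0} cab (inj₁ e) npe
      go DONE e with Maybe.≡-dec _≟_ (P c b) (just a)
      ... | no npe = _ , markSibling {c} {b} {a} {0} cab (inj₂ e) npe
      ... | yes pe with phCase (Ph c a)
      ...   | inj₁ p1 with proj₂ (proj₂ (tree1 a b pe ea p1)) wa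
      ...     | inj₁ (_ , x , _) = ⊥-elim (DONE≢IDLE (trans (sym e) x))
      ...     | inj₂ (x , _) = ⊥-elim (1+n≢0 (trans (sym cab) x))
      go DONE e | yes pe | inj₂ p2 with proj₂ (proj₂ (tree2 a b pe ea p2)) wa
      ...     | inj₁ (_ , x , _) = ⊥-elim (DONE≢IDLE (trans (sym e) x))
      ...     | inj₂ (x , _) = ⊥-elim (1+n≢0 (trans (sym cab) x))
      go EXPLORE e = ⊥-elim (sb e)

    -- Follow the waiting exploring nodes down the tree (depth bounded by the
    -- count of the root, measured by f) until one of them can act.
    descend : ∀ f x → S c x ≡ EXPLORE → K c r ≤ d x + f → Step
    descend f x ex le with W c x in wq
    ... | nothing = localStep x ex wq
    ... | just b with waitE x b ex wq
    ...   | inj₁ cxb = consumer x b ex wq cxb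
    ...   | inj₂ (inj₁ cbx) = _ , reply {c} {x} {b} {0} cbx ex wq
    ...   | inj₂ (inj₂ (eb , pb)) = go f le
      where
      db : d b ≡ suc (d x)
      db = proj₂ (proj₂ (paInfo pb))
      go : ∀ f → K c r ≤ d x + f → Step
      go zero le' = ⊥-elim (<-irrefl refl (≤-trans (≤-reflexive (sym db)) (≤-trans (dMax b (explore⇒woken c b eb)) (≤-trans le' (≤-reflexive (+-identityʳ (d x)))))))
      go (suc f') le' = descend f' b eb (≤-trans le' (≤-reflexive (trans (+-suc (d x) f') (sym (cong (_+ f') db)))))

    progress : S c r ≡ EXPLORE → Step
    progress ex = descend (K c r) r ex (≤-reflexive (cong (_+ K c r) (sym rootD)))

    allDone : S c r ≡ DONE → ∀ k w → d w ≡ k → Woken c w → S c w ≡ DONE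
    allDone dr zero w dw iw with dZeroRoot iw dw
    ... | refl = dr
    allDone dr (suc k) w dw iw with w ≟ r
    ... | yes refl = dr
    ... | no ne with par w ne iw
    ...   | p , pe , _ , ip , dd = treeDone p w pe (allDone dr k p (suc-injective (trans (sym dd) dw)) ip)

    reachIni : S c r ≡ DONE → ∀ a b → Reach G a b → Woken c a → Woken c b
    reachIni dr a .a here ia = ia
    reachIni dr a b (step {v = v} e rest) ia = reachIni dr v b rest
      (nb a v e (inj₂ (inj₁ (allDone dr (d a) a refl ia))))

    part2 : Connected G → S c r ≡ DONE → ∀ u → S c u ≡ DONE
    part2 conn dr u = allDone dr (d u) u refl (reachIni dr r u (conn r u) (rootWoken))

  correct : Connected G →
    ((c : Config N) → Reachable c → Terminal c → (u : Fin N) → status (loc c u) ≡ DONE)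
    × ((c : Config N) → Reachable c → status (loc c r) ≡ DONE → (u : Fin N) → status (loc c u) ≡ DONE)
  correct conn = terminal⇒done , rootDone⇒done
    where
    rootDone⇒done : (c : Config N) → Reachable c → status (loc c r) ≡ DONE → (u : Fin N) → status (loc c u) ≡ DONE
    rootDone⇒done c rc dr with goodReach rc
    ... | inj₁ refl = ⊥-elim (DONE≢INIT (sym dr))
    ... | inj₂ (d , I) = Prog.part2 I conn dr
    -- a terminal configuration is past the root's wake-up, and the root is not exploring
    terminal⇒done : (c : Config N) → Reachable c → Terminal c → (u : Fin N) → status (loc c u) ≡ DONE
    terminal⇒done c rc tc with goodReach rc
    ... | inj₁ refl = ⊥-elim (tc _ (rootWake refl))
    ... | inj₂ (d , I) with Inv.rootSt I
    ...   | inj₁ ex = ⊥-elim (tc _ (proj₂ (Prog.progress I ex)))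
    ...   | inj₂ dr = Prog.part2 I conn dr

-- A single node: the root restarts Explore forever (its count never equals
-- n - 1 = 0), no configuration is terminal and the root is never DONE.
module SingleNode (G : Graph 1) (r : Fin 1) where
  open Algorithm G r
  open Graph G using (adj; 𝒩; irrefl)

  one : ∀ (a b : Fin 1) → a ≡ b
  one fz fz = refl

  emptyN : Empty (𝒩 r)
  emptyN (x , h) with one x r
  ... | refl with trans (sym (∈tabulate⇒true (adj r) r h)) (irrefl r)
  ...   | ()

  emptyO : ∀ mp → Empty (others r mp)
  emptyO nothing = emptyN
  emptyO (just p) (x , h) = emptyN (x , x∈p-y⇒x∈p (𝒩 r) x p h)

  St : Config 1 → Set
  St c = status (loc c r) ≡ EXPLORE × waiting (loc c r) ≡ nothing × phase (loc c r) ≡ ph1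
       × Empty (rem (loc c r)) × 1 ≤ count (loc c r) × (∀ a b → chan c a b ≡ 0)

  Good : Config 1 → Set
  Good c = c ≡ initConfig ⊎ St c

  pres : ∀ {c c'} → Good c → c ⟶ c' → Good c'
  pres (inj₁ refl) (rootWake _) = inj₂ (h1 , h2 , h3 , h4 , h5 , λ _ _ → refl)
    where
    L : Local 1
    L = beginExplore r (record (initLocal {1}) { status = IDLE ; parent = nothing ; children = 𝒩 r ; count = 0 })
    h1 : status (upd (λ _ → initLocal) r L r) ≡ EXPLORE
    h1 rewrite upd-here (λ (_ : Fin 1) → initLocal {1}) r L = refl
    h2 : waiting (upd (λ _ → initLocal) r L r) ≡ nothing
    h2 rewrite upd-here (λ (_ : Fin 1) → initLocal {1}) r L = refl
    h3 : phase (upd (λ _ → initLocal) r L r) ≡ ph1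
    h3 rewrite upd-here (λ (_ : Fin 1) → initLocal {1}) r L = refl
    h4 : Empty (rem (upd (λ _ → initLocal) r L r))
    h4 rewrite upd-here (λ (_ : Fin 1) → initLocal {1}) r L = emptyN
    h5 : 1 ≤ count (upd (λ _ → initLocal) r L r)
    h5 rewrite upd-here (λ (_ : Fin 1) → initLocal {1}) r L = s≤s z≤n
  pres (inj₁ refl) (setParent () _)
  pres (inj₁ refl) (markSibling () _ _)
  pres (inj₁ refl) (explore () _ _)
  pres (inj₁ refl) (reply () _ _)
  pres (inj₁ refl) (next () _ _)
  pres (inj₁ refl) (toPhase2 () _ _ _ _)
  pres (inj₁ refl) (finishDone () _ _ _)
  pres (inj₁ refl) (finishIdle () _ _ _ _ _)
  pres (inj₁ refl) (rootRestart () _ _ _ _)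
  pres (inj₂ (s , _)) (rootWake e) with trans (sym s) e
  ... | ()
  pres (inj₂ (_ , _ , _ , _ , _ , z)) (setParent {c} {u} {v} e0 _) with trans (sym (z v u)) e0
  ... | ()
  pres (inj₂ (_ , _ , _ , _ , _ , z)) (markSibling {c} {u} {v} e0 _ _) with trans (sym (z v u)) e0
  ... | ()
  pres (inj₂ (_ , _ , _ , _ , _ , z)) (explore {c} {u} {v} e0 _ _) with trans (sym (z v u)) e0
  ... | ()
  pres (inj₂ (_ , _ , _ , _ , _ , z)) (reply {c} {u} {v} e0 _ _) with trans (sym (z v u)) e0
  ... | ()
  pres (inj₂ (_ , _ , _ , em , _ , _)) (next {c} {u} {v} _ _ e3) with one u r
  ... | refl = ⊥-elim (em (v , e3))
  pres (inj₂ (_ , _ , _ , _ , k1 , _)) (toPhase2 {c} {u} _ _ _ _ e5) with one u r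
  ... | refl with subst (1 ≤_) e5 k1
  ...   | ()
  pres (inj₂ (_ , _ , p1 , _ , _ , _)) (finishDone {c} {u} _ _ _ e4) with one u r
  ... | refl with trans (sym p1) e4
  ...   | ()
  pres (inj₂ _) (finishIdle {c} {u} _ _ _ _ _ e6) = ⊥-elim (e6 (one u r))
  pres (inj₂ (_ , _ , _ , _ , k1 , z)) (rootRestart {c} _ _ _ _ _) = inj₂ (h1 , h2 , h3 , h4 , h5 , z)
    where
    L : Local 1
    L = beginExplore r (record (loc c r) { status = IDLE })
    h1 : status (upd (loc c) r L r) ≡ EXPLORE
    h1 rewrite upd-here (loc c) r L = refl
    h2 : waiting (upd (loc c) r L r) ≡ nothing
    h2 rewrite upd-here (loc c) r L = refl
    h3 : phase (upd (loc c) r L r) ≡ ph1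
    h3 rewrite upd-here (loc c) r L = refl
    h4 : Empty (rem (upd (loc c) r L r))
    h4 rewrite upd-here (loc c) r L = emptyO (parent (loc c r))
    h5 : 1 ≤ count (upd (loc c) r L r)
    h5 rewrite upd-here (loc c) r L = s≤s z≤n

  goodReach : ∀ {c} → Reachable c → Good c
  goodReach = Star-invariant Good pres (inj₁ refl)

  neverTerminal : (c : Config 1) → Reachable c → ¬ Terminal c
  neverTerminal c rc tc with goodReach rc
  ... | inj₁ refl = tc _ (rootWake refl)
  ... | inj₂ (s , w , p , em , k1 , _) = tc _ (rootRestart s w em p count≢0)
    where
    count≢0 : count (loc c r) ≢ 0
    count≢0 e with subst (1 ≤_) e k1
    ... | ()

  rootNeverDone : (c : Config 1) → Reachable c → status (loc c r) ≢ DONE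
  rootNeverDone c rc dr with goodReach rc
  ... | inj₁ refl = DONE≢INIT (sym dr)
  ... | inj₂ (s , _) = EXPLORE≢DONE (trans (sym s) dr)

  correct : ((c : Config 1) → Reachable c → Terminal c → (u : Fin 1) → status (loc c u) ≡ DONE)
    × ((c : Config 1) → Reachable c → status (loc c r) ≡ DONE → (u : Fin 1) → status (loc c u) ≡ DONE)
  correct = (λ c rc tc → ⊥-elim (neverTerminal c rc tc)) , (λ c rc dr → ⊥-elim (rootNeverDone c rc dr))

claim4 : {n : ℕ} (G : Graph n) → Connected G → (r : Fin n) →
    let open Algorithm G r in
    ((c : Config n) → Reachable c → Terminal c →
       (u : Fin n) → status (loc c u) ≡ DONE)
    × ((c : Config n) → Reachable c → status (loc c r) ≡ DONE →
       (u : Fin n) → status (loc c u) ≡ DONE)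
claim4 {zero} G conn ()
claim4 {suc zero} G conn r = SingleNode.correct G r
claim4 {suc (suc m)} G conn r = BFS.correct G r conn
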